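{- Let $n\ge1$ and $m\ge0$ be integers and $x$ an indeterminate. Let $$T_{n,m}(x)=\left[\binom{x+m}{j-i+m}-\binom{x+m}{m-i-j-1}\right]_{i,j=0}^{n-1},\qquad B_{n,m}(x)=\left[\binom{x+m+2i}{i-j+m}-\binom{x+m+2i}{i-j+m-1}\right]_{i,j=0}^{n-1}.$$ Then $\det T_{n,m}(x)=\det B_{n,m}(x)$, and consequently $$\det T_{n,m}(x)=\prod_{i=1}^n\prod_{j=1}^m\frac{(x+i-j)(x+2i+j-2)}{(x+2i-j)(i+j-1)}.$$
   Context: For $z$ an indeterminate and $k$ an integer, $\binom{z}{k}=z(z-1)\cdots(z-k+1)/k!$ if $k\ge0$ and $\binom{z}{k}=0$ if $k<0$. The identities are identities of rational functions in $x$. -}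

module Defs where

open import Data.Nat as ℕ using (ℕ; zero; suc)
open import Data.Integer as ℤ using (ℤ; +_; -[1+_])
open import Data.Fin as Fin using (Fin; toℕ; punchIn)
open import Data.Rational as ℚ using (ℚ; 0ℚ; 1ℚ; _+_; _*_; _-_; -_; _÷_; ≢-nonZero)
open import Data.Rational.Properties using (_≟_)
open import Relation.Nullary using (yes; no)

ℕ→ℚ : ℕ → ℚ
ℕ→ℚ n = (+ n) ℚ./ 1

ℤ→ℚ : ℤ → ℚ
ℤ→ℚ z = z ℚ./ 1

-- Total division on ℚ (only used where the divisor is assumed nonzero).
_÷′_ : ℚ → ℚ → ℚ
p ÷′ q with q ≟ 0ℚ
... | yes _ = 0ℚ
... | no q≢0 = _÷_ p q {{≢-nonZero q≢0}}

binomℕ : ℚ → ℕ → ℚ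
binomℕ z zero = 1ℚ
binomℕ z (suc k) = binomℕ z k * (z - ℕ→ℚ k) * ((+ 1) ℚ./ suc k)

binom : ℚ → ℤ → ℚ
binom z (+ k) = binomℕ z k
binom z -[1+ _ ] = 0ℚ

Σᶠ : (n : ℕ) → (Fin n → ℚ) → ℚ
Σᶠ zero f = 0ℚ
Σᶠ (suc n) f = f Fin.zero + Σᶠ n (λ i → f (Fin.suc i))

∏₁ : ℕ → (ℕ → ℚ) → ℚ
∏₁ zero f = 1ℚ
∏₁ (suc n) f = ∏₁ n f * f (suc n)

Matrix : ℕ → Set
Matrix n = Fin n → Fin n → ℚ

sign : ℕ → ℚ
sign zero = 1ℚ
sign (suc k) = - sign k

det : (n : ℕ) → Matrix n → ℚ
det zero A = 1ℚ
det (suc n) A =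
  Σᶠ (suc n) (λ j → sign (toℕ j) * A Fin.zero j
                    * det n (λ r c → A (Fin.suc r) (punchIn j c)))

T : (n m : ℕ) → ℚ → Matrix n
T n m x i j =
  binom (x + ℕ→ℚ m) ((+ toℕ j) ℤ.- (+ toℕ i) ℤ.+ (+ m))
  - binom (x + ℕ→ℚ m) ((+ m) ℤ.- (+ toℕ i) ℤ.- (+ toℕ j) ℤ.- (+ 1))

B : (n m : ℕ) → ℚ → Matrix n
B n m x i j =
  binom (x + ℕ→ℚ m + ℕ→ℚ (2 ℕ.* toℕ i)) ((+ toℕ i) ℤ.- (+ toℕ j) ℤ.+ (+ m))
  - binom (x + ℕ→ℚ m + ℕ→ℚ (2 ℕ.* toℕ i)) ((+ toℕ i) ℤ.- (+ toℕ j) ℤ.+ (+ m) ℤ.- (+ 1))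

rhs : (n m : ℕ) → ℚ → ℚ
rhs n m x = ∏₁ n (λ i → ∏₁ m (λ j →
  ((x + ℕ→ℚ i - ℕ→ℚ j) * (x + ℕ→ℚ (2 ℕ.* i) + ℕ→ℚ j - ℕ→ℚ 2))
  ÷′ ((x + ℕ→ℚ (2 ℕ.* i) - ℕ→ℚ j) * (ℕ→ℚ i + ℕ→ℚ j - 1ℚ))))

module Submission where

-- Stage r of a sequence of column operations has, in every column j ≥ r, the entries
-- C(x+m+2r, m−i+j) − C(x+m+2r, m−i+2r−1−j).  Stage 0 is T, and passing from stage r to r+1
-- adds to column j twice column j−1 and once column j−2 (Pascal's rule applied twice), the
-- first step using the antisymmetry of stage r about column r − 1/2 instead.  Column r never
-- changes again and equals column r of Bᵀ, so after n stages the matrix is Bᵀ.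
--
-- For the product, the entries of Bᵀ are, after rescaling rows and columns, those of a
-- Krattenthaler-type matrix K with K i k = ∏_{i<l<n} (k + x + l + 1) · ∏_{1≤l≤i} (k + m − l + 1).
-- Differences of consecutive rows of K, together with det [p i k] = det [Δᵏ p i 0] for
-- polynomials p i, give det K_{n+1} = ρ_n · det K_n, hence
-- det B_{n+1} · den_{n+1} = det B_n · num_{n+1} whenever the scaling factors are nonzero,
-- e.g. for x > 0.  Finally det T · ∏ den − ∏ num is a polynomial in x vanishing at x + k for
-- all large k, so it vanishes identically, and dividing by ∏ den gives the formula.

open import Defs
open import Data.Nat as ℕ using (ℕ; zero; suc; _≤_; _<_; z≤n; s≤s; _∸_; _!; _*_)
import Data.Nat.Properties as ℕP
open import Data.Nat.Coprimality using (1-coprimeTo)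
import Data.Nat.Coprimality as Coprimality
open import Data.Integer as ℤ using (ℤ; -[1+_]; _⊖_)
import Data.Integer.Properties as ℤP
open import Data.Rational as ℚ using (ℚ; mkℚ; 0ℚ; 1ℚ; _+_; _-_; -_) renaming (_*_ to _·_)
import Data.Rational.Properties as ℚP
import Algebra.Properties.Group ℚP.+-0-group as +-Group
open import Data.Fin as Fin using (Fin; toℕ; punchIn)
open import Function using (_∘_)
open import Data.Product using (Σ; _×_; _,_; proj₁; proj₂)
open import Data.Sum using (inj₁; inj₂)
open import Data.Empty using (⊥-elim)
open import Relation.Nullary using (yes; no)
open import Relation.Nullary.Decidable using (dec⇒maybe)
open import Relation.Binary using (tri<; tri≈; tri>)
open import Relation.Binary.PropositionalEquality using (_≡_; _≢_; refl; sym; trans; cong; cong₂; subst; subst₂; module ≡-Reasoning)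
import Tactic.RingSolver.Core.AlmostCommutativeRing as ACR
open import Tactic.RingSolver using (solve-∀)
import Data.Nat.Tactic.RingSolver as ℕ-Solver
import Data.Integer.Tactic.RingSolver as ℤ-Solver

ℚ-ring : ACR.AlmostCommutativeRing _ _
ℚ-ring = ACR.fromCommutativeRing ℚP.+-*-commutativeRing (λ x → dec⇒maybe (0ℚ ℚP.≟ x))

coprime-1 : ∀ n → Coprimality.Coprime n 1
coprime-1 n = Coprimality.sym (1-coprimeTo n)

ℕ→ℚ≡mkℚ : ∀ n → ℕ→ℚ n ≡ mkℚ (ℤ.+ n) 0 (coprime-1 n)
ℕ→ℚ≡mkℚ n = ℚP.normalize-coprime (coprime-1 n)

ℕ→ℚ-+ : ∀ a b → ℕ→ℚ (a ℕ.+ b) ≡ ℕ→ℚ a + ℕ→ℚ b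
ℕ→ℚ-+ a b = begin
  ℕ→ℚ (a ℕ.+ b) ≡⟨ cong (λ z → z ℚ./ 1) +-as-*1 ⟩
  (ℤ.+ a ℤ.* ℤ.+ 1 ℤ.+ ℤ.+ b ℤ.* ℤ.+ 1) ℚ./ 1 ≡⟨⟩
  mkℚ (ℤ.+ a) 0 (coprime-1 a) + mkℚ (ℤ.+ b) 0 (coprime-1 b) ≡⟨ sym (cong₂ _+_ (ℕ→ℚ≡mkℚ a) (ℕ→ℚ≡mkℚ b)) ⟩
  ℕ→ℚ a + ℕ→ℚ b ∎
  where
  open ≡-Reasoning
  +-as-*1 : ℤ.+ (a ℕ.+ b) ≡ ℤ.+ a ℤ.* ℤ.+ 1 ℤ.+ ℤ.+ b ℤ.* ℤ.+ 1
  +-as-*1 = sym (cong₂ ℤ._+_ (ℤP.*-identityʳ (ℤ.+ a)) (ℤP.*-identityʳ (ℤ.+ b)))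

ℕ→ℚ-* : ∀ a b → ℕ→ℚ (a * b) ≡ ℕ→ℚ a · ℕ→ℚ b
ℕ→ℚ-* a b = begin
  ℕ→ℚ (a * b) ≡⟨ cong (λ z → z ℚ./ 1) (ℤP.pos-* a b) ⟩
  (ℤ.+ a ℤ.* ℤ.+ b) ℚ./ 1 ≡⟨⟩
  mkℚ (ℤ.+ a) 0 (coprime-1 a) · mkℚ (ℤ.+ b) 0 (coprime-1 b) ≡⟨ sym (cong₂ _·_ (ℕ→ℚ≡mkℚ a) (ℕ→ℚ≡mkℚ b)) ⟩
  ℕ→ℚ a · ℕ→ℚ b ∎
  where open ≡-Reasoning

ℕ→ℚ-suc : ∀ n → ℕ→ℚ (suc n) ≡ ℕ→ℚ n + 1ℚ
ℕ→ℚ-suc n = trans (cong ℕ→ℚ (ℕP.+-comm 1 n)) (ℕ→ℚ-+ n 1)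

ℕ→ℚ-∸ : ∀ a b → b ≤ a → ℕ→ℚ (a ∸ b) ≡ ℕ→ℚ a - ℕ→ℚ b
ℕ→ℚ-∸ a b b≤a = begin
  ℕ→ℚ (a ∸ b) ≡⟨ regroup (ℕ→ℚ (a ∸ b)) (ℕ→ℚ b) ⟩
  (ℕ→ℚ (a ∸ b) + ℕ→ℚ b) - ℕ→ℚ b ≡⟨ cong (_- ℕ→ℚ b) (sym (ℕ→ℚ-+ (a ∸ b) b)) ⟩
  ℕ→ℚ (a ∸ b ℕ.+ b) - ℕ→ℚ b ≡⟨ cong (λ w → ℕ→ℚ w - ℕ→ℚ b) (ℕP.m∸n+n≡m b≤a) ⟩
  ℕ→ℚ a - ℕ→ℚ b ∎
  where
  open ≡-Reasoning
  regroup : ∀ u v → u ≡ (u + v) - v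
  regroup = solve-∀ ℚ-ring

ℕ→ℚ-2* : ∀ k → ℕ→ℚ (2 * k) ≡ ℕ→ℚ k + ℕ→ℚ k
ℕ→ℚ-2* k = trans (ℕ→ℚ-+ k (k ℕ.+ 0)) (cong (ℕ→ℚ k +_) (cong ℕ→ℚ (ℕP.+-identityʳ k)))

ℕ→ℚ-!-suc : ∀ d → ℕ→ℚ (suc d !) ≡ ℕ→ℚ (suc d) · ℕ→ℚ (d !)
ℕ→ℚ-!-suc d = ℕ→ℚ-* (suc d) (d !)

cong₃ : ∀ {A B C D : Set} (f : A → B → C → D) {a a' b b' c c'} → a ≡ a' → b ≡ b' → c ≡ c' → f a b c ≡ f a' b' c'
cong₃ f refl refl refl = refl

x-y≡x+-1·y : ∀ x y → x - y ≡ x + (- 1ℚ) · y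
x-y≡x+-1·y = solve-∀ ℚ-ring

∑ : ℕ → (ℕ → ℚ) → ℚ
∑ zero f = 0ℚ
∑ (suc n) f = f 0 + ∑ n (λ k → f (suc k))

∏ : ℕ → (ℕ → ℚ) → ℚ
∏ zero f = 1ℚ
∏ (suc n) f = ∏ n f · f n

∑-cong : ∀ n (f g : ℕ → ℚ) → (∀ k → k < n → f k ≡ g k) → ∑ n f ≡ ∑ n g
∑-cong zero f g h = refl
∑-cong (suc n) f g h = cong₂ _+_ (h 0 (s≤s z≤n)) (∑-cong n _ _ (λ k k<n → h (suc k) (s≤s k<n)))

∑-+ : ∀ n (f g : ℕ → ℚ) → ∑ n (λ k → f k + g k) ≡ ∑ n f + ∑ n g
∑-+ zero f g = refl
∑-+ (suc n) f g = begin
  (f 0 + g 0) + ∑ n (λ k → f (suc k) + g (suc k)) ≡⟨ cong (λ z → (f 0 + g 0) + z) (∑-+ n _ _) ⟩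
  (f 0 + g 0) + (∑ n (λ k → f (suc k)) + ∑ n (λ k → g (suc k))) ≡⟨ regroup (f 0) (g 0) _ _ ⟩
  (f 0 + ∑ n (λ k → f (suc k))) + (g 0 + ∑ n (λ k → g (suc k))) ∎
  where
  open ≡-Reasoning
  regroup : ∀ a b c d → (a + b) + (c + d) ≡ (a + c) + (b + d)
  regroup = solve-∀ ℚ-ring

∑-scale : ∀ n c (f : ℕ → ℚ) → ∑ n (λ k → c · f k) ≡ c · ∑ n f
∑-scale zero c f = sym (ℚP.*-zeroʳ c)
∑-scale (suc n) c f = trans (cong (λ z → c · f 0 + z) (∑-scale n c _)) (sym (ℚP.*-distribˡ-+ c (f 0) _))

∑-zero : ∀ n (f : ℕ → ℚ) → (∀ k → k < n → f k ≡ 0ℚ) → ∑ n f ≡ 0ℚ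
∑-zero zero f h = refl
∑-zero (suc n) f h = trans (cong₂ _+_ (h 0 (s≤s z≤n)) (∑-zero n _ (λ k k<n → h (suc k) (s≤s k<n)))) refl

∑-snoc : ∀ n (f : ℕ → ℚ) → ∑ (suc n) f ≡ ∑ n f + f n
∑-snoc zero f = trans (ℚP.+-identityʳ (f 0)) (sym (ℚP.+-identityˡ (f 0)))
∑-snoc (suc n) f = begin
  f 0 + ∑ (suc n) (λ k → f (suc k)) ≡⟨ cong (λ z → f 0 + z) (∑-snoc n _) ⟩
  f 0 + (∑ n (λ k → f (suc k)) + f (suc n)) ≡⟨ sym (ℚP.+-assoc (f 0) _ _) ⟩
  (f 0 + ∑ n (λ k → f (suc k))) + f (suc n) ∎
  where open ≡-Reasoning

∑-comm : ∀ n p (f : ℕ → ℕ → ℚ) → ∑ n (λ i → ∑ p (λ j → f i j)) ≡ ∑ p (λ j → ∑ n (λ i → f i j))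
∑-comm zero p f = sym (∑-zero p _ (λ _ _ → refl))
∑-comm (suc n) p f = begin
  ∑ p (λ j → f 0 j) + ∑ n (λ i → ∑ p (λ j → f (suc i) j))
    ≡⟨ cong (λ z → ∑ p (λ j → f 0 j) + z) (∑-comm n p _) ⟩
  ∑ p (λ j → f 0 j) + ∑ p (λ j → ∑ n (λ i → f (suc i) j)) ≡⟨ sym (∑-+ p _ _) ⟩
  ∑ p (λ j → f 0 j + ∑ n (λ i → f (suc i) j)) ∎
  where open ≡-Reasoning

∏-cong : ∀ n (f g : ℕ → ℚ) → (∀ k → k < n → f k ≡ g k) → ∏ n f ≡ ∏ n g
∏-cong zero f g h = refl
∏-cong (suc n) f g h = cong₂ _·_ (∏-cong n f g (λ k k<n → h k (ℕP.m<n⇒m<1+n k<n))) (h n ℕP.≤-refl)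

∏-· : ∀ n (f g : ℕ → ℚ) → ∏ n (λ k → f k · g k) ≡ ∏ n f · ∏ n g
∏-· zero f g = refl
∏-· (suc n) f g = trans (cong (_· (f n · g n)) (∏-· n f g)) (regroup (∏ n f) (∏ n g) (f n) (g n))
  where
  regroup : ∀ a b c d → (a · b) · (c · d) ≡ (a · c) · (b · d)
  regroup = solve-∀ ℚ-ring

∏-cons : ∀ n (f : ℕ → ℚ) → ∏ (suc n) f ≡ f 0 · ∏ n (λ k → f (suc k))
∏-cons zero f = trans (ℚP.*-identityˡ (f 0)) (sym (ℚP.*-identityʳ (f 0)))
∏-cons (suc n) f = trans (cong (_· f (suc n)) (∏-cons n f)) (ℚP.*-assoc (f 0) _ _)

-- Determinants of ℕ-indexed matrices

punchInℕ : ℕ → ℕ → ℕ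
punchInℕ zero c = suc c
punchInℕ (suc j) zero = zero
punchInℕ (suc j) (suc c) = suc (punchInℕ j c)

Matrixℕ : Set
Matrixℕ = ℕ → ℕ → ℚ

minor : Matrixℕ → ℕ → Matrixℕ
minor M j r c = M (suc r) (punchInℕ j c)

-- Laplace expansion along row 0 as for det in Defs, on ℕ-indexed matrices
-- (entries outside the n × n corner are ignored).
detℕ : ℕ → Matrixℕ → ℚ
detℕ zero M = 1ℚ
detℕ (suc n) M = ∑ (suc n) (λ j → sign j · M 0 j · detℕ n (minor M j))

toℕ-punchIn : ∀ {n} (j : Fin (suc n)) (c : Fin n) → toℕ (punchIn j c) ≡ punchInℕ (toℕ j) (toℕ c)
toℕ-punchIn Fin.zero c = refl
toℕ-punchIn (Fin.suc j) Fin.zero = refl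
toℕ-punchIn (Fin.suc j) (Fin.suc c) = cong suc (toℕ-punchIn j c)

Σᶠ≡∑ : ∀ n (f : Fin n → ℚ) (g : ℕ → ℚ) → (∀ j → f j ≡ g (toℕ j)) → Σᶠ n f ≡ ∑ n g
Σᶠ≡∑ zero f g h = refl
Σᶠ≡∑ (suc n) f g h = cong₂ _+_ (h Fin.zero) (Σᶠ≡∑ n _ _ (λ j → h (Fin.suc j)))

det≡detℕ : ∀ n (A : Matrix n) (M : Matrixℕ) → (∀ i j → A i j ≡ M (toℕ i) (toℕ j)) → det n A ≡ detℕ n M
det≡detℕ zero A M h = refl
det≡detℕ (suc n) A M h = Σᶠ≡∑ (suc n) _ (λ j → sign j · M 0 j · detℕ n (minor M j)) λ j →
  cong₂ _·_ (cong (sign (toℕ j) ·_) (h Fin.zero j))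
    (det≡detℕ n (λ r c → A (Fin.suc r) (punchIn j c)) (minor M (toℕ j)) λ r c → trans (h (Fin.suc r) (punchIn j c)) (cong (M (suc (toℕ r))) (toℕ-punchIn j c)))

punchInℕ-< : ∀ j k → k < j → punchInℕ j k ≡ k
punchInℕ-< (suc j) zero _ = refl
punchInℕ-< (suc j) (suc k) (s≤s k<j) = cong suc (punchInℕ-< j k k<j)

punchInℕ-≥ : ∀ j k → j ≤ k → punchInℕ j k ≡ suc k
punchInℕ-≥ zero k _ = refl
punchInℕ-≥ (suc j) (suc k) (s≤s j≤k) = cong suc (punchInℕ-≥ j k j≤k)

punchInℕ-bounded : ∀ n j k → k < n → punchInℕ j k < suc n
punchInℕ-bounded n zero k k<n = s≤s k<n
punchInℕ-bounded (suc n) (suc j) zero k<n = s≤s z≤n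
punchInℕ-bounded (suc n) (suc j) (suc k) (s≤s k<n) = s≤s (punchInℕ-bounded n j k k<n)

detℕ-cong : ∀ n (M M' : Matrixℕ) → (∀ i j → i < n → j < n → M i j ≡ M' i j) → detℕ n M ≡ detℕ n M'
detℕ-cong zero M M' h = refl
detℕ-cong (suc n) M M' h = ∑-cong (suc n) _ _ λ j j<n →
  cong₂ _·_ (cong (sign j ·_) (h 0 j (s≤s z≤n) j<n))
    (detℕ-cong n _ _ λ r c r<n c<n → h (suc r) (punchInℕ j c) (s≤s r<n) (punchInℕ-bounded n j c c<n))

punchInℕ-injective : ∀ j k k' → punchInℕ j k ≡ punchInℕ j k' → k ≡ k'
punchInℕ-injective zero k k' e = ℕP.suc-injective e
punchInℕ-injective (suc j) zero zero e = refl
punchInℕ-injective (suc j) zero (suc k') ()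
punchInℕ-injective (suc j) (suc k) zero ()
punchInℕ-injective (suc j) (suc k) (suc k') e = cong suc (punchInℕ-injective j k k' (ℕP.suc-injective e))

punchInℕ-≢ : ∀ j k → punchInℕ j k ≢ j
punchInℕ-≢ zero k ()
punchInℕ-≢ (suc j) zero ()
punchInℕ-≢ (suc j) (suc k) e = punchInℕ-≢ j k (ℕP.suc-injective e)

punchInℕ-hits : ∀ n j c → j < suc n → c < suc n → j ≢ c → Σ ℕ (λ c' → c' < n × punchInℕ j c' ≡ c)
punchInℕ-hits n j c j<n c<n j≢c with ℕP.<-cmp c j
... | tri< c<j _ _ = c , ℕP.<-≤-trans c<j (ℕP.≤-pred j<n) , punchInℕ-< j c c<j
... | tri≈ _ c≡j _ = ⊥-elim (j≢c (sym c≡j))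
punchInℕ-hits n j (suc c'') j<n (s≤s c<n) j≢c | tri> _ _ (s≤s j≤c) = c'' , c<n , punchInℕ-≥ j c'' j≤c

detℕ-linear-col : ∀ n c → c < n → (M₁ M₂ M₃ : Matrixℕ) (a b : ℚ)
  → (∀ i j → i < n → j < n → j ≢ c → M₁ i j ≡ M₃ i j)
  → (∀ i j → i < n → j < n → j ≢ c → M₂ i j ≡ M₃ i j)
  → (∀ i → i < n → M₃ i c ≡ a · M₁ i c + b · M₂ i c)
  → detℕ n M₃ ≡ a · detℕ n M₁ + b · detℕ n M₂
detℕ-linear-col (suc n) c c<n M₁ M₂ M₃ a b h₁ h₂ h₃ = begin
  ∑ (suc n) t3 ≡⟨ ∑-cong (suc n) t3 _ termwise ⟩
  ∑ (suc n) (λ j → a · t1 j + b · t2 j) ≡⟨ ∑-+ (suc n) (λ j → a · t1 j) (λ j → b · t2 j) ⟩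
  ∑ (suc n) (λ j → a · t1 j) + ∑ (suc n) (λ j → b · t2 j)
    ≡⟨ cong₂ _+_ (∑-scale (suc n) a t1) (∑-scale (suc n) b t2) ⟩
  a · ∑ (suc n) t1 + b · ∑ (suc n) t2 ∎
  where
  open ≡-Reasoning
  t1 t2 t3 : ℕ → ℚ
  t1 j = sign j · M₁ 0 j · detℕ n (minor M₁ j)
  t2 j = sign j · M₂ 0 j · detℕ n (minor M₂ j)
  t3 j = sign j · M₃ 0 j · detℕ n (minor M₃ j)
  regroup₁ : ∀ s a b x y d → s · (a · x + b · y) · d ≡ a · (s · x · d) + b · (s · y · d)
  regroup₁ = solve-∀ ℚ-ring
  regroup₂ : ∀ s e a b d1 d2 → s · e · (a · d1 + b · d2) ≡ a · (s · e · d1) + b · (s · e · d2)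
  regroup₂ = solve-∀ ℚ-ring
  termwise : ∀ j → j < suc n → t3 j ≡ a · t1 j + b · t2 j
  termwise j j<n with j ℕ.≟ c
  ... | yes refl = begin
      sign j · M₃ 0 j · detℕ n (minor M₃ j)
        ≡⟨ cong (λ z → sign j · z · detℕ n (minor M₃ j)) (h₃ 0 (s≤s z≤n)) ⟩
      sign j · (a · M₁ 0 j + b · M₂ 0 j) · detℕ n (minor M₃ j)
        ≡⟨ regroup₁ (sign j) a b (M₁ 0 j) (M₂ 0 j) (detℕ n (minor M₃ j)) ⟩
      a · (sign j · M₁ 0 j · detℕ n (minor M₃ j)) + b · (sign j · M₂ 0 j · detℕ n (minor M₃ j))
        ≡⟨ cong₂ (λ u v → a · (sign j · M₁ 0 j · u) + b · (sign j · M₂ 0 j · v)) (sym (minor-agrees M₁ h₁)) (sym (minor-agrees M₂ h₂)) ⟩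
      a · t1 j + b · t2 j ∎
    where
    minor-agrees : ∀ (Mk : Matrixℕ) → (∀ i j → i < suc n → j < suc n → j ≢ c → Mk i j ≡ M₃ i j)
      → detℕ n (minor Mk c)
      ≡ detℕ n (minor M₃ c)
    minor-agrees Mk hk = detℕ-cong n _ _ λ r k r<n k<n → hk (suc r) (punchInℕ c k) (s≤s r<n) (punchInℕ-bounded n c k k<n) (punchInℕ-≢ c k)
  ... | no j≢c = begin
      sign j · M₃ 0 j · detℕ n (minor M₃ j) ≡⟨ cong (sign j · M₃ 0 j ·_) ih ⟩
      sign j · M₃ 0 j · (a · detℕ n (minor M₁ j) + b · detℕ n (minor M₂ j))
        ≡⟨ regroup₂ (sign j) (M₃ 0 j) a b (detℕ n (minor M₁ j)) (detℕ n (minor M₂ j)) ⟩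
      a · (sign j · M₃ 0 j · detℕ n (minor M₁ j)) + b · (sign j · M₃ 0 j · detℕ n (minor M₂ j))
        ≡⟨ cong₂ (λ u v → a · (sign j · u · detℕ n (minor M₁ j)) + b · (sign j · v · detℕ n (minor M₂ j)))
             (sym (h₁ 0 j (s≤s z≤n) j<n j≢c)) (sym (h₂ 0 j (s≤s z≤n) j<n j≢c)) ⟩
      a · t1 j + b · t2 j ∎
    where
    hit = punchInℕ-hits n j c j<n c<n j≢c
    c' = proj₁ hit
    c'<n = proj₁ (proj₂ hit)
    pc = proj₂ (proj₂ hit)
    misses-c : ∀ k → k ≢ c' → punchInℕ j k ≢ c
    misses-c k k≢c' e = k≢c' (punchInℕ-injective j k c' (trans e (sym pc)))
    ih : detℕ n (minor M₃ j) ≡ a · detℕ n (minor M₁ j) + b · detℕ n (minor M₂ j)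
    ih = detℕ-linear-col n c' c'<n (minor M₁ j) (minor M₂ j) (minor M₃ j) a b
      (λ r k r<n k<n k≢c' → h₁ (suc r) (punchInℕ j k) (s≤s r<n) (punchInℕ-bounded n j k k<n) (misses-c k k≢c'))
      (λ r k r<n k<n k≢c' → h₂ (suc r) (punchInℕ j k) (s≤s r<n) (punchInℕ-bounded n j k k<n) (misses-c k k≢c'))
      (λ r r<n → subst (λ z → M₃ (suc r) z ≡ a · M₁ (suc r) z + b · M₂ (suc r) z) (sym pc) (h₃ (suc r) (s≤s r<n)))

∑-adjacent-cancel : ∀ n c (f : ℕ → ℚ) → suc c < n
  → (∀ k → k < n → k ≢ c → k ≢ suc c → f k ≡ 0ℚ) → f c + f (suc c) ≡ 0ℚ → ∑ n f ≡ 0ℚ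
∑-adjacent-cancel (suc (suc n)) zero f _ h e = begin
  f 0 + (f 1 + ∑ n (λ k → f (suc (suc k)))) ≡⟨ sym (ℚP.+-assoc (f 0) (f 1) _) ⟩
  (f 0 + f 1) + ∑ n (λ k → f (suc (suc k)))
    ≡⟨ cong₂ _+_ e (∑-zero n _ (λ k k<n → h (suc (suc k)) (s≤s (s≤s k<n)) (λ ()) (λ ()))) ⟩
  0ℚ ∎
  where open ≡-Reasoning
∑-adjacent-cancel (suc n) (suc c) f (s≤s c<n) h e =
  trans (cong₂ _+_ (h 0 (s≤s z≤n) (λ ()) (λ ())) (∑-adjacent-cancel n c (λ k → f (suc k)) c<n
    (λ k k<n k≢c k≢sc → h (suc k) (s≤s k<n) (λ q → k≢c (ℕP.suc-injective q)) (λ q → k≢sc (ℕP.suc-injective q))) e))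
    (ℚP.+-identityˡ 0ℚ)

punchInℕ-adjacent : ∀ c k → k ≢ c → punchInℕ c k ≡ punchInℕ (suc c) k
punchInℕ-adjacent zero    zero    k≢c = ⊥-elim (k≢c refl)
punchInℕ-adjacent zero    (suc k) k≢c = refl
punchInℕ-adjacent (suc c) zero    k≢c = refl
punchInℕ-adjacent (suc c) (suc k) k≢c = cong suc (punchInℕ-adjacent c k (λ q → k≢c (cong suc q)))

punchInℕ-hits-adjacent : ∀ n j c → j < suc n → suc c < suc n → j ≢ c → j ≢ suc c
  → Σ ℕ (λ c' → suc c' < n × punchInℕ j c' ≡ c × punchInℕ j (suc c') ≡ suc c)
punchInℕ-hits-adjacent n j c j<n sc<n j≢c j≢sc with ℕP.<-cmp j c
punchInℕ-hits-adjacent n j (suc c) j<n (s≤s sc<n) j≢c j≢sc | tri< (s≤s j≤c) _ _ =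
  c , sc<n , punchInℕ-≥ j c j≤c , punchInℕ-≥ j (suc c) (ℕP.m≤n⇒m≤1+n j≤c)
... | tri≈ _ j≡c _ = ⊥-elim (j≢c j≡c)
... | tri> _ _ c<j = c , ℕP.<-≤-trans sc<j (ℕP.≤-pred j<n) , punchInℕ-< j c c<j , punchInℕ-< j (suc c) sc<j
  where
  sc<j : suc c < j
  sc<j = ℕP.≤∧≢⇒< c<j (λ e → j≢sc (sym e))

detℕ-equal-adjacent-cols : ∀ n c → suc c < n → (M : Matrixℕ)
  → (∀ i → i < n → M i c ≡ M i (suc c)) → detℕ n M ≡ 0ℚ
detℕ-equal-adjacent-cols (suc n) c sc<n M h = ∑-adjacent-cancel (suc n) c t sc<n others pair
  where
  open ≡-Reasoning
  t : ℕ → ℚ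
  t j = sign j · M 0 j · detℕ n (minor M j)
  others : ∀ j → j < suc n → j ≢ c → j ≢ suc c → t j ≡ 0ℚ
  others j j<n j≢c j≢sc with punchInℕ-hits-adjacent n j c j<n sc<n j≢c j≢sc
  ... | c' , sc'<n , at-c , at-sc = begin
    sign j · M 0 j · detℕ n (minor M j)
      ≡⟨ cong (sign j · M 0 j ·_) (detℕ-equal-adjacent-cols n c' sc'<n (minor M j) h') ⟩
    sign j · M 0 j · 0ℚ                 ≡⟨ ℚP.*-zeroʳ (sign j · M 0 j) ⟩
    0ℚ                                  ∎
    where
    h' : ∀ i → i < n → minor M j i c' ≡ minor M j i (suc c')
    h' i i<n = trans (cong (M (suc i)) at-c) (trans (h (suc i) (s≤s i<n)) (cong (M (suc i)) (sym at-sc)))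
  same-minor : ∀ r k → r < n → M (suc r) (punchInℕ c k) ≡ M (suc r) (punchInℕ (suc c) k)
  same-minor r k r<n with k ℕ.≟ c
  ... | yes refl = trans (cong (M (suc r)) (punchInℕ-≥ k k ℕP.≤-refl))
                     (trans (sym (h (suc r) (s≤s r<n))) (cong (M (suc r)) (sym (punchInℕ-< (suc k) k (ℕP.n<1+n k)))))
  ... | no k≢c = cong (M (suc r)) (punchInℕ-adjacent c k k≢c)
  cancel : ∀ s a d → s · a · d + (- s) · a · d ≡ 0ℚ
  cancel = solve-∀ ℚ-ring
  pair : t c + t (suc c) ≡ 0ℚ
  pair = begin
    sign c · M 0 c · detℕ n (minor M c) + (- sign c) · M 0 (suc c) · detℕ n (minor M (suc c))
      ≡⟨ cong₂ (λ u v → sign c · M 0 c · detℕ n (minor M c) + (- sign c) · u · v)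
               (sym (h 0 (s≤s z≤n))) (detℕ-cong n _ _ (λ r k r<n _ → sym (same-minor r k r<n))) ⟩
    sign c · M 0 c · detℕ n (minor M c) + (- sign c) · M 0 c · detℕ n (minor M c)
      ≡⟨ cancel (sign c) (M 0 c) (detℕ n (minor M c)) ⟩
    0ℚ ∎

detℕ-additive-col : ∀ n c → c < n → (M₁ M₂ M₃ : Matrixℕ)
  → (∀ i j → i < n → j < n → j ≢ c → M₁ i j ≡ M₃ i j)
  → (∀ i j → i < n → j < n → j ≢ c → M₂ i j ≡ M₃ i j)
  → (∀ i → i < n → M₃ i c ≡ M₁ i c + M₂ i c)
  → detℕ n M₃ ≡ detℕ n M₁ + detℕ n M₂
detℕ-additive-col n c c<n M₁ M₂ M₃ h₁ h₂ h₃ =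
  trans (detℕ-linear-col n c c<n M₁ M₂ M₃ 1ℚ 1ℚ h₁ h₂
          (λ i i<n → trans (h₃ i i<n) (sym (cong₂ _+_ (ℚP.*-identityˡ (M₁ i c)) (ℚP.*-identityˡ (M₂ i c))))))
        (cong₂ _+_ (ℚP.*-identityˡ (detℕ n M₁)) (ℚP.*-identityˡ (detℕ n M₂)))

-- Decides c ≟ j rather than j ≟ c, so that proofs can split on j ≟ c without
-- the with-abstraction also rewriting this definition.
setCol : Matrixℕ → ℕ → (ℕ → ℚ) → Matrixℕ
setCol M c p i j with c ℕ.≟ j
... | yes _ = p i
... | no _  = M i j

setCol-at : ∀ M c p i → setCol M c p i c ≡ p i
setCol-at M c p i with c ℕ.≟ c
... | yes _   = refl
... | no c≢c = ⊥-elim (c≢c refl)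

setCol-off : ∀ M c p i j → j ≢ c → setCol M c p i j ≡ M i j
setCol-off M c p i j j≢c with c ℕ.≟ j
... | yes c≡j = ⊥-elim (j≢c (sym c≡j))
... | no _    = refl

setAdjacentCols : Matrixℕ → ℕ → (ℕ → ℚ) → (ℕ → ℚ) → Matrixℕ
setAdjacentCols M c p q = setCol (setCol M c p) (suc c) q

setAdjacentCols-at : ∀ M c p q i → setAdjacentCols M c p q i c ≡ p i
setAdjacentCols-at M c p q i = trans (setCol-off _ (suc c) q i c (ℕP.<⇒≢ (ℕP.n<1+n c))) (setCol-at M c p i)

setAdjacentCols-at-suc : ∀ M c p q i → setAdjacentCols M c p q i (suc c) ≡ q i
setAdjacentCols-at-suc M c p q i = setCol-at _ (suc c) q i

setAdjacentCols-off : ∀ M c p q i j → j ≢ c → j ≢ suc c → setAdjacentCols M c p q i j ≡ M i j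
setAdjacentCols-off M c p q i j j≢c j≢sc = trans (setCol-off _ (suc c) q i j j≢sc) (setCol-off M c p i j j≢c)

swapAdjacentCols : Matrixℕ → ℕ → Matrixℕ
swapAdjacentCols M c = setAdjacentCols M c (λ i → M i (suc c)) (λ i → M i c)

detℕ-swapAdjacentCols : ∀ n c → suc c < n → (M : Matrixℕ)
  → detℕ n (swapAdjacentCols M c) ≡ - detℕ n M
detℕ-swapAdjacentCols n c sc<n M = begin
  D v u                                     ≡⟨ +-Group.inverseʳ-unique (D u v) (D v u) uv+vu≡0 ⟩
  - D u v                                   ≡⟨ cong -_ (detℕ-cong n _ _ (λ i j _ _ → X-uv i j)) ⟩
  - detℕ n M                                ∎
  where
  open ≡-Reasoning
  X : (ℕ → ℚ) → (ℕ → ℚ) → Matrixℕ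
  X = setAdjacentCols M c
  D : (ℕ → ℚ) → (ℕ → ℚ) → ℚ
  D p q = detℕ n (X p q)
  u v : ℕ → ℚ
  u i = M i c
  v i = M i (suc c)
  _⊕_ : (ℕ → ℚ) → (ℕ → ℚ) → ℕ → ℚ
  (p ⊕ q) i = p i + q i
  X-uv : ∀ i j → X u v i j ≡ M i j
  X-uv i j with j ℕ.≟ c
  ... | yes refl = setAdjacentCols-at M c u v i
  ... | no j≢c with j ℕ.≟ suc c
  ...   | yes refl = setAdjacentCols-at-suc M c u v i
  ...   | no j≢sc  = setAdjacentCols-off M c u v i j j≢c j≢sc
  X-off-c : ∀ p p' q i j → j ≢ c → X p q i j ≡ X p' q i j
  X-off-c p p' q i j j≢c with j ℕ.≟ suc c
  ... | yes refl = trans (setAdjacentCols-at-suc M c p q i) (sym (setAdjacentCols-at-suc M c p' q i))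
  ... | no j≢sc  = trans (setAdjacentCols-off M c p q i j j≢c j≢sc) (sym (setAdjacentCols-off M c p' q i j j≢c j≢sc))
  X-off-sc : ∀ p q q' i j → j ≢ suc c → X p q i j ≡ X p q' i j
  X-off-sc p q q' i j j≢sc with j ℕ.≟ c
  ... | yes refl = trans (setAdjacentCols-at M c p q i) (sym (setAdjacentCols-at M c p q' i))
  ... | no j≢c   = trans (setAdjacentCols-off M c p q i j j≢c j≢sc) (sym (setAdjacentCols-off M c p q' i j j≢c j≢sc))
  D-diag : ∀ p → D p p ≡ 0ℚ
  D-diag p = detℕ-equal-adjacent-cols n c sc<n (X p p)
    (λ i _ → trans (setAdjacentCols-at M c p p i) (sym (setAdjacentCols-at-suc M c p p i)))
  D-⊕ˡ : ∀ p p' q → D (p ⊕ p') q ≡ D p q + D p' q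
  D-⊕ˡ p p' q = detℕ-additive-col n c (ℕP.<-trans (ℕP.n<1+n c) sc<n) (X p q) (X p' q) (X (p ⊕ p') q)
    (λ i j _ _ → X-off-c p _ q i j) (λ i j _ _ → X-off-c p' _ q i j)
    (λ i _ → trans (setAdjacentCols-at M c _ q i)
               (sym (cong₂ _+_ (setAdjacentCols-at M c p q i) (setAdjacentCols-at M c p' q i))))
  D-⊕ʳ : ∀ p q q' → D p (q ⊕ q') ≡ D p q + D p q'
  D-⊕ʳ p q q' = detℕ-additive-col n (suc c) sc<n (X p q) (X p q') (X p (q ⊕ q'))
    (λ i j _ _ → X-off-sc p q _ i j) (λ i j _ _ → X-off-sc p q' _ i j)
    (λ i _ → trans (setAdjacentCols-at-suc M c p _ i)
               (sym (cong₂ _+_ (setAdjacentCols-at-suc M c p q i) (setAdjacentCols-at-suc M c p q' i))))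
  uv+vu≡0 : D u v + D v u ≡ 0ℚ
  uv+vu≡0 = begin
    D u v + D v u
      ≡⟨ sym (cong₂ _+_ (ℚP.+-identityˡ (D u v)) (ℚP.+-identityʳ (D v u))) ⟩
    (0ℚ + D u v) + (D v u + 0ℚ)
      ≡⟨ sym (cong₂ (λ a b → (a + D u v) + (D v u + b)) (D-diag u) (D-diag v)) ⟩
    (D u u + D u v) + (D v u + D v v)         ≡⟨ sym (cong₂ _+_ (D-⊕ʳ u u v) (D-⊕ʳ v u v)) ⟩
    D u (u ⊕ v) + D v (u ⊕ v)                 ≡⟨ sym (D-⊕ˡ u v (u ⊕ v)) ⟩
    D (u ⊕ v) (u ⊕ v)                         ≡⟨ D-diag (u ⊕ v) ⟩
    0ℚ                                        ∎

detℕ-equal-cols : ∀ n c d → c < d → d < n → (M : Matrixℕ)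
  → (∀ i → i < n → M i c ≡ M i d) → detℕ n M ≡ 0ℚ
detℕ-equal-cols n c (suc d) (s≤s c≤d) d<n M h with c ℕ.≟ d
... | yes refl = detℕ-equal-adjacent-cols n c d<n M h
... | no c≢d   = ℚP.neg-injective (trans (sym (detℕ-swapAdjacentCols n d d<n M)) swapped≡0)
  where
  c<d = ℕP.≤∧≢⇒< c≤d c≢d
  swapped≡0 : detℕ n (swapAdjacentCols M d) ≡ 0ℚ
  swapped≡0 = detℕ-equal-cols n c d c<d (ℕP.<-trans (ℕP.n<1+n d) d<n) _ λ i i<n →
    trans (setAdjacentCols-off M d _ _ i c c≢d (ℕP.<⇒≢ (ℕP.<-trans c<d (ℕP.n<1+n d))))
      (trans (h i i<n) (sym (setAdjacentCols-at M d _ _ i)))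

detℕ-add-col-multiple : ∀ n c d → c < n → d < n → c ≢ d → (l : ℚ) → (M M' : Matrixℕ)
  → (∀ i j → i < n → j < n → j ≢ c → M' i j ≡ M i j)
  → (∀ i → i < n → M' i c ≡ M i c + l · M i d)
  → detℕ n M' ≡ detℕ n M
detℕ-add-col-multiple n c d c<n d<n c≢d l M M' hoff hc = begin
  detℕ n M'                         ≡⟨ detℕ-linear-col n c c<n M Md M' 1ℚ l
                                         (λ i j i<n j<n j≢c → sym (hoff i j i<n j<n j≢c))
                                         (λ i j i<n j<n j≢c → trans (setCol-off M c _ i j j≢c) (sym (hoff i j i<n j<n j≢c)))
                                         (λ i i<n → trans (hc i i<n) (cong₂ _+_ (sym (ℚP.*-identityˡ (M i c))) (cong (l ·_) (sym (setCol-at M c _ i))))) ⟩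
  1ℚ · detℕ n M + l · detℕ n Md     ≡⟨ cong (λ z → 1ℚ · detℕ n M + l · z) Md≡0 ⟩
  1ℚ · detℕ n M + l · 0ℚ            ≡⟨ simplify (detℕ n M) l ⟩
  detℕ n M                          ∎
  where
  open ≡-Reasoning
  Md : Matrixℕ
  Md = setCol M c (λ i → M i d)
  Md-c : ∀ i → Md i c ≡ M i d
  Md-c i = setCol-at M c _ i
  Md-d : ∀ i → Md i d ≡ M i d
  Md-d i = setCol-off M c _ i d (λ e → c≢d (sym e))
  Md≡0 : detℕ n Md ≡ 0ℚ
  Md≡0 with ℕP.<-cmp c d
  ... | tri< c<d _ _ = detℕ-equal-cols n c d c<d d<n Md (λ i _ → trans (Md-c i) (sym (Md-d i)))
  ... | tri≈ _ c≡d _ = ⊥-elim (c≢d c≡d)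
  ... | tri> _ _ d<c = detℕ-equal-cols n d c d<c c<n Md (λ i _ → trans (Md-d i) (sym (Md-c i)))
  simplify : ∀ a l → 1ℚ · a + l · 0ℚ ≡ a
  simplify = solve-∀ ℚ-ring

detℕ-add-two-col-multiples : ∀ n c d e → c < n → d < n → e < n → c ≢ d → c ≢ e → (a b : ℚ) (M M' : Matrixℕ)
  → (∀ i j → i < n → j < n → j ≢ c → M' i j ≡ M i j)
  → (∀ i → i < n → M' i c ≡ (M i c + a · M i d) + b · M i e)
  → detℕ n M' ≡ detℕ n M
detℕ-add-two-col-multiples n c d e c<n d<n e<n c≢d c≢e a b M M' hoff hc = begin
  detℕ n M'  ≡⟨ detℕ-add-col-multiple n c e c<n e<n c≢e b Md M'
                  (λ i j i<n j<n j≢c → trans (hoff i j i<n j<n j≢c) (sym (setCol-off M c _ i j j≢c)))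
                  (λ i i<n → trans (hc i i<n) (sym (cong₂ (λ u v → u + b · v) (setCol-at M c _ i) (setCol-off M c _ i e (c≢e ∘ sym))))) ⟩
  detℕ n Md  ≡⟨ detℕ-add-col-multiple n c d c<n d<n c≢d a M Md
                  (λ i j _ _ j≢c → setCol-off M c _ i j j≢c) (λ i _ → setCol-at M c _ i) ⟩
  detℕ n M   ∎
  where
  open ≡-Reasoning
  Md : Matrixℕ
  Md = setCol M c (λ i → M i c + a · M i d)

if< : ℕ → ℕ → ℚ → ℚ → ℚ
if< k p a b with k ℕ.<? p
... | yes _ = a
... | no _  = b

if<-yes : ∀ k p a b → k < p → if< k p a b ≡ a
if<-yes k p a b k<p with k ℕ.<? p
... | yes _   = refl
... | no k≮p = ⊥-elim (k≮p k<p)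

if<-no : ∀ k p a b → p ≤ k → if< k p a b ≡ b
if<-no k p a b p≤k with k ℕ.<? p
... | yes k<p = ⊥-elim (ℕP.<⇒≱ k<p p≤k)
... | no _    = refl

colsBelow : ℕ → Matrixℕ → Matrixℕ → Matrixℕ
colsBelow s M N i k = if< k s (M i k) (N i k)

colsBelow-at : ∀ s M N i → colsBelow s M N i s ≡ N i s
colsBelow-at s M N i = if<-no s s _ _ ℕP.≤-refl

colsBelow-at-suc : ∀ s M N i → colsBelow (suc s) M N i s ≡ M i s
colsBelow-at-suc s M N i = if<-yes s (suc s) _ _ (ℕP.n<1+n s)

colsBelow-< : ∀ s M N i k → k < s → colsBelow s M N i k ≡ M i k
colsBelow-< s M N i k = if<-yes k s _ _

colsBelow-≥ : ∀ s M N i k → s ≤ k → colsBelow s M N i k ≡ N i k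
colsBelow-≥ s M N i k = if<-no k s _ _

colsBelow-off : ∀ s M N i k → k ≢ s → colsBelow s M N i k ≡ colsBelow (suc s) M N i k
colsBelow-off s M N i k k≢s with ℕP.<-cmp k s
... | tri< k<s _ _ = trans (colsBelow-< s M N i k k<s) (sym (colsBelow-< (suc s) M N i k (ℕP.m<n⇒m<1+n k<s)))
... | tri≈ _ k≡s _ = ⊥-elim (k≢s k≡s)
... | tri> _ _ s<k = trans (colsBelow-≥ s M N i k (ℕP.<⇒≤ s<k)) (sym (colsBelow-≥ (suc s) M N i k s<k))

detℕ-colsBelow : ∀ n p (M N : Matrixℕ) → p ≤ n
  → (∀ s → p ≤ s → s < n → detℕ n (colsBelow s M N) ≡ detℕ n (colsBelow (suc s) M N))
  → detℕ n (colsBelow p M N) ≡ detℕ n M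
detℕ-colsBelow n p M N p≤n step = sweep (n ∸ p) p (ℕP.m∸n+n≡m p≤n) ℕP.≤-refl
  where
  sweep : ∀ q s → q ℕ.+ s ≡ n → p ≤ s → detℕ n (colsBelow s M N) ≡ detℕ n M
  sweep zero    s refl p≤s = detℕ-cong n _ _ (λ i k _ k<n → colsBelow-< s M N i k k<n)
  sweep (suc q) s e    p≤s = trans (step s p≤s s<n) (sweep q (suc s) (trans (ℕP.+-suc q s) e) (ℕP.m≤n⇒m≤1+n p≤s))
    where
    s<n : s < n
    s<n = ℕP.m+n≤o⇒n≤o q (ℕP.≤-reflexive (trans (ℕP.+-suc q s) e))

∑-∑-signed-swap : ∀ n p (α β : ℕ → ℚ) (F : ℕ → ℕ → ℚ)
  → ∑ n (λ j → (- sign j) · α j · ∑ p (λ i → sign i · β i · F i j))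
    ≡ ∑ p (λ i → (- sign i) · β i · ∑ n (λ j → sign j · α j · F i j))
∑-∑-signed-swap n p α β F = begin
  ∑ n (λ j → (- sign j) · α j · ∑ p (λ i → sign i · β i · F i j))
    ≡⟨ ∑-cong n _ _ (λ j _ → sym (∑-scale p ((- sign j) · α j) (λ i → sign i · β i · F i j))) ⟩
  ∑ n (λ j → ∑ p (λ i → (- sign j) · α j · (sign i · β i · F i j)))
    ≡⟨ ∑-comm n p _ ⟩
  ∑ p (λ i → ∑ n (λ j → (- sign j) · α j · (sign i · β i · F i j)))
    ≡⟨ ∑-cong p _ _ (λ i _ → trans (∑-cong n _ _ (λ j _ → rearrange (sign j) (α j) (sign i) (β i) (F i j)))
                                  (∑-scale n ((- sign i) · β i) (λ j → sign j · α j · F i j))) ⟩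
  ∑ p (λ i → (- sign i) · β i · ∑ n (λ j → sign j · α j · F i j)) ∎
  where
  open ≡-Reasoning
  rearrange : ∀ sj a si b f → (- sj) · a · (si · b · f) ≡ (- si) · b · (sj · a · f)
  rearrange = solve-∀ ℚ-ring

detℕ-expand-col0 : ∀ n M → detℕ (suc n) M ≡ ∑ (suc n) (λ i → sign i · M i 0 · detℕ n (λ r c → M (punchInℕ i r) (suc c)))
detℕ-expand-col0 zero M = refl
detℕ-expand-col0 (suc n) M = cong (λ z → sign 0 · M 0 0 · detℕ (suc n) (minor M 0) + z) (begin
  ∑ (suc n) (λ j → sign (suc j) · M 0 (suc j) · detℕ (suc n) (minor M (suc j)))
    ≡⟨ ∑-cong (suc n) _ _ (λ j _ → cong (sign (suc j) · M 0 (suc j) ·_) (detℕ-expand-col0 n (minor M (suc j)))) ⟩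
  ∑ (suc n) (λ j → (- sign j) · M 0 (suc j) · ∑ (suc n) (λ i → sign i · M (suc i) 0 · D i j))
    ≡⟨ ∑-∑-signed-swap (suc n) (suc n) (λ j → M 0 (suc j)) (λ i → M (suc i) 0) D ⟩
  ∑ (suc n) (λ i → (- sign i) · M (suc i) 0 · ∑ (suc n) (λ j → sign j · M 0 (suc j) · D i j)) ∎)
  where
  open ≡-Reasoning
  D : ℕ → ℕ → ℚ
  D i j = detℕ n (λ r c → M (suc (punchInℕ i r)) (suc (punchInℕ j c)))

transpose : Matrixℕ → Matrixℕ
transpose M i j = M j i

detℕ-transpose : ∀ n M → detℕ n (transpose M) ≡ detℕ n M
detℕ-transpose zero M = refl
detℕ-transpose (suc n) M = trans
  (∑-cong (suc n) _ _ (λ j _ → cong (sign j · M j 0 ·_) (detℕ-transpose n (λ r c → M (punchInℕ j r) (suc c)))))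
  (sym (detℕ-expand-col0 n M))

detℕ-last-col : ∀ n M → (∀ i → i < n → M i n ≡ 0ℚ) → detℕ (suc n) M ≡ M n n · detℕ n M
detℕ-last-col zero M h = trans (ℚP.+-identityʳ _) (regroup (M 0 0))
  where
  regroup : ∀ a → 1ℚ · a · 1ℚ ≡ a · 1ℚ
  regroup = solve-∀ ℚ-ring
detℕ-last-col (suc n) M h = begin
  ∑ (suc (suc n)) t ≡⟨ ∑-snoc (suc n) t ⟩
  ∑ (suc n) t + t (suc n) ≡⟨ cong (λ z → ∑ (suc n) t + z) tlast ⟩
  ∑ (suc n) t + 0ℚ ≡⟨ ℚP.+-identityʳ _ ⟩
  ∑ (suc n) t ≡⟨ ∑-cong (suc n) _ _ (λ j j<n → step j j<n) ⟩
  ∑ (suc n) (λ j → M (suc n) (suc n) · (sign j · M 0 j · detℕ n (minor M j)))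
    ≡⟨ ∑-scale (suc n) (M (suc n) (suc n)) (λ j → sign j · M 0 j · detℕ n (minor M j)) ⟩
  M (suc n) (suc n) · detℕ (suc n) M ∎
  where
  open ≡-Reasoning
  t : ℕ → ℚ
  t j = sign j · M 0 j · detℕ (suc n) (minor M j)
  tlast : t (suc n) ≡ 0ℚ
  tlast = trans (cong (λ z → sign (suc n) · z · detℕ (suc n) (minor M (suc n))) (h 0 (s≤s z≤n))) (regroup (sign (suc n)) (detℕ (suc n) (minor M (suc n))))
    where
    regroup : ∀ a b → a · 0ℚ · b ≡ 0ℚ
    regroup = solve-∀ ℚ-ring
  step : ∀ j → j < suc n → t j ≡ M (suc n) (suc n) · (sign j · M 0 j · detℕ n (minor M j))
  step j j<n = begin
    sign j · M 0 j · detℕ (suc n) (minor M j)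
      ≡⟨ cong (sign j · M 0 j ·_) (detℕ-last-col n (minor M j) (λ i i<n → trans (cong (M (suc i)) (punchInℕ-≥ j n (ℕP.≤-pred j<n))) (h (suc i) (s≤s i<n)))) ⟩
    sign j · M 0 j · (M (suc n) (punchInℕ j n) · detℕ n (minor M j))
      ≡⟨ cong₂ (λ u v → sign j · M 0 j · (M (suc n) u · v)) (punchInℕ-≥ j n (ℕP.≤-pred j<n)) refl ⟩
    sign j · M 0 j · (M (suc n) (suc n) · detℕ n (minor M j))
      ≡⟨ regroup (sign j) (M 0 j) (M (suc n) (suc n)) _ ⟩
    M (suc n) (suc n) · (sign j · M 0 j · detℕ n (minor M j)) ∎
    where
    regroup : ∀ s a b c → s · a · (b · c) ≡ b · (s · a · c)
    regroup = solve-∀ ℚ-ring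

detℕ-scale-rows : ∀ n (r : ℕ → ℚ) M → detℕ n (λ i j → r i · M i j) ≡ ∏ n r · detℕ n M
detℕ-scale-rows zero r M = sym (ℚP.*-identityˡ 1ℚ)
detℕ-scale-rows (suc n) r M = begin
  ∑ (suc n) (λ j → sign j · (r 0 · M 0 j) · detℕ n (λ a b → r (suc a) · M (suc a) (punchInℕ j b)))
    ≡⟨ ∑-cong (suc n) _ _ (λ j _ → trans (cong (sign j · (r 0 · M 0 j) ·_) (detℕ-scale-rows n (λ a → r (suc a)) (minor M j)))
                                        (regroup (sign j) (r 0) (M 0 j) (∏ n (λ a → r (suc a))) (detℕ n (minor M j)))) ⟩
  ∑ (suc n) (λ j → (r 0 · ∏ n (λ a → r (suc a))) · (sign j · M 0 j · detℕ n (minor M j)))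
    ≡⟨ ∑-scale (suc n) (r 0 · ∏ n (λ a → r (suc a))) (λ j → sign j · M 0 j · detℕ n (minor M j)) ⟩
  (r 0 · ∏ n (λ a → r (suc a))) · detℕ (suc n) M ≡⟨ cong (_· detℕ (suc n) M) (sym (∏-cons n r)) ⟩
  ∏ (suc n) r · detℕ (suc n) M ∎
  where
  open ≡-Reasoning
  regroup : ∀ s a b p d → s · (a · b) · (p · d) ≡ (a · p) · (s · b · d)
  regroup = solve-∀ ℚ-ring

detℕ-scale-cols : ∀ n (w : ℕ → ℚ) M → detℕ n (λ i j → M i j · w j) ≡ ∏ n w · detℕ n M
detℕ-scale-cols n w M = begin
  detℕ n (λ i j → M i j · w j) ≡⟨ sym (detℕ-transpose n _) ⟩
  detℕ n (λ i j → M j i · w i) ≡⟨ detℕ-cong n _ _ (λ i j _ _ → ℚP.*-comm (M j i) (w i)) ⟩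
  detℕ n (λ i j → w i · M j i) ≡⟨ detℕ-scale-rows n w (transpose M) ⟩
  ∏ n w · detℕ n (transpose M) ≡⟨ cong (∏ n w ·_) (detℕ-transpose n M) ⟩
  ∏ n w · detℕ n M ∎
  where open ≡-Reasoning

-- Finite differences and polynomial functions

Δ : (ℚ → ℚ) → ℚ → ℚ
Δ f x = f (x + 1ℚ) - f x

Δ^ : ℕ → (ℚ → ℚ) → ℚ → ℚ
Δ^ zero f = f
Δ^ (suc d) f = Δ^ d (Δ f)

record ConstΔ^ (d : ℕ) (c : ℚ) (f : ℚ → ℚ) : Set where
  constructor mkConstΔ^
  field Δ^≡ : ∀ x → Δ^ d f x ≡ c
open ConstΔ^ public

ConstΔ^-Δ : ∀ {d c f} → ConstΔ^ (suc d) c f → ConstΔ^ d c (Δ f)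
ConstΔ^-Δ p = mkConstΔ^ (Δ^≡ p)

ConstΔ^-Δ⁻ : ∀ {d c f} → ConstΔ^ d c (Δ f) → ConstΔ^ (suc d) c f
ConstΔ^-Δ⁻ p = mkConstΔ^ (Δ^≡ p)

Δ-cong : ∀ (f g : ℚ → ℚ) → (∀ x → f x ≡ g x) → ∀ x → Δ f x ≡ Δ g x
Δ-cong f g h x = cong₂ _-_ (h (x + 1ℚ)) (h x)

Δ^-cong : ∀ d (f g : ℚ → ℚ) → (∀ x → f x ≡ g x) → ∀ x → Δ^ d f x ≡ Δ^ d g x
Δ^-cong zero f g h = h
Δ^-cong (suc d) f g h = Δ^-cong d (Δ f) (Δ g) (Δ-cong f g h)

ConstΔ^-cong : ∀ d c (f g : ℚ → ℚ) → (∀ x → f x ≡ g x) → ConstΔ^ d c f → ConstΔ^ d c g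
ConstΔ^-cong d c f g h p = mkConstΔ^ λ x → trans (sym (Δ^-cong d f g h x)) (Δ^≡ p x)

ConstΔ^-subst : ∀ d c c' (f : ℚ → ℚ) → c ≡ c' → ConstΔ^ d c f → ConstΔ^ d c' f
ConstΔ^-subst d c c' f e p = mkConstΔ^ λ x → trans (Δ^≡ p x) e

Δ^-+ : ∀ d (f g : ℚ → ℚ) x → Δ^ d (λ y → f y + g y) x ≡ Δ^ d f x + Δ^ d g x
Δ^-+ zero f g x = refl
Δ^-+ (suc d) f g x = trans (Δ^-cong d _ (λ y → Δ f y + Δ g y) (λ y → regroup (f (y + 1ℚ)) (g (y + 1ℚ)) (f y) (g y)) x) (Δ^-+ d (Δ f) (Δ g) x)
  where
  regroup : ∀ a b c d → (a + b) - (c + d) ≡ (a - c) + (b - d)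
  regroup = solve-∀ ℚ-ring

Δ^-scale : ∀ d a (f : ℚ → ℚ) x → Δ^ d (λ y → a · f y) x ≡ a · Δ^ d f x
Δ^-scale zero a f x = refl
Δ^-scale (suc d) a f x = trans (Δ^-cong d _ (λ y → a · Δ f y) (λ y → regroup a (f (y + 1ℚ)) (f y)) x) (Δ^-scale d a (Δ f) x)
  where
  regroup : ∀ a b c → a · b - a · c ≡ a · (b - c)
  regroup = solve-∀ ℚ-ring

Δ^-shift : ∀ d (f : ℚ → ℚ) x → Δ^ d (λ y → f (y + 1ℚ)) x ≡ Δ^ d f (x + 1ℚ)
Δ^-shift zero f x = refl
Δ^-shift (suc d) f x = Δ^-shift d (Δ f) x

Δ^-Δ : ∀ d (f : ℚ → ℚ) x → Δ^ d (Δ f) x ≡ Δ (Δ^ d f) x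
Δ^-Δ zero f x = refl
Δ^-Δ (suc d) f x = Δ^-Δ d (Δ f) x

ConstΔ^-shift : ∀ d c (f : ℚ → ℚ) → ConstΔ^ d c f → ConstΔ^ d c (λ y → f (y + 1ℚ))
ConstΔ^-shift d c f p = mkConstΔ^ λ x → trans (Δ^-shift d f x) (Δ^≡ p (x + 1ℚ))

ConstΔ^-+ : ∀ d c c' (f g : ℚ → ℚ) → ConstΔ^ d c f → ConstΔ^ d c' g → ConstΔ^ d (c + c') (λ y → f y + g y)
ConstΔ^-+ d c c' f g lf lg = mkConstΔ^ λ x → trans (Δ^-+ d f g x) (cong₂ _+_ (Δ^≡ lf x) (Δ^≡ lg x))

ConstΔ^-scale : ∀ d c a (f : ℚ → ℚ) → ConstΔ^ d c f → ConstΔ^ d (a · c) (λ y → a · f y)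
ConstΔ^-scale d c a f lf = mkConstΔ^ λ x → trans (Δ^-scale d a f x) (cong (a ·_) (Δ^≡ lf x))

ConstΔ^-suc : ∀ d c (f : ℚ → ℚ) → ConstΔ^ d c f → ConstΔ^ (suc d) 0ℚ f
ConstΔ^-suc d c f lf = mkConstΔ^ λ x → trans (Δ^-Δ d f x) (trans (cong₂ _-_ (Δ^≡ lf (x + 1ℚ)) (Δ^≡ lf x)) (ℚP.+-inverseʳ c))

ConstΔ^-linear-factor : ∀ d c a (f : ℚ → ℚ) → ConstΔ^ d c f → ConstΔ^ (suc d) (ℕ→ℚ (suc d) · c) (λ y → (y + a) · f y)
ConstΔ^-linear-factor zero c a f lf = mkConstΔ^ λ x → begin
  (x + 1ℚ + a) · f (x + 1ℚ) - (x + a) · f x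
    ≡⟨ cong₂ (λ u v → (x + 1ℚ + a) · u - (x + a) · v) (Δ^≡ lf (x + 1ℚ)) (Δ^≡ lf x) ⟩
  (x + 1ℚ + a) · c - (x + a) · c ≡⟨ regroup x a c ⟩
  1ℚ · c ∎
  where
  open ≡-Reasoning
  regroup : ∀ x a c → (x + 1ℚ + a) · c - (x + a) · c ≡ 1ℚ · c
  regroup = solve-∀ ℚ-ring
ConstΔ^-linear-factor (suc d) c a f lf = ConstΔ^-Δ⁻ (ConstΔ^-subst (suc d) _ _ _ const-eq
    (ConstΔ^-cong (suc d) _ (λ y → f (y + 1ℚ) + (y + a) · Δ f y) _ (λ y → sym (regroup y a (f (y + 1ℚ)) (f y)))
      (ConstΔ^-+ (suc d) c _ _ _ (ConstΔ^-shift (suc d) c f lf) (ConstΔ^-linear-factor d c a (Δ f) (ConstΔ^-Δ lf)))))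
  where
  regroup : ∀ y a p q → (y + 1ℚ + a) · p - (y + a) · q ≡ p + (y + a) · (p - q)
  regroup = solve-∀ ℚ-ring
  const-eq : c + ℕ→ℚ (suc d) · c ≡ ℕ→ℚ (suc (suc d)) · c
  const-eq = begin
    c + ℕ→ℚ (suc d) · c ≡⟨ regroup₂ c (ℕ→ℚ (suc d)) ⟩
    (ℕ→ℚ (suc d) + 1ℚ) · c ≡⟨ cong (_· c) (sym (ℕ→ℚ-suc (suc d))) ⟩
    ℕ→ℚ (suc (suc d)) · c ∎
    where
    open ≡-Reasoning
    regroup₂ : ∀ c n → c + n · c ≡ (n + 1ℚ) · c
    regroup₂ = solve-∀ ℚ-ring

ConstΔ^-linear-factorʳ : ∀ d c a (f : ℚ → ℚ) → ConstΔ^ d c f → ConstΔ^ (suc d) (ℕ→ℚ (suc d) · c) (λ y → f y · (y + a))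
ConstΔ^-linear-factorʳ d c a f lf = ConstΔ^-cong (suc d) _ _ _ (λ y → ℚP.*-comm (y + a) (f y)) (ConstΔ^-linear-factor d c a f lf)

-- Degree ≤ d is expressed by the vanishing of the (d+1)-st difference, which needs
-- no coefficient representation.
Poly : ℕ → (ℚ → ℚ) → Set
Poly d f = ConstΔ^ (suc d) 0ℚ f

Poly-cong : ∀ d (f g : ℚ → ℚ) → (∀ x → f x ≡ g x) → Poly d f → Poly d g
Poly-cong d = ConstΔ^-cong (suc d) 0ℚ

Poly-suc : ∀ d (f : ℚ → ℚ) → Poly d f → Poly (suc d) f
Poly-suc d f p = ConstΔ^-suc (suc d) 0ℚ f p

Poly-≤ : ∀ d e (f : ℚ → ℚ) → d ≤ e → Poly d f → Poly e f
Poly-≤ zero zero f _ p = p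
Poly-≤ zero (suc e) f _ p = Poly-suc e f (Poly-≤ zero e f z≤n p)
Poly-≤ (suc d) (suc e) f (s≤s d≤e) p = ConstΔ^-Δ⁻ (Poly-≤ d e (Δ f) d≤e (ConstΔ^-Δ p))

Poly-+ : ∀ d (f g : ℚ → ℚ) → Poly d f → Poly d g → Poly d (λ y → f y + g y)
Poly-+ d f g pf pg = ConstΔ^-subst (suc d) _ _ _ (ℚP.+-identityˡ 0ℚ) (ConstΔ^-+ (suc d) 0ℚ 0ℚ f g pf pg)

Poly-scale : ∀ d a (f : ℚ → ℚ) → Poly d f → Poly d (λ y → a · f y)
Poly-scale d a f pf = ConstΔ^-subst (suc d) _ _ _ (ℚP.*-zeroʳ a) (ConstΔ^-scale (suc d) 0ℚ a f pf)

Poly-const : ∀ d c → Poly d (λ _ → c)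
Poly-const d c = Poly-≤ 0 d _ z≤n (mkConstΔ^ λ x → ℚP.+-inverseʳ c)

Poly-·-step : ∀ e (f g : ℚ → ℚ) → Poly e (λ y → Δ f y · g (y + 1ℚ)) → Poly e (λ y → f y · Δ g y) → Poly (suc e) (λ y → f y · g y)
Poly-·-step e f g p1 p2 = ConstΔ^-Δ⁻ (Poly-cong e _ _ (λ y → sym (regroup (f (y + 1ℚ)) (g (y + 1ℚ)) (f y) (g y))) (Poly-+ e _ _ p1 p2))
  where
  regroup : ∀ p q r s → p · q - r · s ≡ (p - r) · q + r · (q - s)
  regroup = solve-∀ ℚ-ring

Poly-· : ∀ a b (f g : ℚ → ℚ) → Poly a f → Poly b g → Poly (a ℕ.+ b) (λ y → f y · g y)
Poly-· zero zero f g pf pg = mkConstΔ^ λ x → begin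
  f (x + 1ℚ) · g (x + 1ℚ) - f x · g x ≡⟨ regroup (f (x + 1ℚ)) (g (x + 1ℚ)) (f x) (g x) ⟩
  (f (x + 1ℚ) - f x) · g (x + 1ℚ) + f x · (g (x + 1ℚ) - g x)
    ≡⟨ cong₂ (λ u v → u · g (x + 1ℚ) + f x · v) (Δ^≡ pf x) (Δ^≡ pg x) ⟩
  0ℚ · g (x + 1ℚ) + f x · 0ℚ ≡⟨ regroup₀ (g (x + 1ℚ)) (f x) ⟩
  0ℚ ∎
  where
  open ≡-Reasoning
  regroup : ∀ p q r s → p · q - r · s ≡ (p - r) · q + r · (q - s)
  regroup = solve-∀ ℚ-ring
  regroup₀ : ∀ a b → 0ℚ · a + b · 0ℚ ≡ 0ℚ
  regroup₀ = solve-∀ ℚ-ring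
Poly-· zero (suc b) f g pf pg = Poly-·-step b f g
  (Poly-cong b (λ _ → 0ℚ) _ (λ y → sym (trans (cong (_· g (y + 1ℚ)) (Δ^≡ pf y)) (ℚP.*-zeroˡ (g (y + 1ℚ))))) (Poly-const b 0ℚ))
  (Poly-· zero b f (Δ g) pf (ConstΔ^-Δ pg))
Poly-· (suc a) zero f g pf pg = Poly-·-step (a ℕ.+ 0) f g (Poly-· a zero (Δ f) (λ y → g (y + 1ℚ)) (ConstΔ^-Δ pf) (ConstΔ^-shift 1 0ℚ g pg))
  (Poly-cong _ (λ _ → 0ℚ) _ (λ y → sym (trans (cong (f y ·_) (Δ^≡ pg y)) (ℚP.*-zeroʳ (f y)))) (Poly-const _ 0ℚ))
Poly-· (suc a) (suc b) f g pf pg = Poly-·-step (a ℕ.+ suc b) f g (Poly-· a (suc b) (Δ f) (λ y → g (y + 1ℚ)) (ConstΔ^-Δ pf) (ConstΔ^-shift (suc (suc b)) 0ℚ g pg))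
  (subst (λ k → Poly k (λ y → f y · Δ g y)) (sym (ℕP.+-suc a b)) (Poly-· (suc a) b f (Δ g) pf (ConstΔ^-Δ pg)))

IsPoly : (ℚ → ℚ) → Set
IsPoly f = Σ ℕ (λ d → Poly d f)

IsPoly-cong : ∀ (f g : ℚ → ℚ) → (∀ x → f x ≡ g x) → IsPoly f → IsPoly g
IsPoly-cong f g h (d , p) = d , Poly-cong d f g h p

IsPoly-+ : ∀ (f g : ℚ → ℚ) → IsPoly f → IsPoly g → IsPoly (λ y → f y + g y)
IsPoly-+ f g (d , pf) (e , pg) = (d ℕ.+ e) , Poly-+ _ f g (Poly-≤ d _ f (ℕP.m≤m+n d e) pf) (Poly-≤ e _ g (ℕP.m≤n+m e d) pg)

IsPoly-· : ∀ (f g : ℚ → ℚ) → IsPoly f → IsPoly g → IsPoly (λ y → f y · g y)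
IsPoly-· f g (d , pf) (e , pg) = (d ℕ.+ e) , Poly-· d e f g pf pg

IsPoly-const : ∀ c → IsPoly (λ _ → c)
IsPoly-const c = 0 , Poly-const 0 c

IsPoly-scale : ∀ a (f : ℚ → ℚ) → IsPoly f → IsPoly (λ y → a · f y)
IsPoly-scale a f (d , pf) = d , Poly-scale d a f pf

IsPoly-- : ∀ (f g : ℚ → ℚ) → IsPoly f → IsPoly g → IsPoly (λ y → f y - g y)
IsPoly-- f g pf pg = IsPoly-cong _ _ (λ y → cong (f y +_) (sym (regroup (g y)))) (IsPoly-+ f _ pf (IsPoly-scale (- 1ℚ) g pg))
  where
  regroup : ∀ a → - a ≡ (- 1ℚ) · a
  regroup = solve-∀ ℚ-ring

IsPoly-x+c : ∀ c → IsPoly (λ y → y + c)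
IsPoly-x+c c = 1 , mkConstΔ^ λ x → regroup x c
  where
  regroup : ∀ x c → ((x + 1ℚ + 1ℚ + c) - (x + 1ℚ + c)) - ((x + 1ℚ + c) - (x + c)) ≡ 0ℚ
  regroup = solve-∀ ℚ-ring

+-ℕ→ℚ-assoc : ∀ x j k → (x + ℕ→ℚ j) + ℕ→ℚ k ≡ x + ℕ→ℚ (j ℕ.+ k)
+-ℕ→ℚ-assoc x j k = trans (ℚP.+-assoc x _ _) (cong (x +_) (sym (ℕ→ℚ-+ j k)))

Δ≡0⇒periodic : ∀ (f : ℚ → ℚ) x → (∀ j → Δ f (x + ℕ→ℚ j) ≡ 0ℚ) → ∀ K → f x ≡ f (x + ℕ→ℚ K)
Δ≡0⇒periodic f x h zero = cong f (sym (ℚP.+-identityʳ x))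
Δ≡0⇒periodic f x h (suc K) = begin
  f x ≡⟨ Δ≡0⇒periodic f x h K ⟩
  f (x + ℕ→ℚ K) ≡⟨ sym (+-Group.x∙y⁻¹≈ε⇒x≈y (f (x + ℕ→ℚ K + 1ℚ)) (f (x + ℕ→ℚ K)) (h K)) ⟩
  f (x + ℕ→ℚ K + 1ℚ) ≡⟨ cong f (trans (ℚP.+-assoc x _ _) (cong (x +_) (sym (ℕ→ℚ-suc K)))) ⟩
  f (x + ℕ→ℚ (suc K)) ∎
  where open ≡-Reasoning

Poly-zero-on-tail⇒zero : ∀ d (f : ℚ → ℚ) → Poly d f → ∀ x K → (∀ k → K ≤ k → f (x + ℕ→ℚ k) ≡ 0ℚ) → f x ≡ 0ℚ
Poly-zero-on-tail⇒zero zero f pf x K h = trans (Δ≡0⇒periodic f x (λ j → Δ^≡ pf (x + ℕ→ℚ j)) K) (h K ℕP.≤-refl)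
Poly-zero-on-tail⇒zero (suc d) f pf x K h = trans (Δ≡0⇒periodic f x Δzero K) (h K ℕP.≤-refl)
  where
  Δzero : ∀ j → Δ f (x + ℕ→ℚ j) ≡ 0ℚ
  Δzero j = Poly-zero-on-tail⇒zero d (Δ f) (ConstΔ^-Δ pf) (x + ℕ→ℚ j) K λ k K≤k → begin
    f (x + ℕ→ℚ j + ℕ→ℚ k + 1ℚ) - f (x + ℕ→ℚ j + ℕ→ℚ k)
      ≡⟨ cong₂ _-_ (cong f (trans (cong (_+ 1ℚ) (+-ℕ→ℚ-assoc x j k)) (trans (ℚP.+-assoc x _ _) (cong (x +_) (sym (ℕ→ℚ-suc (j ℕ.+ k)))))))
                   (cong f (+-ℕ→ℚ-assoc x j k)) ⟩
    f (x + ℕ→ℚ (suc (j ℕ.+ k))) - f (x + ℕ→ℚ (j ℕ.+ k))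
      ≡⟨ cong₂ _-_ (h _ (ℕP.≤-trans K≤k (ℕP.≤-trans (ℕP.m≤n+m k j) (ℕP.n≤1+n _)))) (h _ (ℕP.≤-trans K≤k (ℕP.m≤n+m k j))) ⟩
    0ℚ - 0ℚ ≡⟨ refl ⟩
    0ℚ ∎
    where open ≡-Reasoning

-- Stage p of det [g i k] = det [Δᵏ (g i) 0]: columns k < p are already final (u),
-- column k ≥ p holds g i (k − p) for the p times differenced family g.
valueCols : ℕ → Matrixℕ → (ℕ → ℚ → ℚ) → Matrixℕ
valueCols p u g i k = if< k p (u i k) (g i (ℕ→ℚ (k ∸ p)))

diffCols : ℕ → Matrixℕ → (ℕ → ℚ → ℚ) → Matrixℕ
diffCols p u g i k = if< k p (u i k) (Δ^ (k ∸ p) (g i) 0ℚ)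

freezeCol : ℕ → Matrixℕ → (ℕ → ℚ → ℚ) → Matrixℕ
freezeCol p u g i k = if< k p (u i k) (g i 0ℚ)

mapΔ : (ℕ → ℚ → ℚ) → ℕ → ℚ → ℚ
mapΔ g i = Δ (g i)

valueCols-freezeCol : ∀ p u g i k → k ≤ p
  → valueCols (suc p) (freezeCol p u g) (mapΔ g) i k ≡ valueCols p u g i k
valueCols-freezeCol p u g i k k≤p with ℕP.<-≤-connex k p
... | inj₁ k<p = trans (if<-yes k (suc p) _ _ (s≤s k≤p)) (trans (if<-yes k p _ _ k<p) (sym (if<-yes k p _ _ k<p)))
... | inj₂ p≤k = trans (if<-yes k (suc p) _ _ (s≤s k≤p)) (trans (if<-no k p _ _ p≤k)
                   (sym (trans (if<-no k p _ _ p≤k) (cong (g i ∘ ℕ→ℚ) k∸p≡0))))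
  where
  k∸p≡0 : k ∸ p ≡ 0
  k∸p≡0 = ℕP.m≤n⇒m∸n≡0 k≤p

valueCols-mapΔ : ∀ p u g i t → p ≤ t
  → valueCols (suc p) (freezeCol p u g) (mapΔ g) i (suc t) ≡ valueCols p u g i (suc t) + (- 1ℚ) · valueCols p u g i t
valueCols-mapΔ p u g i t p≤t = begin
  valueCols (suc p) (freezeCol p u g) (mapΔ g) i (suc t)  ≡⟨ if<-no (suc t) (suc p) _ _ (s≤s p≤t) ⟩
  g i (ℕ→ℚ (t ∸ p) + 1ℚ) - g i (ℕ→ℚ (t ∸ p))
    ≡⟨ cong (λ z → g i z - g i (ℕ→ℚ (t ∸ p))) (sym (ℕ→ℚ-suc (t ∸ p))) ⟩
  g i (ℕ→ℚ (suc (t ∸ p))) - g i (ℕ→ℚ (t ∸ p))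
    ≡⟨ cong (λ z → g i (ℕ→ℚ z) - g i (ℕ→ℚ (t ∸ p))) (sym (ℕP.+-∸-assoc 1 p≤t)) ⟩
  g i (ℕ→ℚ (suc t ∸ p)) - g i (ℕ→ℚ (t ∸ p))
    ≡⟨ x-y≡x+-1·y (g i (ℕ→ℚ (suc t ∸ p))) (g i (ℕ→ℚ (t ∸ p))) ⟩
  g i (ℕ→ℚ (suc t ∸ p)) + (- 1ℚ) · g i (ℕ→ℚ (t ∸ p))
    ≡⟨ sym (cong₂ (λ a b → a + (- 1ℚ) · b) (if<-no (suc t) p _ _ (ℕP.m≤n⇒m≤1+n p≤t)) (if<-no t p _ _ p≤t)) ⟩
  valueCols p u g i (suc t) + (- 1ℚ) · valueCols p u g i t ∎
  where open ≡-Reasoning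

detℕ-valueCols-step : ∀ n p u g → p < n
  → detℕ n (valueCols p u g) ≡ detℕ n (valueCols (suc p) (freezeCol p u g) (mapΔ g))
detℕ-valueCols-step n p u g p<n = begin
  detℕ n old                         ≡⟨ sym (detℕ-colsBelow n (suc p) old new p<n step) ⟩
  detℕ n (colsBelow (suc p) old new) ≡⟨ detℕ-cong n _ _ (λ i k _ _ → below i k) ⟩
  detℕ n new                         ∎
  where
  open ≡-Reasoning
  old new : Matrixℕ
  old = valueCols p u g
  new = valueCols (suc p) (freezeCol p u g) (mapΔ g)
  below : ∀ i k → colsBelow (suc p) old new i k ≡ new i k
  below i k with ℕP.<-≤-connex k (suc p)
  ... | inj₁ k<sp = trans (colsBelow-< _ old new i k k<sp) (sym (valueCols-freezeCol p u g i k (ℕP.≤-pred k<sp)))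
  ... | inj₂ sp≤k = colsBelow-≥ _ old new i k sp≤k
  step : ∀ s → suc p ≤ s → s < n → detℕ n (colsBelow s old new) ≡ detℕ n (colsBelow (suc s) old new)
  step (suc t) (s≤s p≤t) s<n = detℕ-add-col-multiple n (suc t) t s<n (ℕP.<-trans (ℕP.n<1+n t) s<n) ℕP.1+n≢n (- 1ℚ) _ _
    (λ i k _ _ k≢s → colsBelow-off (suc t) old new i k k≢s)
    (λ i _ → trans (colsBelow-at (suc t) old new i)
               (trans (valueCols-mapΔ p u g i t p≤t)
                 (sym (cong₂ (λ a b → a + (- 1ℚ) · b) (colsBelow-at-suc (suc t) old new i)
                                                     (colsBelow-< (suc (suc t)) old new i t (ℕP.m<n⇒m<1+n (ℕP.n<1+n t)))))))

detℕ-valueCols≡diffCols : ∀ r n p u g → r ℕ.+ p ≡ n → detℕ n (valueCols p u g) ≡ detℕ n (diffCols p u g)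
detℕ-valueCols≡diffCols zero n p u g refl = detℕ-cong n _ _ λ i k _ k<p →
  trans (if<-yes k p _ _ k<p) (sym (if<-yes k p _ _ k<p))
detℕ-valueCols≡diffCols (suc r) n p u g e = begin
  detℕ n (valueCols p u g)                               ≡⟨ detℕ-valueCols-step n p u g p<n ⟩
  detℕ n (valueCols (suc p) (freezeCol p u g) (mapΔ g))
    ≡⟨ detℕ-valueCols≡diffCols r n (suc p) (freezeCol p u g) (mapΔ g) (trans (ℕP.+-suc r p) e) ⟩
  detℕ n (diffCols (suc p) (freezeCol p u g) (mapΔ g))
    ≡⟨ detℕ-cong n _ _ (λ i k _ _ → diffCols-freezeCol i k) ⟩
  detℕ n (diffCols p u g)                                ∎
  where
  open ≡-Reasoning
  p<n : p < n
  p<n = ℕP.m+n≤o⇒n≤o r (ℕP.≤-reflexive (trans (ℕP.+-suc r p) e))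
  diffCols-freezeCol : ∀ i k → diffCols (suc p) (freezeCol p u g) (mapΔ g) i k ≡ diffCols p u g i k
  diffCols-freezeCol i k with ℕP.<-≤-connex k (suc p)
  ... | inj₂ sp≤k = trans (if<-no k (suc p) _ _ sp≤k)
                      (sym (trans (if<-no k p _ _ (ℕP.<⇒≤ sp≤k)) (cong (λ z → Δ^ z (g i) 0ℚ) (ℕP.+-∸-assoc 1 sp≤k))))
  ... | inj₁ k<sp with ℕP.<-≤-connex k p
  ...   | inj₁ k<p = trans (if<-yes k (suc p) _ _ k<sp) (trans (if<-yes k p _ _ k<p) (sym (if<-yes k p _ _ k<p)))
  ...   | inj₂ p≤k = trans (if<-yes k (suc p) _ _ k<sp) (trans (if<-no k p _ _ p≤k)
                       (sym (trans (if<-no k p _ _ p≤k) (cong (λ z → Δ^ z (g i) 0ℚ) (ℕP.m≤n⇒m∸n≡0 (ℕP.≤-pred k<sp))))))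

detℕ-values≡differences : ∀ n (g : ℕ → ℚ → ℚ) → detℕ n (λ i k → g i (ℕ→ℚ k)) ≡ detℕ n (λ i k → Δ^ k (g i) 0ℚ)
detℕ-values≡differences n g = begin
  detℕ n (λ i k → g i (ℕ→ℚ k))         ≡⟨ detℕ-cong n _ _ (λ i k _ _ → sym (if<-no k 0 0ℚ _ z≤n)) ⟩
  detℕ n (valueCols 0 (λ _ _ → 0ℚ) g)  ≡⟨ detℕ-valueCols≡diffCols n n 0 (λ _ _ → 0ℚ) g (ℕP.+-identityʳ n) ⟩
  detℕ n (diffCols 0 (λ _ _ → 0ℚ) g)   ≡⟨ detℕ-cong n _ _ (λ i k _ _ → if<-no k 0 0ℚ _ z≤n) ⟩
  detℕ n (λ i k → Δ^ k (g i) 0ℚ)       ∎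
  where open ≡-Reasoning

-- Krattenthaler-type determinants

factorsA : (ℕ → ℚ) → ℕ → ℕ → ℚ → ℚ
factorsA A a zero X = 1ℚ
factorsA A a (suc len) X = (X + A a) · factorsA A (suc a) len X

factorsB : (ℕ → ℚ) → ℕ → ℚ → ℚ
factorsB B zero X = 1ℚ
factorsB B (suc i) X = factorsB B i X · (X + B (suc i))

-- krattPoly n A B i X = ∏_{i<l<n} (X + A l) · ∏_{1≤l≤i} (X + B l), row i of the matrix
-- in Krattenthaler's determinant lemma.
krattPoly : ℕ → (ℕ → ℚ) → (ℕ → ℚ) → ℕ → ℚ → ℚ
krattPoly n A B i X = factorsA A (suc i) (n ∸ suc i) X · factorsB B i X

krattMatrix : ℕ → (ℕ → ℚ) → (ℕ → ℚ) → Matrixℕ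
krattMatrix n A B i k = krattPoly n A B i (ℕ→ℚ k)

factorsA-shift : ∀ A a len X → factorsA (λ l → A (suc l)) a len X ≡ factorsA A (suc a) len X
factorsA-shift A a zero X = refl
factorsA-shift A a (suc len) X = cong ((X + A (suc a)) ·_) (factorsA-shift A (suc a) len X)

factorsA-cong : ∀ A A' a len X → (∀ l → A l ≡ A' l) → factorsA A a len X ≡ factorsA A' a len X
factorsA-cong A A' a zero X h = refl
factorsA-cong A A' a (suc len) X h = cong₂ (λ u v → (X + u) · v) (h a) (factorsA-cong A A' (suc a) len X h)

krattPoly-diff : ∀ n A B i X → i < n → krattPoly (suc n) A B i X - krattPoly (suc n) A B (suc i) X
  ≡ (A (suc i) - B (suc i)) · krattPoly n (λ l → A (suc l)) B i X
krattPoly-diff n A B i X i<n = begin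
  factorsA A (suc i) (n ∸ i) X · factorsB B i X - factorsA A (suc (suc i)) (n ∸ suc i) X · (factorsB B i X · (X + B (suc i)))
    ≡⟨ cong (λ z → factorsA A (suc i) z X · factorsB B i X - factorsA A (suc (suc i)) (n ∸ suc i) X · (factorsB B i X · (X + B (suc i)))) (ℕP.+-∸-assoc 1 i<n) ⟩
  (X + A (suc i)) · factorsA A (suc (suc i)) (n ∸ suc i) X · factorsB B i X - factorsA A (suc (suc i)) (n ∸ suc i) X · (factorsB B i X · (X + B (suc i)))
    ≡⟨ regroup X (A (suc i)) (B (suc i)) (factorsA A (suc (suc i)) (n ∸ suc i) X) (factorsB B i X) ⟩
  (A (suc i) - B (suc i)) · (factorsA A (suc (suc i)) (n ∸ suc i) X · factorsB B i X)
    ≡⟨ cong (λ z → (A (suc i) - B (suc i)) · (z · factorsB B i X)) (sym (factorsA-shift A (suc i) (n ∸ suc i) X)) ⟩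
  (A (suc i) - B (suc i)) · krattPoly n (λ l → A (suc l)) B i X ∎
  where
  open ≡-Reasoning
  regroup : ∀ X a b P Q → (X + a) · P · Q - P · (Q · (X + b)) ≡ (a - b) · (P · Q)
  regroup = solve-∀ ℚ-ring

ConstΔ^-factorsA : ∀ A a len D (g : ℚ → ℚ) → ConstΔ^ D (ℕ→ℚ (D !)) g
  → ConstΔ^ (len ℕ.+ D) (ℕ→ℚ ((len ℕ.+ D) !)) (λ X → factorsA A a len X · g X)
ConstΔ^-factorsA A a zero D g lg = ConstΔ^-cong D _ g _ (λ X → sym (ℚP.*-identityˡ (g X))) lg
ConstΔ^-factorsA A a (suc len) D g lg = ConstΔ^-subst _ _ _ _ (sym (ℕ→ℚ-!-suc (len ℕ.+ D)))
  (ConstΔ^-cong _ _ (λ X → (X + A a) · (factorsA A (suc a) len X · g X)) _ (λ X → sym (ℚP.*-assoc (X + A a) _ _))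
    (ConstΔ^-linear-factor (len ℕ.+ D) _ (A a) _ (ConstΔ^-factorsA A (suc a) len D g lg)))

ConstΔ^-factorsB : ∀ B i → ConstΔ^ i (ℕ→ℚ (i !)) (factorsB B i)
ConstΔ^-factorsB B zero = mkConstΔ^ λ x → refl
ConstΔ^-factorsB B (suc i) = ConstΔ^-subst _ _ _ _ (sym (ℕ→ℚ-!-suc i)) (ConstΔ^-linear-factorʳ i _ (B (suc i)) (factorsB B i) (ConstΔ^-factorsB B i))

ConstΔ^-krattPoly : ∀ n A B k → k < n → ConstΔ^ n 0ℚ (krattPoly n A B k)
ConstΔ^-krattPoly n A B k k<n = subst (λ z → ConstΔ^ z 0ℚ (krattPoly n A B k)) degree
  (ConstΔ^-suc _ _ _ (ConstΔ^-factorsA A (suc k) (n ∸ suc k) k (factorsB B k) (ConstΔ^-factorsB B k)))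
  where
  degree : suc ((n ∸ suc k) ℕ.+ k) ≡ n
  degree = trans (sym (ℕP.+-suc (n ∸ suc k) k)) (ℕP.m∸n+n≡m k<n)

krattRow : ℕ → (ℕ → ℚ) → (ℕ → ℚ) → ℕ → ℚ → ℚ
krattRow n A B k X = if< k n (krattPoly n (λ l → A (suc l)) B k X) (factorsB B n X)

detℕ-krattMatrix-rowDiffs : ∀ n A B → detℕ (suc n) (krattMatrix (suc n) A B)
  ≡ ∏ n (λ i → A (suc i) - B (suc i)) · detℕ (suc n) (λ k i → krattRow n A B k (ℕ→ℚ i))
detℕ-krattMatrix-rowDiffs n A B = begin
  detℕ (suc n) (krattMatrix (suc n) A B)
    ≡⟨ sym (detℕ-transpose (suc n) (krattMatrix (suc n) A B)) ⟩
  detℕ (suc n) N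
    ≡⟨ detℕ-cong (suc n) _ _ (λ i k _ _ → sym (colsBelow-≥ 0 M N i k z≤n)) ⟩
  detℕ (suc n) (colsBelow 0 M N)                       ≡⟨ detℕ-colsBelow (suc n) 0 M N z≤n step ⟩
  detℕ (suc n) M                                       ≡⟨ detℕ-scale-cols (suc n) w (transpose H) ⟩
  ∏ (suc n) w · detℕ (suc n) (transpose H)            ≡⟨ cong₂ _·_ ∏w (detℕ-transpose (suc n) H) ⟩
  ∏ n A-B · detℕ (suc n) H                             ∎
  where
  open ≡-Reasoning
  A-B : ℕ → ℚ
  A-B i = A (suc i) - B (suc i)
  w : ℕ → ℚ
  w k = if< k n (A-B k) 1ℚ
  H N M : Matrixℕ
  H k i = krattRow n A B k (ℕ→ℚ i)
  N i k = krattMatrix (suc n) A B k i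
  M i k = H k i · w k
  ∏w : ∏ (suc n) w ≡ ∏ n A-B
  ∏w = trans (cong₂ _·_ (∏-cong n w A-B (λ k k<n → if<-yes k n _ _ k<n)) (if<-no n n _ _ ℕP.≤-refl)) (ℚP.*-identityʳ _)
  M-diff : ∀ i s → s < n → M i s ≡ N i s + (- 1ℚ) · N i (suc s)
  M-diff i s s<n = begin
    H s i · w s                                   ≡⟨ cong₂ _·_ (if<-yes s n _ _ s<n) (if<-yes s n _ _ s<n) ⟩
    krattPoly n (λ l → A (suc l)) B s (ℕ→ℚ i) · A-B s ≡⟨ ℚP.*-comm _ (A-B s) ⟩
    A-B s · krattPoly n (λ l → A (suc l)) B s (ℕ→ℚ i) ≡⟨ sym (krattPoly-diff n A B s (ℕ→ℚ i) s<n) ⟩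
    N i s - N i (suc s)                           ≡⟨ x-y≡x+-1·y (N i s) (N i (suc s)) ⟩
    N i s + (- 1ℚ) · N i (suc s)                  ∎
  M-last : ∀ i → M i n ≡ N i n
  M-last i = begin
    H n i · w n                       ≡⟨ cong₂ _·_ (if<-no n n _ _ ℕP.≤-refl) (if<-no n n _ _ ℕP.≤-refl) ⟩
    factorsB B n (ℕ→ℚ i) · 1ℚ         ≡⟨ ℚP.*-comm (factorsB B n (ℕ→ℚ i)) 1ℚ ⟩
    1ℚ · factorsB B n (ℕ→ℚ i)
      ≡⟨ cong (λ z → factorsA A (suc n) z (ℕ→ℚ i) · factorsB B n (ℕ→ℚ i)) (sym (ℕP.n∸n≡0 n)) ⟩
    N i n                             ∎
  step : ∀ s → 0 ≤ s → s < suc n → detℕ (suc n) (colsBelow s M N) ≡ detℕ (suc n) (colsBelow (suc s) M N)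
  step s _ s<sn with ℕP.m≤n⇒m<n∨m≡n (ℕP.≤-pred s<sn)
  ... | inj₂ refl = detℕ-cong (suc n) _ _ λ i k _ _ → same i k
    where
    same : ∀ i k → colsBelow n M N i k ≡ colsBelow (suc n) M N i k
    same i k with k ℕ.≟ n
    ... | yes refl = trans (colsBelow-at n M N i) (trans (sym (M-last i)) (sym (colsBelow-at-suc n M N i)))
    ... | no k≢n   = colsBelow-off n M N i k k≢n
  ... | inj₁ s<n = sym (detℕ-add-col-multiple (suc n) s (suc s) s<sn (s≤s s<n) (ℕP.<⇒≢ (ℕP.n<1+n s)) (- 1ℚ) _ _
    (λ i k _ _ k≢s → sym (colsBelow-off s M N i k k≢s))
    (λ i _ → trans (colsBelow-at-suc s M N i)
               (trans (M-diff i s s<n)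
                 (sym (cong₂ (λ a b → a + (- 1ℚ) · b) (colsBelow-at s M N i) (colsBelow-≥ s M N i (suc s) (ℕP.n≤1+n s)))))))

detℕ-krattRows : ∀ n A B → detℕ (suc n) (λ k i → krattRow n A B k (ℕ→ℚ i))
  ≡ ℕ→ℚ (n !) · detℕ n (krattMatrix n (λ l → A (suc l)) B)
detℕ-krattRows n A B = begin
  detℕ (suc n) (λ k i → krattRow n A B k (ℕ→ℚ i)) ≡⟨ detℕ-values≡differences (suc n) (krattRow n A B) ⟩
  detℕ (suc n) R                                   ≡⟨ detℕ-last-col n R R-last-col ⟩
  R n n · detℕ n R
    ≡⟨ cong₂ _·_ R-corner (detℕ-cong n _ _ (λ k i k<n _ → R-upper k i k<n)) ⟩
  ℕ→ℚ (n !) · detℕ n (λ k i → Δ^ i (krattPoly n A' B k) 0ℚ)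
    ≡⟨ cong (ℕ→ℚ (n !) ·_) (sym (detℕ-values≡differences n (krattPoly n A' B))) ⟩
  ℕ→ℚ (n !) · detℕ n (krattMatrix n A' B)         ∎
  where
  open ≡-Reasoning
  A' : ℕ → ℚ
  A' l = A (suc l)
  R : Matrixℕ
  R k i = Δ^ i (krattRow n A B k) 0ℚ
  R-upper : ∀ k i → k < n → R k i ≡ Δ^ i (krattPoly n A' B k) 0ℚ
  R-upper k i k<n = Δ^-cong i _ _ (λ X → if<-yes k n _ _ k<n) 0ℚ
  R-last-col : ∀ k → k < n → R k n ≡ 0ℚ
  R-last-col k k<n = trans (R-upper k n k<n) (Δ^≡ (ConstΔ^-krattPoly n A' B k k<n) 0ℚ)
  R-corner : R n n ≡ ℕ→ℚ (n !)
  R-corner = trans (Δ^-cong n _ (factorsB B n) (λ X → if<-no n n _ _ ℕP.≤-refl) 0ℚ) (Δ^≡ (ConstΔ^-factorsB B n) 0ℚ)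

detℕ-krattMatrix-step : ∀ n A B → detℕ (suc n) (krattMatrix (suc n) A B)
  ≡ (∏ n (λ i → A (suc i) - B (suc i)) · ℕ→ℚ (n !)) · detℕ n (krattMatrix n (λ l → A (suc l)) B)
detℕ-krattMatrix-step n A B =
  trans (detℕ-krattMatrix-rowDiffs n A B)
        (trans (cong (∏ n (λ i → A (suc i) - B (suc i)) ·_) (detℕ-krattRows n A B))
               (sym (ℚP.*-assoc (∏ n (λ i → A (suc i) - B (suc i))) (ℕ→ℚ (n !)) _)))

-- Rising and falling factorials, binomial coefficients

rising : ℚ → ℕ → ℚ
rising z zero = 1ℚ
rising z (suc L) = z · rising (z + 1ℚ) L

rising-+ : ∀ p q z → rising z (p ℕ.+ q) ≡ rising z p · rising (z + ℕ→ℚ p) q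
rising-+ zero q z = trans (cong (λ w → rising w q) (sym (ℚP.+-identityʳ z))) (sym (ℚP.*-identityˡ _))
rising-+ (suc p) q z = begin
  z · rising (z + 1ℚ) (p ℕ.+ q) ≡⟨ cong (z ·_) (rising-+ p q (z + 1ℚ)) ⟩
  z · (rising (z + 1ℚ) p · rising (z + 1ℚ + ℕ→ℚ p) q)
    ≡⟨ cong (λ w → z · (rising (z + 1ℚ) p · rising w q)) shift ⟩
  z · (rising (z + 1ℚ) p · rising (z + ℕ→ℚ (suc p)) q) ≡⟨ sym (ℚP.*-assoc z _ _) ⟩
  z · rising (z + 1ℚ) p · rising (z + ℕ→ℚ (suc p)) q ∎
  where
  open ≡-Reasoning
  regroup : ∀ z p → z + 1ℚ + p ≡ z + (p + 1ℚ)
  regroup = solve-∀ ℚ-ring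
  shift : z + 1ℚ + ℕ→ℚ p ≡ z + ℕ→ℚ (suc p)
  shift = trans (regroup z (ℕ→ℚ p)) (cong (z +_) (sym (ℕ→ℚ-suc p)))

rising-suc : ∀ L z → rising z (suc L) ≡ rising z L · (z + ℕ→ℚ L)
rising-suc L z = trans (cong (rising z) (ℕP.+-comm 1 L)) (trans (rising-+ L 1 z) (cong (rising z L ·_) (ℚP.*-identityʳ _)))

falling : ℚ → ℕ → ℚ
falling z zero = 1ℚ
falling z (suc j) = falling z j · (z - ℕ→ℚ j)

1/suc·suc≡1 : ∀ k → ((ℤ.+ 1) ℚ./ suc k) · ℕ→ℚ (suc k) ≡ 1ℚ
1/suc·suc≡1 k = trans (cong₂ _·_ 1/suc≡mkℚ (ℕ→ℚ≡mkℚ (suc k))) (ℚP.*-inverseˡ (mkℚ (ℤ.+ suc k) 0 (coprime-1 (suc k))))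
  where
  1/suc≡mkℚ : (ℤ.+ 1) ℚ./ suc k ≡ mkℚ (ℤ.+ 1) k (1-coprimeTo (suc k))
  1/suc≡mkℚ = ℚP.normalize-coprime (1-coprimeTo (suc k))

binomℕ·!≡falling : ∀ z k → binomℕ z k · ℕ→ℚ (k !) ≡ falling z k
binomℕ·!≡falling z zero = ℚP.*-identityˡ 1ℚ
binomℕ·!≡falling z (suc k) = begin
  binomℕ z k · (z - ℕ→ℚ k) · ((ℤ.+ 1) ℚ./ suc k) · ℕ→ℚ (suc k !)
    ≡⟨ cong (binomℕ z k · (z - ℕ→ℚ k) · ((ℤ.+ 1) ℚ./ suc k) ·_) (ℕ→ℚ-!-suc k) ⟩
  binomℕ z k · (z - ℕ→ℚ k) · ((ℤ.+ 1) ℚ./ suc k) · (ℕ→ℚ (suc k) · ℕ→ℚ (k !))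
    ≡⟨ regroup (binomℕ z k) (z - ℕ→ℚ k) ((ℤ.+ 1) ℚ./ suc k) (ℕ→ℚ (suc k)) (ℕ→ℚ (k !)) ⟩
  (binomℕ z k · ℕ→ℚ (k !)) · (z - ℕ→ℚ k) · (((ℤ.+ 1) ℚ./ suc k) · ℕ→ℚ (suc k))
    ≡⟨ cong₂ (λ u v → u · (z - ℕ→ℚ k) · v) (binomℕ·!≡falling z k) (1/suc·suc≡1 k) ⟩
  falling z k · (z - ℕ→ℚ k) · 1ℚ ≡⟨ ℚP.*-identityʳ _ ⟩
  falling z (suc k) ∎
  where
  open ≡-Reasoning
  regroup : ∀ b t u s f → b · t · u · (s · f) ≡ (b · f) · t · (u · s)
  regroup = solve-∀ ℚ-ring

binomℕ-Δ·! : ∀ z j → (binomℕ z (suc j) - binomℕ z j) · ℕ→ℚ (suc j !) ≡ falling z j · (z - ℕ→ℚ j - ℕ→ℚ j - 1ℚ)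
binomℕ-Δ·! z j = begin
  (binomℕ z (suc j) - binomℕ z j) · ℕ→ℚ (suc j !)
    ≡⟨ ℚP.*-distribʳ-+ (ℕ→ℚ (suc j !)) (binomℕ z (suc j)) (- binomℕ z j) ⟩
  binomℕ z (suc j) · ℕ→ℚ (suc j !) + (- binomℕ z j) · ℕ→ℚ (suc j !)
    ≡⟨ cong₂ _+_ (binomℕ·!≡falling z (suc j)) (cong ((- binomℕ z j) ·_) (ℕ→ℚ-!-suc j)) ⟩
  falling z j · (z - ℕ→ℚ j) + (- binomℕ z j) · (ℕ→ℚ (suc j) · ℕ→ℚ (j !))
    ≡⟨ cong (λ w → falling z j · (z - ℕ→ℚ j) + (- binomℕ z j) · (w · ℕ→ℚ (j !))) (ℕ→ℚ-suc j) ⟩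
  falling z j · (z - ℕ→ℚ j) + (- binomℕ z j) · ((ℕ→ℚ j + 1ℚ) · ℕ→ℚ (j !))
    ≡⟨ regroup (falling z j) z (ℕ→ℚ j) (binomℕ z j) (ℕ→ℚ (j !)) ⟩
  falling z j · (z - ℕ→ℚ j - ℕ→ℚ j - 1ℚ) + (falling z j - binomℕ z j · ℕ→ℚ (j !)) · (ℕ→ℚ j + 1ℚ)
    ≡⟨ cong (λ w → falling z j · (z - ℕ→ℚ j - ℕ→ℚ j - 1ℚ) + (falling z j - w) · (ℕ→ℚ j + 1ℚ)) (binomℕ·!≡falling z j) ⟩
  falling z j · (z - ℕ→ℚ j - ℕ→ℚ j - 1ℚ) + (falling z j - falling z j) · (ℕ→ℚ j + 1ℚ)
    ≡⟨ regroup₂ (falling z j · (z - ℕ→ℚ j - ℕ→ℚ j - 1ℚ)) (falling z j) (ℕ→ℚ j + 1ℚ) ⟩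
  falling z j · (z - ℕ→ℚ j - ℕ→ℚ j - 1ℚ) ∎
  where
  open ≡-Reasoning
  regroup : ∀ F z j b f → F · (z - j) + (- b) · ((j + 1ℚ) · f) ≡ F · (z - j - j - 1ℚ) + (F - b · f) · (j + 1ℚ)
  regroup = solve-∀ ℚ-ring
  regroup₂ : ∀ a F s → a + (F - F) · s ≡ a
  regroup₂ = solve-∀ ℚ-ring

falling≡rising : ∀ L z → falling (z + ℕ→ℚ L) L ≡ rising (z + 1ℚ) L
falling≡rising zero z = refl
falling≡rising (suc L) z = begin
  falling (z + ℕ→ℚ (suc L)) L · (z + ℕ→ℚ (suc L) - ℕ→ℚ L)
    ≡⟨ cong (λ w → falling (z + w) L · (z + w - ℕ→ℚ L)) (ℕ→ℚ-suc L) ⟩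
  falling (z + (ℕ→ℚ L + 1ℚ)) L · (z + (ℕ→ℚ L + 1ℚ) - ℕ→ℚ L)
    ≡⟨ cong₂ (λ u v → falling u L · v) (regroup₁ z (ℕ→ℚ L)) (regroup₂ z (ℕ→ℚ L)) ⟩
  falling (z + 1ℚ + ℕ→ℚ L) L · (z + 1ℚ) ≡⟨ cong (_· (z + 1ℚ)) (falling≡rising L (z + 1ℚ)) ⟩
  rising (z + 1ℚ + 1ℚ) L · (z + 1ℚ) ≡⟨ ℚP.*-comm (rising (z + 1ℚ + 1ℚ) L) (z + 1ℚ) ⟩
  rising (z + 1ℚ) (suc L) ∎
  where
  open ≡-Reasoning
  regroup₁ : ∀ z l → z + (l + 1ℚ) ≡ z + 1ℚ + l
  regroup₁ = solve-∀ ℚ-ring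
  regroup₂ : ∀ z l → z + (l + 1ℚ) - l ≡ z + 1ℚ
  regroup₂ = solve-∀ ℚ-ring

!≡falling·! : ∀ a i → i ≤ a → ℕ→ℚ (a !) ≡ falling (ℕ→ℚ a) i · ℕ→ℚ ((a ∸ i) !)
!≡falling·! a zero _ = sym (ℚP.*-identityˡ _)
!≡falling·! a (suc i) si≤a = begin
  ℕ→ℚ (a !) ≡⟨ !≡falling·! a i (ℕP.<⇒≤ si≤a) ⟩
  falling (ℕ→ℚ a) i · ℕ→ℚ ((a ∸ i) !) ≡⟨ cong (λ w → falling (ℕ→ℚ a) i · ℕ→ℚ (w !)) a∸i≡suc ⟩
  falling (ℕ→ℚ a) i · ℕ→ℚ (suc (a ∸ suc i) !) ≡⟨ cong (falling (ℕ→ℚ a) i ·_) (ℕ→ℚ-!-suc (a ∸ suc i)) ⟩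
  falling (ℕ→ℚ a) i · (ℕ→ℚ (suc (a ∸ suc i)) · ℕ→ℚ ((a ∸ suc i) !))
    ≡⟨ cong (λ w → falling (ℕ→ℚ a) i · (ℕ→ℚ w · ℕ→ℚ ((a ∸ suc i) !))) (sym a∸i≡suc) ⟩
  falling (ℕ→ℚ a) i · (ℕ→ℚ (a ∸ i) · ℕ→ℚ ((a ∸ suc i) !))
    ≡⟨ cong (λ w → falling (ℕ→ℚ a) i · (w · ℕ→ℚ ((a ∸ suc i) !))) (ℕ→ℚ-∸ a i (ℕP.<⇒≤ si≤a)) ⟩
  falling (ℕ→ℚ a) i · ((ℕ→ℚ a - ℕ→ℚ i) · ℕ→ℚ ((a ∸ suc i) !))
    ≡⟨ sym (ℚP.*-assoc (falling (ℕ→ℚ a) i) (ℕ→ℚ a - ℕ→ℚ i) (ℕ→ℚ ((a ∸ suc i) !))) ⟩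
  falling (ℕ→ℚ a) (suc i) · ℕ→ℚ ((a ∸ suc i) !) ∎
  where
  open ≡-Reasoning
  a∸i≡suc : a ∸ i ≡ suc (a ∸ suc i)
  a∸i≡suc = ℕP.+-∸-assoc 1 si≤a

falling-ℕ-zero : ∀ a i → a < i → falling (ℕ→ℚ a) i ≡ 0ℚ
falling-ℕ-zero a (suc i) (s≤s a≤i) with ℕP.m≤n⇒m<n∨m≡n a≤i
... | inj₁ a<i = trans (cong (_· (ℕ→ℚ a - ℕ→ℚ i)) (falling-ℕ-zero a i a<i)) (ℚP.*-zeroˡ (ℕ→ℚ a - ℕ→ℚ i))
... | inj₂ refl = trans (cong (falling (ℕ→ℚ a) a ·_) (ℚP.+-inverseʳ (ℕ→ℚ a))) (ℚP.*-zeroʳ (falling (ℕ→ℚ a) a))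

idx1 : ∀ k i m → (ℤ.+ k) ℤ.- (ℤ.+ i) ℤ.+ (ℤ.+ m) ≡ (k ℕ.+ m) ⊖ i
idx1 k i m = trans (cong (ℤ._+ ℤ.+ m) (ℤP.[+m]-[+n]≡m⊖n k i)) (ℤP.distribˡ-⊖-+-pos m k i)

idx2 : ∀ k i m → (ℤ.+ k) ℤ.- (ℤ.+ i) ℤ.+ (ℤ.+ m) ℤ.- (ℤ.+ 1) ≡ (k ℕ.+ m) ⊖ suc i
idx2 k i m = trans (cong (ℤ._- ℤ.+ 1) (idx1 k i m)) (trans (ℤP.distribˡ-⊖-+-neg 0 (k ℕ.+ m) i) (cong ((k ℕ.+ m) ⊖_) (ℕP.+-identityʳ (suc i))))

binom-⊖-< : ∀ z a b → a < b → binom z (a ⊖ b) ≡ 0ℚ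
binom-⊖-< z a b a<b = cong (binom z) (trans (ℤP.⊖-< a<b) (cong (λ t → ℤ.- (ℤ.+ t)) (ℕP.+-∸-assoc 1 a<b)))

binom-⊖-≥ : ∀ z a b → b ≤ a → binom z (a ⊖ b) ≡ binomℕ z (a ∸ b)
binom-⊖-≥ z a b b≤a = cong (binom z) (ℤP.⊖-≥ b≤a)

ℕ→ℚ-nonNeg : ∀ l → 0ℚ ℚ.≤ ℕ→ℚ l
ℕ→ℚ-nonNeg l = ℚP.nonNegative⁻¹ (ℕ→ℚ l) {{ℚP.normalize-nonNeg l 1}}

pos+nonNeg : ∀ {a b} → 0ℚ ℚ.< a → 0ℚ ℚ.≤ b → 0ℚ ℚ.< a + b
pos+nonNeg {a} {b} pa nb = subst (ℚ._< a + b) (ℚP.+-identityʳ 0ℚ) (ℚP.+-mono-<-≤ pa nb)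

nonNeg+pos : ∀ {a b} → 0ℚ ℚ.≤ a → 0ℚ ℚ.< b → 0ℚ ℚ.< a + b
nonNeg+pos {a} {b} na pb = subst (ℚ._< a + b) (ℚP.+-identityʳ 0ℚ) (ℚP.+-mono-≤-< na pb)

pos·pos : ∀ {a b} → 0ℚ ℚ.< a → 0ℚ ℚ.< b → 0ℚ ℚ.< a · b
pos·pos {a} {b} pa pb = ℚP.positive⁻¹ (a · b) {{ℚP.pos*pos⇒pos a {{ℚ.positive pa}} b {{ℚ.positive pb}}}}

0<1 : 0ℚ ℚ.< 1ℚ
0<1 = ℚP.positive⁻¹ 1ℚ

0≤1 : 0ℚ ℚ.≤ 1ℚ
0≤1 = ℚP.<⇒≤ 0<1

rising-pos : ∀ a z → 0ℚ ℚ.< z → 0ℚ ℚ.< rising z a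
rising-pos zero z pz = 0<1
rising-pos (suc a) z pz = pos·pos pz (rising-pos a (z + 1ℚ) (pos+nonNeg pz 0≤1))

ℕ→ℚ-suc-pos : ∀ u → 0ℚ ℚ.< ℕ→ℚ (suc u)
ℕ→ℚ-suc-pos u = subst (0ℚ ℚ.<_) (sym (ℕ→ℚ-suc u)) (nonNeg+pos (ℕ→ℚ-nonNeg u) 0<1)

ℕ→ℚ-!-pos : ∀ t → 0ℚ ℚ.< ℕ→ℚ (t !)
ℕ→ℚ-!-pos t = subst (λ w → 0ℚ ℚ.< ℕ→ℚ w) (trans (ℕP.+-comm 1 _) (ℕP.m∸n+n≡m (ℕP.1≤n! t))) (ℕ→ℚ-suc-pos (t ! ∸ 1))

∏-pos : ∀ n (f : ℕ → ℚ) → (∀ k → 0ℚ ℚ.< f k) → 0ℚ ℚ.< ∏ n f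
∏-pos zero f h = 0<1
∏-pos (suc n) f h = pos·pos (∏-pos n f h) (h n)

pos⇒≢0 : ∀ {a} → 0ℚ ℚ.< a → a ≢ 0ℚ
pos⇒≢0 pa e = ℚP.<-irrefl refl (subst (0ℚ ℚ.<_) e pa)

·-cancelʳ : ∀ a b c → a · c ≡ b · c → c ≢ 0ℚ → a ≡ b
·-cancelʳ a b c e c≢0 = begin
  a ≡⟨ sym (ℚP.*-identityʳ a) ⟩
  a · 1ℚ ≡⟨ cong (a ·_) (sym (ℚP.*-inverseʳ c)) ⟩
  a · (c · ic) ≡⟨ sym (ℚP.*-assoc a c ic) ⟩
  (a · c) · ic ≡⟨ cong (_· ic) e ⟩
  (b · c) · ic ≡⟨ ℚP.*-assoc b c ic ⟩
  b · (c · ic) ≡⟨ cong (b ·_) (ℚP.*-inverseʳ c) ⟩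
  b · 1ℚ ≡⟨ ℚP.*-identityʳ b ⟩
  b ∎
  where
  open ≡-Reasoning
  instance _ = ℚ.≢-nonZero c≢0
  ic = ℚ.1/ c

falling-shift : ∀ z k → falling (z + 1ℚ) (suc k) ≡ (z + 1ℚ) · falling z k
falling-shift z zero = regroup₀ (z + 1ℚ)
  where
  regroup₀ : ∀ a → 1ℚ · (a - 0ℚ) ≡ a · 1ℚ
  regroup₀ = solve-∀ ℚ-ring
falling-shift z (suc k) = begin
  falling (z + 1ℚ) (suc k) · (z + 1ℚ - ℕ→ℚ (suc k))
    ≡⟨ cong₂ _·_ (falling-shift z k) (cong (λ w → z + 1ℚ - w) (ℕ→ℚ-suc k)) ⟩
  (z + 1ℚ) · falling z k · (z + 1ℚ - (ℕ→ℚ k + 1ℚ)) ≡⟨ regroup (z + 1ℚ) (falling z k) z (ℕ→ℚ k) ⟩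
  (z + 1ℚ) · (falling z k · (z - ℕ→ℚ k)) ∎
  where
  open ≡-Reasoning
  regroup : ∀ a f z k → a · f · (z + 1ℚ - (k + 1ℚ)) ≡ a · (f · (z - k))
  regroup = solve-∀ ℚ-ring

binomℕ-pascal : ∀ z k → binomℕ (z + 1ℚ) (suc k) ≡ binomℕ z (suc k) + binomℕ z k
binomℕ-pascal z k = ·-cancelʳ _ _ (ℕ→ℚ (suc k !)) times-! (pos⇒≢0 (ℕ→ℚ-!-pos (suc k)))
  where
  open ≡-Reasoning
  times-! : binomℕ (z + 1ℚ) (suc k) · ℕ→ℚ (suc k !) ≡ (binomℕ z (suc k) + binomℕ z k) · ℕ→ℚ (suc k !)
  times-! = begin
    binomℕ (z + 1ℚ) (suc k) · ℕ→ℚ (suc k !) ≡⟨ binomℕ·!≡falling (z + 1ℚ) (suc k) ⟩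
    falling (z + 1ℚ) (suc k) ≡⟨ falling-shift z k ⟩
    (z + 1ℚ) · falling z k ≡⟨ regroup z (falling z k) (ℕ→ℚ k) ⟩
    falling z k · (z - ℕ→ℚ k) + falling z k · (ℕ→ℚ k + 1ℚ)
      ≡⟨ cong₂ (λ u v → u + v · (ℕ→ℚ k + 1ℚ)) (sym (binomℕ·!≡falling z (suc k))) (sym (binomℕ·!≡falling z k)) ⟩
    binomℕ z (suc k) · ℕ→ℚ (suc k !) + (binomℕ z k · ℕ→ℚ (k !)) · (ℕ→ℚ k + 1ℚ)
      ≡⟨ cong (λ w → binomℕ z (suc k) · ℕ→ℚ (suc k !) + w) (regroup₂ (binomℕ z k) (ℕ→ℚ (k !)) (ℕ→ℚ k + 1ℚ)) ⟩
    binomℕ z (suc k) · ℕ→ℚ (suc k !) + binomℕ z k · ((ℕ→ℚ k + 1ℚ) · ℕ→ℚ (k !))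
      ≡⟨ cong (λ w → binomℕ z (suc k) · ℕ→ℚ (suc k !) + binomℕ z k · (w · ℕ→ℚ (k !))) (sym (ℕ→ℚ-suc k)) ⟩
    binomℕ z (suc k) · ℕ→ℚ (suc k !) + binomℕ z k · (ℕ→ℚ (suc k) · ℕ→ℚ (k !))
      ≡⟨ cong (λ w → binomℕ z (suc k) · ℕ→ℚ (suc k !) + binomℕ z k · w) (sym (ℕ→ℚ-!-suc k)) ⟩
    binomℕ z (suc k) · ℕ→ℚ (suc k !) + binomℕ z k · ℕ→ℚ (suc k !)
      ≡⟨ sym (ℚP.*-distribʳ-+ (ℕ→ℚ (suc k !)) (binomℕ z (suc k)) (binomℕ z k)) ⟩
    (binomℕ z (suc k) + binomℕ z k) · ℕ→ℚ (suc k !) ∎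
    where
    regroup : ∀ z f k → (z + 1ℚ) · f ≡ f · (z - k) + f · (k + 1ℚ)
    regroup = solve-∀ ℚ-ring
    regroup₂ : ∀ a b c → (a · b) · c ≡ a · (c · b)
    regroup₂ = solve-∀ ℚ-ring

+suc-1 : ∀ k → ℤ.+ suc k ℤ.- ℤ.+ 1 ≡ ℤ.+ k
+suc-1 k = trans (ℤP.[+m]-[+n]≡m⊖n (suc k) 1) (ℤP.⊖-≥ z≤n)

binom-pascal : ∀ z K → binom (z + 1ℚ) K ≡ binom z K + binom z (K ℤ.- ℤ.+ 1)
binom-pascal z (ℤ.+ zero) = sym (ℚP.+-identityʳ 1ℚ)
binom-pascal z (ℤ.+ suc k) = trans (binomℕ-pascal z k) (cong (λ w → binomℕ z (suc k) + binom z w) (sym (+suc-1 k)))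
binom-pascal z -[1+ t ] = refl

binom-pascal² : ∀ z K → binom (z + 1ℚ + 1ℚ) K
  ≡ binom z K + binom z (K ℤ.- ℤ.+ 1) + binom z (K ℤ.- ℤ.+ 1) + binom z (K ℤ.- ℤ.+ 1 ℤ.- ℤ.+ 1)
binom-pascal² z K = begin
  binom (z + 1ℚ + 1ℚ) K ≡⟨ binom-pascal (z + 1ℚ) K ⟩
  binom (z + 1ℚ) K + binom (z + 1ℚ) (K ℤ.- ℤ.+ 1)
    ≡⟨ cong₂ _+_ (binom-pascal z K) (binom-pascal z (K ℤ.- ℤ.+ 1)) ⟩
  (binom z K + binom z (K ℤ.- ℤ.+ 1)) + (binom z (K ℤ.- ℤ.+ 1) + binom z (K ℤ.- ℤ.+ 1 ℤ.- ℤ.+ 1))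
    ≡⟨ regroup (binom z K) (binom z (K ℤ.- ℤ.+ 1)) (binom z (K ℤ.- ℤ.+ 1)) (binom z (K ℤ.- ℤ.+ 1 ℤ.- ℤ.+ 1)) ⟩
  binom z K + binom z (K ℤ.- ℤ.+ 1) + binom z (K ℤ.- ℤ.+ 1) + binom z (K ℤ.- ℤ.+ 1 ℤ.- ℤ.+ 1) ∎
  where
  open ≡-Reasoning
  regroup : ∀ a b c d → (a + b) + (c + d) ≡ a + b + c + d
  regroup = solve-∀ ℚ-ring

Bᵀ : ℕ → ℚ → Matrixℕ
Bᵀ m x i k = binom (x + ℕ→ℚ m + ℕ→ℚ (2 * k)) ((ℤ.+ k) ℤ.- (ℤ.+ i) ℤ.+ (ℤ.+ m))
           - binom (x + ℕ→ℚ m + ℕ→ℚ (2 * k)) ((ℤ.+ k) ℤ.- (ℤ.+ i) ℤ.+ (ℤ.+ m) ℤ.- (ℤ.+ 1))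

-- From T to Bᵀ by column operations

top : ℕ → ℚ → ℕ → ℚ
top m x r = x + ℕ→ℚ m + ℕ→ℚ (2 * r)

top-suc : ∀ m x r → top m x (suc r) ≡ top m x r + 1ℚ + 1ℚ
top-suc m x r = begin
  x + ℕ→ℚ m + ℕ→ℚ (2 * suc r)              ≡⟨ cong (λ w → x + ℕ→ℚ m + w) (ℕ→ℚ-2* (suc r)) ⟩
  x + ℕ→ℚ m + (ℕ→ℚ (suc r) + ℕ→ℚ (suc r))  ≡⟨ cong (λ w → x + ℕ→ℚ m + (w + w)) (ℕ→ℚ-suc r) ⟩
  x + ℕ→ℚ m + ((ℕ→ℚ r + 1ℚ) + (ℕ→ℚ r + 1ℚ)) ≡⟨ regroup x (ℕ→ℚ m) (ℕ→ℚ r) ⟩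
  x + ℕ→ℚ m + (ℕ→ℚ r + ℕ→ℚ r) + 1ℚ + 1ℚ  ≡⟨ cong (λ w → x + ℕ→ℚ m + w + 1ℚ + 1ℚ) (sym (ℕ→ℚ-2* r)) ⟩
  x + ℕ→ℚ m + ℕ→ℚ (2 * r) + 1ℚ + 1ℚ       ∎
  where
  open ≡-Reasoning
  regroup : ∀ x m r → x + m + ((r + 1ℚ) + (r + 1ℚ)) ≡ x + m + (r + r) + 1ℚ + 1ℚ
  regroup = solve-∀ ℚ-ring

binomTop : ℕ → ℚ → ℕ → ℕ → ℤ → ℚ
binomTop m x r i J = binom (top m x r) (ℤ.+ m ℤ.- ℤ.+ i ℤ.+ J)

reflectIdx : ℕ → ℤ → ℤ
reflectIdx r J = ℤ.+ r ℤ.+ ℤ.+ r ℤ.- ℤ.+ 1 ℤ.- J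

-- Entry (i, J) of stage r of the column operations taking T to Bᵀ.
Gℤ : ℕ → ℚ → ℕ → ℕ → ℤ → ℚ
Gℤ m x r i J = binomTop m x r i J - binomTop m x r i (reflectIdx r J)

binomTop-suc : ∀ m x r i J → binomTop m x (suc r) i J
  ≡ binomTop m x r i J + binomTop m x r i (J ℤ.- ℤ.+ 1) + binomTop m x r i (J ℤ.- ℤ.+ 1) + binomTop m x r i (J ℤ.- ℤ.+ 1 ℤ.- ℤ.+ 1)
binomTop-suc m x r i J = begin
  binom (top m x (suc r)) K                    ≡⟨ cong (λ z → binom z K) (top-suc m x r) ⟩
  binom (top m x r + 1ℚ + 1ℚ) K                ≡⟨ binom-pascal² (top m x r) K ⟩
  binom Y K + binom Y (K ℤ.- ℤ.+ 1) + binom Y (K ℤ.- ℤ.+ 1) + binom Y (K ℤ.- ℤ.+ 1 ℤ.- ℤ.+ 1)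
    ≡⟨ cong₂ (λ a b → binom Y K + binom Y a + binom Y a + binom Y b) (shift₁ (ℤ.+ m) (ℤ.+ i) J) (shift₂ (ℤ.+ m) (ℤ.+ i) J) ⟩
  binomTop m x r i J + binomTop m x r i (J ℤ.- ℤ.+ 1) + binomTop m x r i (J ℤ.- ℤ.+ 1) + binomTop m x r i (J ℤ.- ℤ.+ 1 ℤ.- ℤ.+ 1) ∎
  where
  open ≡-Reasoning
  Y = top m x r
  K = ℤ.+ m ℤ.- ℤ.+ i ℤ.+ J
  shift₁ : ∀ M I J → M ℤ.- I ℤ.+ J ℤ.- ℤ.+ 1 ≡ M ℤ.- I ℤ.+ (J ℤ.- ℤ.+ 1)
  shift₁ = ℤ-Solver.solve-∀
  shift₂ : ∀ M I J → M ℤ.- I ℤ.+ J ℤ.- ℤ.+ 1 ℤ.- ℤ.+ 1 ≡ M ℤ.- I ℤ.+ (J ℤ.- ℤ.+ 1 ℤ.- ℤ.+ 1)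
  shift₂ = ℤ-Solver.solve-∀

Gℤ-pascal : ∀ m x r i J → Gℤ m x (suc r) i J
  ≡ Gℤ m x r i J + Gℤ m x r i (J ℤ.- ℤ.+ 1) + Gℤ m x r i (J ℤ.- ℤ.+ 1) + Gℤ m x r i (J ℤ.- ℤ.+ 1 ℤ.- ℤ.+ 1)
Gℤ-pascal m x r i J = begin
  f (suc r) J - f (suc r) R'
    ≡⟨ cong₂ _-_ (binomTop-suc m x r i J) (binomTop-suc m x r i R') ⟩
  (f r J + f r J₁ + f r J₁ + f r J₂) - (f r R' + f r (R' ℤ.- ℤ.+ 1) + f r (R' ℤ.- ℤ.+ 1) + f r (R' ℤ.- ℤ.+ 1 ℤ.- ℤ.+ 1))
    ≡⟨ cong₃ (λ a b c → (f r J + f r J₁ + f r J₁ + f r J₂) - (f r a + f r b + f r b + f r c))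
             (reflect₂ (ℤ.+ r) J) (reflect₁ (ℤ.+ r) J) (reflect₀ (ℤ.+ r) J) ⟩
  (f r J + f r J₁ + f r J₁ + f r J₂) - (f r (reflectIdx r J₂) + f r (reflectIdx r J₁) + f r (reflectIdx r J₁) + f r (reflectIdx r J))
    ≡⟨ regroup (f r J) (f r J₁) (f r J₂) (f r (reflectIdx r J)) (f r (reflectIdx r J₁)) (f r (reflectIdx r J₂)) ⟩
  Gℤ m x r i J + Gℤ m x r i J₁ + Gℤ m x r i J₁ + Gℤ m x r i J₂ ∎
  where
  open ≡-Reasoning
  f : ℕ → ℤ → ℚ
  f r = binomTop m x r i
  J₁ = J ℤ.- ℤ.+ 1
  J₂ = J ℤ.- ℤ.+ 1 ℤ.- ℤ.+ 1
  R' = reflectIdx (suc r) J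
  reflect₂ : ∀ R J → (ℤ.+ 1 ℤ.+ R) ℤ.+ (ℤ.+ 1 ℤ.+ R) ℤ.- ℤ.+ 1 ℤ.- J ≡ R ℤ.+ R ℤ.- ℤ.+ 1 ℤ.- (J ℤ.- ℤ.+ 1 ℤ.- ℤ.+ 1)
  reflect₂ = ℤ-Solver.solve-∀
  reflect₁ : ∀ R J → (ℤ.+ 1 ℤ.+ R) ℤ.+ (ℤ.+ 1 ℤ.+ R) ℤ.- ℤ.+ 1 ℤ.- J ℤ.- ℤ.+ 1 ≡ R ℤ.+ R ℤ.- ℤ.+ 1 ℤ.- (J ℤ.- ℤ.+ 1)
  reflect₁ = ℤ-Solver.solve-∀
  reflect₀ : ∀ R J → (ℤ.+ 1 ℤ.+ R) ℤ.+ (ℤ.+ 1 ℤ.+ R) ℤ.- ℤ.+ 1 ℤ.- J ℤ.- ℤ.+ 1 ℤ.- ℤ.+ 1 ≡ R ℤ.+ R ℤ.- ℤ.+ 1 ℤ.- J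
  reflect₀ = ℤ-Solver.solve-∀
  regroup : ∀ a₀ a₁ a₂ b₀ b₁ b₂ → (a₀ + a₁ + a₁ + a₂) - (b₂ + b₁ + b₁ + b₀) ≡ (a₀ - b₀) + (a₁ - b₁) + (a₁ - b₁) + (a₂ - b₂)
  regroup = solve-∀ ℚ-ring

Gℤ-antisym : ∀ m x r i → Gℤ m x r i (ℤ.+ r ℤ.- ℤ.+ 1) ≡ - Gℤ m x r i (ℤ.+ r)
Gℤ-antisym m x r i = begin
  f (ℤ.+ r ℤ.- ℤ.+ 1) - f (reflectIdx r (ℤ.+ r ℤ.- ℤ.+ 1))
    ≡⟨ cong (λ K → f (ℤ.+ r ℤ.- ℤ.+ 1) - f K) (reflect-pred (ℤ.+ r)) ⟩
  f (ℤ.+ r ℤ.- ℤ.+ 1) - f (ℤ.+ r)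
    ≡⟨ cong (λ K → f K - f (ℤ.+ r)) (sym (reflect-self (ℤ.+ r))) ⟩
  f (reflectIdx r (ℤ.+ r)) - f (ℤ.+ r)
    ≡⟨ a-b≡-[b-a] (f (reflectIdx r (ℤ.+ r))) (f (ℤ.+ r)) ⟩
  - (f (ℤ.+ r) - f (reflectIdx r (ℤ.+ r)))                 ∎
  where
  open ≡-Reasoning
  f = binomTop m x r i
  reflect-pred : ∀ R → R ℤ.+ R ℤ.- ℤ.+ 1 ℤ.- (R ℤ.- ℤ.+ 1) ≡ R
  reflect-pred = ℤ-Solver.solve-∀
  reflect-self : ∀ R → R ℤ.+ R ℤ.- ℤ.+ 1 ℤ.- R ≡ R ℤ.- ℤ.+ 1
  reflect-self = ℤ-Solver.solve-∀
  a-b≡-[b-a] : ∀ a b → a - b ≡ - (b - a)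
  a-b≡-[b-a] = solve-∀ ℚ-ring

G : ℕ → ℚ → ℕ → ℕ → ℕ → ℚ
G m x r i j = Gℤ m x r i (ℤ.+ j)

G-step-diag : ∀ m x r i → G m x (suc r) i (suc r) ≡ G m x r i (suc r) + 1ℚ · G m x r i r
G-step-diag m x r i = begin
  g (suc r) (ℤ.+ suc r)
    ≡⟨ Gℤ-pascal m x r i (ℤ.+ suc r) ⟩
  g r (ℤ.+ suc r) + g r J₁ + g r J₁ + g r (J₁ ℤ.- ℤ.+ 1)
    ≡⟨ cong (λ K → g r (ℤ.+ suc r) + g r K + g r K + g r (K ℤ.- ℤ.+ 1)) (+suc-1 r) ⟩
  g r (ℤ.+ suc r) + g r (ℤ.+ r) + g r (ℤ.+ r) + g r (ℤ.+ r ℤ.- ℤ.+ 1)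
    ≡⟨ cong (g r (ℤ.+ suc r) + g r (ℤ.+ r) + g r (ℤ.+ r) +_) (Gℤ-antisym m x r i) ⟩
  g r (ℤ.+ suc r) + g r (ℤ.+ r) + g r (ℤ.+ r) + - g r (ℤ.+ r)
    ≡⟨ simplify (g r (ℤ.+ suc r)) (g r (ℤ.+ r)) ⟩
  g r (ℤ.+ suc r) + 1ℚ · g r (ℤ.+ r)                                         ∎
  where
  open ≡-Reasoning
  g : ℕ → ℤ → ℚ
  g r = Gℤ m x r i
  J₁ = ℤ.+ suc r ℤ.- ℤ.+ 1
  simplify : ∀ a b → a + b + b + - b ≡ a + 1ℚ · b
  simplify = solve-∀ ℚ-ring

G-step : ∀ m x r i s → G m x (suc r) i (suc (suc s))
  ≡ (G m x r i (suc (suc s)) + (1ℚ + 1ℚ) · G m x r i (suc s)) + 1ℚ · G m x r i s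
G-step m x r i s = begin
  g (suc r) J₂                                                                ≡⟨ Gℤ-pascal m x r i J₂ ⟩
  g r J₂ + g r (J₂ ℤ.- ℤ.+ 1) + g r (J₂ ℤ.- ℤ.+ 1) + g r (J₂ ℤ.- ℤ.+ 1 ℤ.- ℤ.+ 1)
    ≡⟨ cong (λ K → g r J₂ + g r K + g r K + g r (K ℤ.- ℤ.+ 1)) (+suc-1 (suc s)) ⟩
  g r J₂ + g r (ℤ.+ suc s) + g r (ℤ.+ suc s) + g r (ℤ.+ suc s ℤ.- ℤ.+ 1)
    ≡⟨ cong (λ K → g r J₂ + g r (ℤ.+ suc s) + g r (ℤ.+ suc s) + g r K) (+suc-1 s) ⟩
  g r J₂ + g r (ℤ.+ suc s) + g r (ℤ.+ suc s) + g r (ℤ.+ s)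
    ≡⟨ regroup (g r J₂) (g r (ℤ.+ suc s)) (g r (ℤ.+ s)) ⟩
  (g r J₂ + (1ℚ + 1ℚ) · g r (ℤ.+ suc s)) + 1ℚ · g r (ℤ.+ s)                   ∎
  where
  open ≡-Reasoning
  g : ℕ → ℤ → ℚ
  g r = Gℤ m x r i
  J₂ = ℤ.+ suc (suc s)
  regroup : ∀ a b c → a + b + b + c ≡ (a + (1ℚ + 1ℚ) · b) + 1ℚ · c
  regroup = solve-∀ ℚ-ring

stageMatrix : (ℕ → ℕ → ℕ → ℚ) → ℕ → Matrixℕ
stageMatrix G r i j = if< j r (G j i j) (G r i j)

detℕ-stageMatrix-suc : ∀ (G : ℕ → ℕ → ℕ → ℚ)
  → (∀ r i → G (suc r) i (suc r) ≡ G r i (suc r) + 1ℚ · G r i r)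
  → (∀ r i s → G (suc r) i (suc (suc s)) ≡ (G r i (suc (suc s)) + (1ℚ + 1ℚ) · G r i (suc s)) + 1ℚ · G r i s)
  → ∀ n r → r < n → detℕ n (stageMatrix G r) ≡ detℕ n (stageMatrix G (suc r))
detℕ-stageMatrix-suc G step-diag step n r r<n = begin
  detℕ n old                         ≡⟨ sym (detℕ-colsBelow n (suc r) old new r<n sweep) ⟩
  detℕ n (colsBelow (suc r) old new) ≡⟨ detℕ-cong n _ _ (λ i j _ _ → below i j) ⟩
  detℕ n new                         ∎
  where
  open ≡-Reasoning
  old new : Matrixℕ
  old = stageMatrix G r
  new = stageMatrix G (suc r)
  below : ∀ i j → colsBelow (suc r) old new i j ≡ new i j
  below i j with ℕP.<-≤-connex j (suc r)
  ... | inj₂ sr≤j = colsBelow-≥ (suc r) old new i j sr≤j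
  ... | inj₁ j<sr with ℕP.<-≤-connex j r
  ...   | inj₁ j<r = trans (colsBelow-< _ old new i j j<sr) (trans (if<-yes j r _ _ j<r) (sym (if<-yes j (suc r) _ _ j<sr)))
  ...   | inj₂ r≤j = trans (colsBelow-< _ old new i j j<sr)
                       (trans (if<-no j r _ _ r≤j) (trans (cong (λ k → G k i j) (sym j≡r)) (sym (if<-yes j (suc r) _ _ j<sr))))
    where
    j≡r : j ≡ r
    j≡r = ℕP.≤-antisym (ℕP.≤-pred j<sr) r≤j
  old-col : ∀ t i d → d < suc t → r ≤ d → colsBelow (suc t) old new i d ≡ G r i d
  old-col t i d d<st r≤d = trans (colsBelow-< (suc t) old new i d d<st) (if<-no d r _ _ r≤d)
  new-col : ∀ t i → suc r ≤ t → colsBelow t old new i t ≡ G (suc r) i t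
  new-col t i sr≤t = trans (colsBelow-at t old new i) (if<-no t (suc r) _ _ sr≤t)
  sweep : ∀ t → suc r ≤ t → t < n → detℕ n (colsBelow t old new) ≡ detℕ n (colsBelow (suc t) old new)
  sweep (suc t) (s≤s r≤t) t<n with ℕP.m≤n⇒m<n∨m≡n r≤t
  ... | inj₂ refl = detℕ-add-col-multiple n (suc r) r t<n r<n ℕP.1+n≢n 1ℚ _ _
    (λ i j _ _ j≢t → colsBelow-off (suc r) old new i j j≢t)
    (λ i _ → trans (new-col (suc r) i ℕP.≤-refl) (trans (step-diag r i)
               (sym (cong₂ (λ a b → a + 1ℚ · b) (old-col (suc r) i (suc r) (ℕP.n<1+n (suc r)) (ℕP.n≤1+n r))
                                                 (old-col (suc r) i r (ℕP.m<n⇒m<1+n (ℕP.n<1+n r)) ℕP.≤-refl)))))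
  ... | inj₁ (s≤s {n = s} r≤s) = detℕ-add-two-col-multiples n (suc (suc s)) (suc s) s t<n s+1<n s<n
    ℕP.1+n≢n (ℕP.<⇒≢ (ℕP.<-trans (ℕP.n<1+n s) (ℕP.n<1+n (suc s))) ∘ sym) (1ℚ + 1ℚ) 1ℚ _ _
    (λ i j _ _ j≢t → colsBelow-off (suc (suc s)) old new i j j≢t)
    (λ i _ → trans (new-col (suc (suc s)) i (s≤s (ℕP.m≤n⇒m≤1+n r≤s))) (trans (step r i s)
               (sym (cong₃ (λ a b c → (a + (1ℚ + 1ℚ) · b) + 1ℚ · c)
                 (old-col (suc (suc s)) i (suc (suc s)) (ℕP.n<1+n _) (ℕP.m≤n⇒m≤1+n (ℕP.m≤n⇒m≤1+n r≤s)))
                 (old-col (suc (suc s)) i (suc s) (ℕP.m<n⇒m<1+n (ℕP.n<1+n _)) (ℕP.m≤n⇒m≤1+n r≤s))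
                 (old-col (suc (suc s)) i s (ℕP.m<n⇒m<1+n (ℕP.m<n⇒m<1+n (ℕP.n<1+n s))) r≤s)))))
    where
    s+1<n : suc s < n
    s+1<n = ℕP.<-trans (ℕP.n<1+n (suc s)) t<n
    s<n : s < n
    s<n = ℕP.<-trans (ℕP.n<1+n s) s+1<n

Tℕ : ℕ → ℚ → Matrixℕ
Tℕ m x i j = binom (x + ℕ→ℚ m) ((ℤ.+ j) ℤ.- (ℤ.+ i) ℤ.+ (ℤ.+ m)) - binom (x + ℕ→ℚ m) ((ℤ.+ m) ℤ.- (ℤ.+ i) ℤ.- (ℤ.+ j) ℤ.- (ℤ.+ 1))

stageMatrix-zero : ∀ m x i j → stageMatrix (G m x) 0 i j ≡ Tℕ m x i j
stageMatrix-zero m x i j = trans (if<-no j 0 (G m x j i j) _ z≤n)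
  (cong₃ (λ z a b → binom z a - binom z b) (ℚP.+-identityʳ (x + ℕ→ℚ m)) (index₁ (ℤ.+ m) (ℤ.+ i) (ℤ.+ j)) (index₂ (ℤ.+ m) (ℤ.+ i) (ℤ.+ j)))
  where
  index₁ : ∀ M I J → M ℤ.- I ℤ.+ J ≡ J ℤ.- I ℤ.+ M
  index₁ = ℤ-Solver.solve-∀
  index₂ : ∀ M I J → M ℤ.- I ℤ.+ (ℤ.+ 0 ℤ.+ ℤ.+ 0 ℤ.- ℤ.+ 1 ℤ.- J) ≡ M ℤ.- I ℤ.- J ℤ.- ℤ.+ 1
  index₂ = ℤ-Solver.solve-∀

stageMatrix-final : ∀ n m x i j → j < n → stageMatrix (G m x) n i j ≡ Bᵀ m x i j
stageMatrix-final n m x i j j<n = trans (if<-yes j n _ _ j<n)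
  (cong₂ (λ a b → binom (top m x j) a - binom (top m x j) b) (index₁ (ℤ.+ m) (ℤ.+ i) (ℤ.+ j)) (index₂ (ℤ.+ m) (ℤ.+ i) (ℤ.+ j)))
  where
  index₁ : ∀ M I J → M ℤ.- I ℤ.+ J ≡ J ℤ.- I ℤ.+ M
  index₁ = ℤ-Solver.solve-∀
  index₂ : ∀ M I J → M ℤ.- I ℤ.+ (J ℤ.+ J ℤ.- ℤ.+ 1 ℤ.- J) ≡ J ℤ.- I ℤ.+ M ℤ.- ℤ.+ 1
  index₂ = ℤ-Solver.solve-∀

detℕ-stageMatrix : ∀ n m x r → r ≤ n → detℕ n (stageMatrix (G m x) 0) ≡ detℕ n (stageMatrix (G m x) r)
detℕ-stageMatrix n m x zero    _    = refl
detℕ-stageMatrix n m x (suc r) r<n = trans (detℕ-stageMatrix n m x r (ℕP.<⇒≤ r<n))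
                                           (detℕ-stageMatrix-suc (G m x) (G-step-diag m x) (G-step m x) n r r<n)

detℕ-T≡Bᵀ : ∀ n m x → detℕ n (Tℕ m x) ≡ detℕ n (Bᵀ m x)
detℕ-T≡Bᵀ n m x = begin
  detℕ n (Tℕ m x)                 ≡⟨ detℕ-cong n _ _ (λ i j _ _ → sym (stageMatrix-zero m x i j)) ⟩
  detℕ n (stageMatrix (G m x) 0)  ≡⟨ detℕ-stageMatrix n m x n ℕP.≤-refl ⟩
  detℕ n (stageMatrix (G m x) n)  ≡⟨ detℕ-cong n _ _ (λ i j _ j<n → stageMatrix-final n m x i j j<n) ⟩
  detℕ n (Bᵀ m x)                 ∎
  where open ≡-Reasoning

-- The product formula for x > 0

aₓ : ℚ → ℕ → ℚ
aₓ x l = x + ℕ→ℚ l + 1ℚ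

bₘ : ℕ → ℕ → ℚ
bₘ m l = ℕ→ℚ m - ℕ→ℚ l + 1ℚ

Kₓ : ℕ → ℕ → ℚ → Matrixℕ
Kₓ n m x = krattMatrix n (aₓ x) (bₘ m)

ρ : ℕ → ℕ → ℚ → ℚ
ρ m n x = ℕ→ℚ (n !) · ∏ n (λ a → x + ℕ→ℚ n + ℕ→ℚ (suc a) - ℕ→ℚ m)

krattConst : ℕ → ℕ → ℚ → ℚ
krattConst m n x = ∏ n (λ i → aₓ x (suc i) - bₘ m (suc i)) · ℕ→ℚ (n !)

detKₓ-shift-step : ∀ m n x → detℕ (suc n) (Kₓ (suc n) m x) ≡ krattConst m n x · detℕ n (Kₓ n m (x + 1ℚ))
detKₓ-shift-step m n x = trans (detℕ-krattMatrix-step n (aₓ x) (bₘ m)) (cong (krattConst m n x ·_) (detℕ-cong n _ _ (λ i k _ _ → entry i k)))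
  where
  aₓ-suc : ∀ l → aₓ x (suc l) ≡ aₓ (x + 1ℚ) l
  aₓ-suc l = trans (cong (λ z → x + z + 1ℚ) (ℕ→ℚ-suc l)) (regroup x (ℕ→ℚ l))
    where
    regroup : ∀ x a → x + (a + 1ℚ) + 1ℚ ≡ x + 1ℚ + a + 1ℚ
    regroup = solve-∀ ℚ-ring
  entry : ∀ i k → krattMatrix n (λ l → aₓ x (suc l)) (bₘ m) i k ≡ Kₓ n m (x + 1ℚ) i k
  entry i k = cong (_· factorsB (bₘ m) i (ℕ→ℚ k)) (factorsA-cong _ _ (suc i) (n ∸ suc i) (ℕ→ℚ k) aₓ-suc)

detKₓ-step : ∀ m n x → detℕ (suc n) (Kₓ (suc n) m x) ≡ ρ m n x · detℕ n (Kₓ n m x)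
detKₓ-step m zero x = trans (detKₓ-shift-step m 0 x) (cong (_· 1ℚ) (ℚP.*-comm 1ℚ (ℕ→ℚ 1)))
detKₓ-step m (suc n) x = begin
  detℕ (suc (suc n)) (Kₓ (suc (suc n)) m x) ≡⟨ detKₓ-shift-step m (suc n) x ⟩
  krattConst m (suc n) x · detℕ (suc n) (Kₓ (suc n) m (x + 1ℚ))
    ≡⟨ cong (krattConst m (suc n) x ·_) (detKₓ-step m n (x + 1ℚ)) ⟩
  krattConst m (suc n) x · (ρ m n (x + 1ℚ) · D)
    ≡⟨ cong₂ (λ u v → (∏f · fₙ) · u · (v · D)) (ℕ→ℚ-!-suc n) ρ-shift ⟩
  ((∏f · fₙ) · (1+n · n!)) · ((n! · ∏g) · D) ≡⟨ regroup ∏f fₙ 1+n n! ∏g D ⟩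
  ((1+n · n!) · (∏g · fₙ)) · ((∏f · n!) · D)
    ≡⟨ cong₂ (λ u z → (u · (∏g · z)) · ((∏f · n!) · D)) (sym (ℕ→ℚ-!-suc n)) fₙ≡gₙ ⟩
  ρ m (suc n) x · (krattConst m n x · D) ≡⟨ cong (ρ m (suc n) x ·_) (sym (detKₓ-shift-step m n x)) ⟩
  ρ m (suc n) x · detℕ (suc n) (Kₓ (suc n) m x) ∎
  where
  open ≡-Reasoning
  D = detℕ n (Kₓ n m (x + 1ℚ))
  f : ℕ → ℚ
  f i = aₓ x (suc i) - bₘ m (suc i)
  g : ℕ → ℚ
  g a = x + ℕ→ℚ (suc n) + ℕ→ℚ (suc a) - ℕ→ℚ m
  ∏f = ∏ n f
  ∏g = ∏ n g
  fₙ = f n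
  1+n = ℕ→ℚ (suc n)
  n! = ℕ→ℚ (n !)
  ρ-shift : ρ m n (x + 1ℚ) ≡ n! · ∏g
  ρ-shift = cong (n! ·_) (∏-cong n _ _ (λ a _ → trans (cong (λ z → z - ℕ→ℚ m) (regroup x (ℕ→ℚ n) (ℕ→ℚ (suc a))))
                                           (cong (λ z → x + z + ℕ→ℚ (suc a) - ℕ→ℚ m) (sym (ℕ→ℚ-suc n)))))
    where
    regroup : ∀ x n a → x + 1ℚ + n + a ≡ x + (n + 1ℚ) + a
    regroup = solve-∀ ℚ-ring
  fₙ≡gₙ : fₙ ≡ g n
  fₙ≡gₙ = regroup x (ℕ→ℚ (suc n)) (ℕ→ℚ m)
    where
    regroup : ∀ x s m → (x + s + 1ℚ) - (m - s + 1ℚ) ≡ x + s + s - m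
    regroup = solve-∀ ℚ-ring
  regroup : ∀ a b c d e D → ((a · b) · (c · d)) · ((d · e) · D) ≡ ((c · d) · (e · b)) · ((a · d) · D)
  regroup = solve-∀ ℚ-ring

factorsB-bₘ≡falling : ∀ m k i → factorsB (bₘ m) i (ℕ→ℚ k) ≡ falling (ℕ→ℚ (m ℕ.+ k)) i
factorsB-bₘ≡falling m k zero = refl
factorsB-bₘ≡falling m k (suc i) = cong₂ _·_ (factorsB-bₘ≡falling m k i) (begin
  ℕ→ℚ k + (ℕ→ℚ m - ℕ→ℚ (suc i) + 1ℚ) ≡⟨ cong (λ w → ℕ→ℚ k + (ℕ→ℚ m - w + 1ℚ)) (ℕ→ℚ-suc i) ⟩
  ℕ→ℚ k + (ℕ→ℚ m - (ℕ→ℚ i + 1ℚ) + 1ℚ) ≡⟨ regroup (ℕ→ℚ k) (ℕ→ℚ m) (ℕ→ℚ i) ⟩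
  ℕ→ℚ m + ℕ→ℚ k - ℕ→ℚ i ≡⟨ cong (_- ℕ→ℚ i) (sym (ℕ→ℚ-+ m k)) ⟩
  ℕ→ℚ (m ℕ.+ k) - ℕ→ℚ i ∎)
  where
  open ≡-Reasoning
  regroup : ∀ k m i → k + (m - (i + 1ℚ) + 1ℚ) ≡ m + k - i
  regroup = solve-∀ ℚ-ring

factorsA-aₓ≡rising : ∀ x a len X → factorsA (aₓ x) a len X ≡ rising (X + x + ℕ→ℚ a + 1ℚ) len
factorsA-aₓ≡rising x a zero X = refl
factorsA-aₓ≡rising x a (suc len) X = cong₂ _·_ (regroup X x (ℕ→ℚ a)) (trans (factorsA-aₓ≡rising x (suc a) len X) (cong (λ w → rising w len) shift))
  where
  regroup : ∀ X x a → X + (x + a + 1ℚ) ≡ X + x + a + 1ℚ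
  regroup = solve-∀ ℚ-ring
  regroup₂ : ∀ X x a → X + x + (a + 1ℚ) + 1ℚ ≡ X + x + a + 1ℚ + 1ℚ
  regroup₂ = solve-∀ ℚ-ring
  shift : X + x + ℕ→ℚ (suc a) + 1ℚ ≡ X + x + ℕ→ℚ a + 1ℚ + 1ℚ
  shift = trans (cong (λ w → X + x + w + 1ℚ) (ℕ→ℚ-suc a)) (regroup₂ X x (ℕ→ℚ a))

bColFactor : ℕ → ℕ → ℚ → ℕ → ℚ
bColFactor n m x k = ℕ→ℚ ((m ℕ.+ k) !) · rising (x + 1ℚ) (k ℕ.+ n)

kRowFactor : ℕ → ℚ → ℕ → ℚ
kRowFactor m x i = x - ℕ→ℚ m + ℕ→ℚ (2 * i) + 1ℚ

kColFactor : ℕ → ℚ → ℕ → ℚ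
kColFactor m x k = rising (x + 1ℚ) (m ℕ.+ 2 * k)

Bᵀ-⊖ : ∀ m x i k → Bᵀ m x i k ≡ binom (top m x k) ((k ℕ.+ m) ⊖ i) - binom (top m x k) ((k ℕ.+ m) ⊖ suc i)
Bᵀ-⊖ m x i k = cong₂ (λ a b → binom (top m x k) a - binom (top m x k) b) (idx1 k i m) (idx2 k i m)

ℕ→ℚ-!-factorsB : ∀ m k i → i ≤ k ℕ.+ m → ℕ→ℚ ((m ℕ.+ k) !) ≡ factorsB (bₘ m) i (ℕ→ℚ k) · ℕ→ℚ ((k ℕ.+ m ∸ i) !)
ℕ→ℚ-!-factorsB m k i i≤km = begin
  ℕ→ℚ ((m ℕ.+ k) !)
    ≡⟨ !≡falling·! (m ℕ.+ k) i (subst (i ≤_) (ℕP.+-comm k m) i≤km) ⟩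
  falling (ℕ→ℚ (m ℕ.+ k)) i · ℕ→ℚ ((m ℕ.+ k ∸ i) !)
    ≡⟨ cong₂ (λ a b → a · ℕ→ℚ ((b ∸ i) !)) (sym (factorsB-bₘ≡falling m k i)) (ℕP.+-comm m k) ⟩
  factorsB (bₘ m) i (ℕ→ℚ k) · ℕ→ℚ ((k ℕ.+ m ∸ i) !) ∎
  where open ≡-Reasoning

Kₓ≡rising·factorsB : ∀ n m x i k → Kₓ n m x i k ≡ rising (x + 1ℚ + ℕ→ℚ (k ℕ.+ suc i)) (n ∸ suc i) · factorsB (bₘ m) i (ℕ→ℚ k)
Kₓ≡rising·factorsB n m x i k = cong (_· factorsB (bₘ m) i (ℕ→ℚ k))
  (trans (factorsA-aₓ≡rising x (suc i) (n ∸ suc i) (ℕ→ℚ k)) (cong (λ z → rising z (n ∸ suc i)) start))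
  where
  start : ℕ→ℚ k + x + ℕ→ℚ (suc i) + 1ℚ ≡ x + 1ℚ + ℕ→ℚ (k ℕ.+ suc i)
  start = trans (regroup (ℕ→ℚ k) x (ℕ→ℚ (suc i))) (cong (x + 1ℚ +_) (sym (ℕ→ℚ-+ k (suc i))))
    where
    regroup : ∀ k x s → k + x + s + 1ℚ ≡ x + 1ℚ + (k + s)
    regroup = solve-∀ ℚ-ring

rising-bColFactor-split : ∀ n x k i → i < n
  → rising (x + 1ℚ) (k ℕ.+ n) ≡ rising (x + 1ℚ) (k ℕ.+ suc i) · rising (x + 1ℚ + ℕ→ℚ (k ℕ.+ suc i)) (n ∸ suc i)
rising-bColFactor-split n x k i i<n =
  trans (cong (rising (x + 1ℚ)) (trans (cong (k ℕ.+_) (sym (ℕP.m∸n+n≡m i<n))) (reassoc k (n ∸ suc i) i)))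
        (rising-+ (k ℕ.+ suc i) (n ∸ suc i) (x + 1ℚ))
  where
  reassoc : ∀ k L i → k ℕ.+ (L ℕ.+ suc i) ≡ k ℕ.+ suc i ℕ.+ L
  reassoc = ℕ-Solver.solve-∀

scaled-entries-below : ∀ n m x i k → k ℕ.+ m < i
  → Bᵀ m x i k · bColFactor n m x k ≡ kRowFactor m x i · (Kₓ n m x i k · kColFactor m x k)
scaled-entries-below n m x i k km<i = begin
  Bᵀ m x i k · bColFactor n m x k                        ≡⟨ cong (_· bColFactor n m x k) Bᵀ≡0 ⟩
  0ℚ · bColFactor n m x k                                ≡⟨ ℚP.*-zeroˡ (bColFactor n m x k) ⟩
  0ℚ                                                     ≡⟨ sym (trans (cong (λ z → kRowFactor m x i · (z · kColFactor m x k)) Kₓ≡0)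
                                                                      (zeros (kRowFactor m x i) (kColFactor m x k))) ⟩
  kRowFactor m x i · (Kₓ n m x i k · kColFactor m x k)   ∎
  where
  open ≡-Reasoning
  Bᵀ≡0 : Bᵀ m x i k ≡ 0ℚ
  Bᵀ≡0 = trans (Bᵀ-⊖ m x i k) (cong₂ _-_ (binom-⊖-< _ _ _ km<i) (binom-⊖-< _ _ _ (ℕP.m<n⇒m<1+n km<i)))
  Kₓ≡0 : Kₓ n m x i k ≡ 0ℚ
  Kₓ≡0 = trans (cong (factorsA (aₓ x) (suc i) (n ∸ suc i) (ℕ→ℚ k) ·_)
                 (trans (factorsB-bₘ≡falling m k i) (falling-ℕ-zero (m ℕ.+ k) i (subst (_< i) (ℕP.+-comm k m) km<i))))
               (ℚP.*-zeroʳ (factorsA (aₓ x) (suc i) (n ∸ suc i) (ℕ→ℚ k)))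
  zeros : ∀ r v → r · (0ℚ · v) ≡ 0ℚ
  zeros = solve-∀ ℚ-ring

rising-diagonal : ∀ m x k → rising (x + 1ℚ) (k ℕ.+ suc (k ℕ.+ m)) ≡ kColFactor m x k · kRowFactor m x (k ℕ.+ m)
rising-diagonal m x k = begin
  rising (x + 1ℚ) (k ℕ.+ suc (k ℕ.+ m))                        ≡⟨ cong (rising (x + 1ℚ)) (reorder k m) ⟩
  rising (x + 1ℚ) (suc (m ℕ.+ 2 * k))                          ≡⟨ rising-suc (m ℕ.+ 2 * k) (x + 1ℚ) ⟩
  kColFactor m x k · (x + 1ℚ + ℕ→ℚ (m ℕ.+ 2 * k))              ≡⟨ cong (kColFactor m x k ·_) last-factor ⟩
  kColFactor m x k · kRowFactor m x (k ℕ.+ m)                  ∎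
  where
  open ≡-Reasoning
  reorder : ∀ k m → k ℕ.+ suc (k ℕ.+ m) ≡ suc (m ℕ.+ 2 * k)
  reorder = ℕ-Solver.solve-∀
  last-factor : x + 1ℚ + ℕ→ℚ (m ℕ.+ 2 * k) ≡ x - ℕ→ℚ m + ℕ→ℚ (2 * (k ℕ.+ m)) + 1ℚ
  last-factor = begin
    x + 1ℚ + ℕ→ℚ (m ℕ.+ 2 * k)
      ≡⟨ cong (x + 1ℚ +_) (trans (ℕ→ℚ-+ m (2 * k)) (cong (ℕ→ℚ m +_) (ℕ→ℚ-2* k))) ⟩
    x + 1ℚ + (ℕ→ℚ m + (ℕ→ℚ k + ℕ→ℚ k))             ≡⟨ regroup x (ℕ→ℚ m) (ℕ→ℚ k) ⟩
    x - ℕ→ℚ m + ((ℕ→ℚ k + ℕ→ℚ m) + (ℕ→ℚ k + ℕ→ℚ m)) + 1ℚ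
      ≡⟨ cong (λ z → x - ℕ→ℚ m + (z + z) + 1ℚ) (sym (ℕ→ℚ-+ k m)) ⟩
    x - ℕ→ℚ m + (ℕ→ℚ (k ℕ.+ m) + ℕ→ℚ (k ℕ.+ m)) + 1ℚ
      ≡⟨ cong (λ z → x - ℕ→ℚ m + z + 1ℚ) (sym (ℕ→ℚ-2* (k ℕ.+ m))) ⟩
    x - ℕ→ℚ m + ℕ→ℚ (2 * (k ℕ.+ m)) + 1ℚ          ∎
    where
    regroup : ∀ x m k → x + 1ℚ + (m + (k + k)) ≡ x - m + ((k + m) + (k + m)) + 1ℚ
    regroup = solve-∀ ℚ-ring

scaled-entries-diagonal : ∀ n m x k → k ℕ.+ m < n
  → Bᵀ m x (k ℕ.+ m) k · bColFactor n m x k ≡ kRowFactor m x (k ℕ.+ m) · (Kₓ n m x (k ℕ.+ m) k · kColFactor m x k)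
scaled-entries-diagonal n m x k i<n = begin
  Bᵀ m x i k · (ℕ→ℚ ((m ℕ.+ k) !) · rising (x + 1ℚ) (k ℕ.+ n))  ≡⟨ cong₃ (λ a b c → a · (b · c)) Bᵀ≡1 (ℕ→ℚ-!-factorsB m k i ℕP.≤-refl)
                                                                            (rising-bColFactor-split n x k i i<n) ⟩
  1ℚ · ((F · ℕ→ℚ ((i ∸ i) !)) · (rising (x + 1ℚ) j · RL))
    ≡⟨ cong (λ z → 1ℚ · ((F · ℕ→ℚ (z !)) · (z' · RL))) (ℕP.n∸n≡0 i) ⟩
  1ℚ · ((F · 1ℚ) · (z' · RL))
    ≡⟨ cong (λ z → 1ℚ · ((F · 1ℚ) · (z · RL))) (rising-diagonal m x k) ⟩
  1ℚ · ((F · 1ℚ) · ((kColFactor m x k · r) · RL))                ≡⟨ regroup F (kColFactor m x k) r RL ⟩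
  r · ((RL · F) · kColFactor m x k)
    ≡⟨ cong (λ z → r · (z · kColFactor m x k)) (sym (Kₓ≡rising·factorsB n m x i k)) ⟩
  r · (Kₓ n m x i k · kColFactor m x k)                          ∎
  where
  open ≡-Reasoning
  i = k ℕ.+ m
  j = k ℕ.+ suc i
  z' = rising (x + 1ℚ) j
  F = factorsB (bₘ m) i (ℕ→ℚ k)
  RL = rising (x + 1ℚ + ℕ→ℚ j) (n ∸ suc i)
  r = kRowFactor m x i
  Bᵀ≡1 : Bᵀ m x i k ≡ 1ℚ
  Bᵀ≡1 = trans (Bᵀ-⊖ m x i k) (cong₂ _-_ (cong (binom (top m x k)) (ℤP.n⊖n≡0 i)) (binom-⊖-< _ i (suc i) (ℕP.n<1+n i)))
  regroup : ∀ F v r R → 1ℚ · ((F · 1ℚ) · ((v · r) · R)) ≡ r · ((R · F) · v)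
  regroup = solve-∀ ℚ-ring

module AboveDiagonal (m : ℕ) (x : ℚ) (i k : ℕ) (i<km : i < k ℕ.+ m) where

  j K : ℕ
  j = k ℕ.+ suc i
  K = k ℕ.+ m ∸ suc i

  ℕ→ℚ-K : ℕ→ℚ K ≡ ℕ→ℚ k + ℕ→ℚ m - (ℕ→ℚ i + 1ℚ)
  ℕ→ℚ-K = trans (ℕ→ℚ-∸ (k ℕ.+ m) (suc i) i<km) (cong₂ _-_ (ℕ→ℚ-+ k m) (ℕ→ℚ-suc i))

  ℕ→ℚ-j : ℕ→ℚ j ≡ ℕ→ℚ k + (ℕ→ℚ i + 1ℚ)
  ℕ→ℚ-j = trans (ℕ→ℚ-+ k (suc i)) (cong (ℕ→ℚ k +_) (ℕ→ℚ-suc i))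

  top≡ : top m x k ≡ ℕ→ℚ k + ℕ→ℚ m + ℕ→ℚ k + x
  top≡ = trans (cong (x + ℕ→ℚ m +_) (ℕ→ℚ-2* k)) (regroup x (ℕ→ℚ m) (ℕ→ℚ k))
    where
    regroup : ∀ x m k → x + m + (k + k) ≡ k + m + k + x
    regroup = solve-∀ ℚ-ring

  Bᵀ≡binomℕ-Δ : Bᵀ m x i k ≡ binomℕ (top m x k) (suc K) - binomℕ (top m x k) K
  Bᵀ≡binomℕ-Δ = trans (Bᵀ-⊖ m x i k)
    (cong₂ _-_ (trans (binom-⊖-≥ _ (k ℕ.+ m) i (ℕP.<⇒≤ i<km)) (cong (binomℕ _) (ℕP.+-∸-assoc 1 i<km)))
               (binom-⊖-≥ _ (k ℕ.+ m) (suc i) i<km))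

  falling-top : falling (top m x k) K ≡ rising (x + 1ℚ + ℕ→ℚ j) K
  falling-top = begin
    falling (top m x k) K                   ≡⟨ cong (λ z → falling z K) top≡x+j+K ⟩
    falling (x + ℕ→ℚ j + ℕ→ℚ K) K           ≡⟨ falling≡rising K (x + ℕ→ℚ j) ⟩
    rising (x + ℕ→ℚ j + 1ℚ) K               ≡⟨ cong (λ z → rising z K) (x+j+1≡x+1+j x (ℕ→ℚ j)) ⟩
    rising (x + 1ℚ + ℕ→ℚ j) K               ∎
    where
    open ≡-Reasoning
    x+j+1≡x+1+j : ∀ x j → x + j + 1ℚ ≡ x + 1ℚ + j
    x+j+1≡x+1+j = solve-∀ ℚ-ring
    top≡x+j+K : top m x k ≡ x + ℕ→ℚ j + ℕ→ℚ K
    top≡x+j+K = trans top≡ (trans (regroup (ℕ→ℚ k) (ℕ→ℚ m) x (ℕ→ℚ i)) (sym (cong₂ (λ a b → x + a + b) ℕ→ℚ-j ℕ→ℚ-K)))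
      where
      regroup : ∀ k m x i → k + m + k + x ≡ x + (k + (i + 1ℚ)) + (k + m - (i + 1ℚ))
      regroup = solve-∀ ℚ-ring

  top-2K-1≡kRowFactor : top m x k - ℕ→ℚ K - ℕ→ℚ K - 1ℚ ≡ kRowFactor m x i
  top-2K-1≡kRowFactor = begin
    top m x k - ℕ→ℚ K - ℕ→ℚ K - 1ℚ   ≡⟨ cong₂ (λ a b → a - b - b - 1ℚ) top≡ ℕ→ℚ-K ⟩
    (ℕ→ℚ k + ℕ→ℚ m + ℕ→ℚ k + x) - (ℕ→ℚ k + ℕ→ℚ m - (ℕ→ℚ i + 1ℚ)) - (ℕ→ℚ k + ℕ→ℚ m - (ℕ→ℚ i + 1ℚ)) - 1ℚ
                                      ≡⟨ regroup (ℕ→ℚ k) (ℕ→ℚ m) x (ℕ→ℚ i) ⟩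
    x - ℕ→ℚ m + (ℕ→ℚ i + ℕ→ℚ i) + 1ℚ ≡⟨ cong (λ z → x - ℕ→ℚ m + z + 1ℚ) (sym (ℕ→ℚ-2* i)) ⟩
    kRowFactor m x i                  ∎
    where
    open ≡-Reasoning
    regroup : ∀ k m x i → (k + m + k + x) - (k + m - (i + 1ℚ)) - (k + m - (i + 1ℚ)) - 1ℚ ≡ x - m + (i + i) + 1ℚ
    regroup = solve-∀ ℚ-ring

  kColFactor-split : kColFactor m x k ≡ rising (x + 1ℚ) j · rising (x + 1ℚ + ℕ→ℚ j) K
  kColFactor-split = trans (cong (rising (x + 1ℚ)) m+2k≡j+K) (rising-+ j K (x + 1ℚ))
    where
    m+2k≡j+K : m ℕ.+ 2 * k ≡ j ℕ.+ K
    m+2k≡j+K = trans (reorder₁ m k) (trans (cong (k ℕ.+_) (sym (ℕP.m∸n+n≡m i<km))) (reorder₂ k K i))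
      where
      reorder₁ : ∀ m k → m ℕ.+ 2 * k ≡ k ℕ.+ (k ℕ.+ m)
      reorder₁ = ℕ-Solver.solve-∀
      reorder₂ : ∀ k K i → k ℕ.+ (K ℕ.+ suc i) ≡ k ℕ.+ suc i ℕ.+ K
      reorder₂ = ℕ-Solver.solve-∀

scaled-entries-above : ∀ n m x i k → i < n → i < k ℕ.+ m
  → Bᵀ m x i k · bColFactor n m x k ≡ kRowFactor m x i · (Kₓ n m x i k · kColFactor m x k)
scaled-entries-above n m x i k i<n i<km = begin
  Bᵀ m x i k · (ℕ→ℚ ((m ℕ.+ k) !) · rising (x + 1ℚ) (k ℕ.+ n))
    ≡⟨ cong₃ (λ a b c → a · (b · c)) Bᵀ≡binomℕ-Δ (ℕ→ℚ-!-factorsB m k i (ℕP.<⇒≤ i<km)) (rising-bColFactor-split n x k i i<n) ⟩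
  (binomℕ X (suc K) - binomℕ X K) · ((F · ℕ→ℚ ((k ℕ.+ m ∸ i) !)) · (Rj · RL))
    ≡⟨ cong (λ z → (binomℕ X (suc K) - binomℕ X K) · ((F · ℕ→ℚ (z !)) · (Rj · RL))) (ℕP.+-∸-assoc 1 i<km) ⟩
  (binomℕ X (suc K) - binomℕ X K) · ((F · ℕ→ℚ (suc K !)) · (Rj · RL))
    ≡⟨ regroup₁ (binomℕ X (suc K) - binomℕ X K) F (ℕ→ℚ (suc K !)) Rj RL ⟩
  ((binomℕ X (suc K) - binomℕ X K) · ℕ→ℚ (suc K !)) · F · Rj · RL
    ≡⟨ cong (λ z → z · F · Rj · RL) (binomℕ-Δ·! X K) ⟩
  (falling X K · (X - ℕ→ℚ K - ℕ→ℚ K - 1ℚ)) · F · Rj · RL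
    ≡⟨ cong₂ (λ a b → (a · b) · F · Rj · RL) falling-top top-2K-1≡kRowFactor ⟩
  (RK · kRowFactor m x i) · F · Rj · RL
    ≡⟨ regroup₂ RK (kRowFactor m x i) F Rj RL ⟩
  kRowFactor m x i · ((RL · F) · (Rj · RK))
    ≡⟨ cong₂ (λ a b → kRowFactor m x i · (a · b)) (sym (Kₓ≡rising·factorsB n m x i k)) (sym kColFactor-split) ⟩
  kRowFactor m x i · (Kₓ n m x i k · kColFactor m x k) ∎
  where
  open ≡-Reasoning
  open AboveDiagonal m x i k i<km
  X = top m x k
  F = factorsB (bₘ m) i (ℕ→ℚ k)
  Rj = rising (x + 1ℚ) j
  RL = rising (x + 1ℚ + ℕ→ℚ j) (n ∸ suc i)
  RK = rising (x + 1ℚ + ℕ→ℚ j) K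
  regroup₁ : ∀ c b f p r → c · ((b · f) · (p · r)) ≡ (c · f) · b · p · r
  regroup₁ = solve-∀ ℚ-ring
  regroup₂ : ∀ R r b p l → (R · r) · b · p · l ≡ r · ((l · b) · (p · R))
  regroup₂ = solve-∀ ℚ-ring

scaled-entries : ∀ n m x i k → i < n
  → Bᵀ m x i k · bColFactor n m x k ≡ kRowFactor m x i · (Kₓ n m x i k · kColFactor m x k)
scaled-entries n m x i k i<n with ℕP.<-cmp (k ℕ.+ m) i
... | tri< km<i _ _ = scaled-entries-below n m x i k km<i
... | tri≈ _ refl _ = scaled-entries-diagonal n m x k i<n
... | tri> _ _ i<km = scaled-entries-above n m x i k i<n i<km

detℕ-Bᵀ-scaled : ∀ n m x → detℕ n (Bᵀ m x) · ∏ n (bColFactor n m x)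
  ≡ (∏ n (kRowFactor m x) · ∏ n (kColFactor m x)) · detℕ n (Kₓ n m x)
detℕ-Bᵀ-scaled n m x = begin
  detℕ n (Bᵀ m x) · ∏ n (bColFactor n m x) ≡⟨ ℚP.*-comm (detℕ n (Bᵀ m x)) _ ⟩
  ∏ n (bColFactor n m x) · detℕ n (Bᵀ m x) ≡⟨ sym (detℕ-scale-cols n (bColFactor n m x) (Bᵀ m x)) ⟩
  detℕ n (λ i k → Bᵀ m x i k · bColFactor n m x k)
    ≡⟨ detℕ-cong n _ _ (λ i k i<n _ → scaled-entries n m x i k i<n) ⟩
  detℕ n (λ i k → kRowFactor m x i · (Kₓ n m x i k · kColFactor m x k))
    ≡⟨ detℕ-scale-rows n (kRowFactor m x) (λ i k → Kₓ n m x i k · kColFactor m x k) ⟩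
  ∏ n (kRowFactor m x) · detℕ n (λ i k → Kₓ n m x i k · kColFactor m x k)
    ≡⟨ cong (∏ n (kRowFactor m x) ·_) (detℕ-scale-cols n (kColFactor m x) (Kₓ n m x)) ⟩
  ∏ n (kRowFactor m x) · (∏ n (kColFactor m x) · detℕ n (Kₓ n m x))
    ≡⟨ sym (ℚP.*-assoc (∏ n (kRowFactor m x)) _ _) ⟩
  (∏ n (kRowFactor m x) · ∏ n (kColFactor m x)) · detℕ n (Kₓ n m x) ∎
  where open ≡-Reasoning

∏₁-cong : ∀ m (f g : ℕ → ℚ) → (∀ j → f j ≡ g j) → ∏₁ m f ≡ ∏₁ m g
∏₁-cong zero f g h = refl
∏₁-cong (suc m) f g h = cong₂ _·_ (∏₁-cong m f g h) (h (suc m))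

∏₁-· : ∀ m (f g : ℕ → ℚ) → ∏₁ m (λ j → f j · g j) ≡ ∏₁ m f · ∏₁ m g
∏₁-· zero f g = refl
∏₁-· (suc m) f g = trans (cong (_· (f (suc m) · g (suc m))) (∏₁-· m f g)) (regroup (∏₁ m f) (∏₁ m g) (f (suc m)) (g (suc m)))
  where
  regroup : ∀ a b c d → (a · b) · (c · d) ≡ (a · c) · (b · d)
  regroup = solve-∀ ℚ-ring

∏₁-descending : ∀ m a → ∏₁ m (λ j → a - ℕ→ℚ j) ≡ rising (a - ℕ→ℚ m) m
∏₁-descending zero a = refl
∏₁-descending (suc m) a = begin
  ∏₁ m (λ j → a - ℕ→ℚ j) · (a - ℕ→ℚ (suc m)) ≡⟨ cong (_· (a - ℕ→ℚ (suc m))) (∏₁-descending m a) ⟩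
  rising (a - ℕ→ℚ m) m · (a - ℕ→ℚ (suc m)) ≡⟨ ℚP.*-comm (rising (a - ℕ→ℚ m) m) _ ⟩
  (a - ℕ→ℚ (suc m)) · rising (a - ℕ→ℚ m) m ≡⟨ cong (λ z → (a - ℕ→ℚ (suc m)) · rising z m) shift ⟩
  rising (a - ℕ→ℚ (suc m)) (suc m) ∎
  where
  open ≡-Reasoning
  regroup : ∀ a m → a - m ≡ a - (m + 1ℚ) + 1ℚ
  regroup = solve-∀ ℚ-ring
  shift : a - ℕ→ℚ m ≡ a - ℕ→ℚ (suc m) + 1ℚ
  shift = trans (regroup a (ℕ→ℚ m)) (cong (λ z → a - z + 1ℚ) (sym (ℕ→ℚ-suc m)))

∏₁-ascending : ∀ m a → ∏₁ m (λ j → a + ℕ→ℚ j) ≡ rising (a + 1ℚ) m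
∏₁-ascending zero a = refl
∏₁-ascending (suc m) a = begin
  ∏₁ m (λ j → a + ℕ→ℚ j) · (a + ℕ→ℚ (suc m)) ≡⟨ cong₂ _·_ (∏₁-ascending m a) (cong (a +_) (ℕ→ℚ-suc m)) ⟩
  rising (a + 1ℚ) m · (a + (ℕ→ℚ m + 1ℚ)) ≡⟨ cong (rising (a + 1ℚ) m ·_) (regroup a (ℕ→ℚ m)) ⟩
  rising (a + 1ℚ) m · (a + 1ℚ + ℕ→ℚ m) ≡⟨ sym (rising-suc m (a + 1ℚ)) ⟩
  rising (a + 1ℚ) (suc m) ∎
  where
  open ≡-Reasoning
  regroup : ∀ a m → a + (m + 1ℚ) ≡ a + 1ℚ + m
  regroup = solve-∀ ℚ-ring

∏≡rising : ∀ n c → ∏ n (λ k → c + ℕ→ℚ k) ≡ rising c n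
∏≡rising zero c = refl
∏≡rising (suc n) c = trans (cong (_· (c + ℕ→ℚ n)) (∏≡rising n c)) (sym (rising-suc n c))

!-+≡!·rising : ∀ n m → ℕ→ℚ ((n ℕ.+ m) !) ≡ ℕ→ℚ (n !) · rising (ℕ→ℚ n + 1ℚ) m
!-+≡!·rising n zero = trans (cong (λ z → ℕ→ℚ (z !)) (ℕP.+-identityʳ n)) (sym (ℚP.*-identityʳ _))
!-+≡!·rising n (suc m) = begin
  ℕ→ℚ ((n ℕ.+ suc m) !) ≡⟨ cong (λ z → ℕ→ℚ (z !)) (ℕP.+-suc n m) ⟩
  ℕ→ℚ (suc (n ℕ.+ m) !) ≡⟨ ℕ→ℚ-!-suc (n ℕ.+ m) ⟩
  ℕ→ℚ (suc (n ℕ.+ m)) · ℕ→ℚ ((n ℕ.+ m) !)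
    ≡⟨ cong₂ _·_ (trans (ℕ→ℚ-suc (n ℕ.+ m)) (cong (_+ 1ℚ) (ℕ→ℚ-+ n m))) (!-+≡!·rising n m) ⟩
  (ℕ→ℚ n + ℕ→ℚ m + 1ℚ) · (ℕ→ℚ (n !) · rising (ℕ→ℚ n + 1ℚ) m)
    ≡⟨ regroup (ℕ→ℚ n) (ℕ→ℚ m) (ℕ→ℚ (n !)) (rising (ℕ→ℚ n + 1ℚ) m) ⟩
  ℕ→ℚ (n !) · (rising (ℕ→ℚ n + 1ℚ) m · (ℕ→ℚ n + 1ℚ + ℕ→ℚ m))
    ≡⟨ cong (ℕ→ℚ (n !) ·_) (sym (rising-suc m (ℕ→ℚ n + 1ℚ))) ⟩
  ℕ→ℚ (n !) · rising (ℕ→ℚ n + 1ℚ) (suc m) ∎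
  where
  open ≡-Reasoning
  regroup : ∀ n m f r → (n + m + 1ℚ) · (f · r) ≡ f · (r · (n + 1ℚ + m))
  regroup = solve-∀ ℚ-ring

numFactor : ℚ → ℕ → ℕ → ℚ
numFactor x i j = (x + ℕ→ℚ i - ℕ→ℚ j) · (x + ℕ→ℚ (2 * i) + ℕ→ℚ j - ℕ→ℚ 2)

denFactor : ℚ → ℕ → ℕ → ℚ
denFactor x i j = (x + ℕ→ℚ (2 * i) - ℕ→ℚ j) · (ℕ→ℚ i + ℕ→ℚ j - 1ℚ)

numRow : ℚ → ℕ → ℕ → ℚ
numRow x m i = ∏₁ m (numFactor x i)

denRow : ℚ → ℕ → ℕ → ℚ
denRow x m i = ∏₁ m (denFactor x i)

denRow≡rising : ∀ x m n → denRow x m (suc n) ≡ rising (x + ℕ→ℚ (2 * suc n) - ℕ→ℚ m) m · rising (ℕ→ℚ n + 1ℚ) m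
denRow≡rising x m n = trans (∏₁-· m _ _) (cong₂ _·_ (∏₁-descending m (x + ℕ→ℚ (2 * suc n)))
  (trans (∏₁-cong m _ (λ j → ℕ→ℚ n + ℕ→ℚ j) (λ j → trans (cong (λ z → z + ℕ→ℚ j - 1ℚ) (ℕ→ℚ-suc n)) (regroup (ℕ→ℚ n) (ℕ→ℚ j)))) (∏₁-ascending m (ℕ→ℚ n))))
  where
  regroup : ∀ n j → n + 1ℚ + j - 1ℚ ≡ n + j
  regroup = solve-∀ ℚ-ring

numRow≡rising : ∀ x m n → numRow x m (suc n) ≡ rising (x + ℕ→ℚ (suc n) - ℕ→ℚ m) m · rising (x + ℕ→ℚ (2 * suc n) - ℕ→ℚ 2 + 1ℚ) m
numRow≡rising x m n = trans (∏₁-· m _ _) (cong₂ _·_ (∏₁-descending m (x + ℕ→ℚ (suc n)))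
  (trans (∏₁-cong m _ (λ j → (x + ℕ→ℚ (2 * suc n) - ℕ→ℚ 2) + ℕ→ℚ j) (λ j → regroup x (ℕ→ℚ (2 * suc n)) (ℕ→ℚ j) (ℕ→ℚ 2))) (∏₁-ascending m (x + ℕ→ℚ (2 * suc n) - ℕ→ℚ 2))))
  where
  regroup : ∀ x a j t → x + a + j - t ≡ (x + a - t) + j
  regroup = solve-∀ ℚ-ring

ρ≡rising : ∀ m n x → ρ m n x ≡ ℕ→ℚ (n !) · rising (x + ℕ→ℚ n + 1ℚ - ℕ→ℚ m) n
ρ≡rising m n x = cong (ℕ→ℚ (n !) ·_) (trans (∏-cong n _ (λ a → (x + ℕ→ℚ n + 1ℚ - ℕ→ℚ m) + ℕ→ℚ a)
  (λ a _ → trans (cong (λ z → x + ℕ→ℚ n + z - ℕ→ℚ m) (ℕ→ℚ-suc a)) (regroup x (ℕ→ℚ n) (ℕ→ℚ a) (ℕ→ℚ m)))) (∏≡rising n _))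
  where
  regroup : ∀ x n a m → x + n + (a + 1ℚ) - m ≡ (x + n + 1ℚ - m) + a
  regroup = solve-∀ ℚ-ring

∏-bColFactor-suc : ∀ n m x → ∏ (suc n) (bColFactor (suc n) m x)
  ≡ (∏ n (bColFactor n m x) · rising (x + 1ℚ + ℕ→ℚ n) n) · (ℕ→ℚ ((m ℕ.+ n) !) · rising (x + 1ℚ) (n ℕ.+ suc n))
∏-bColFactor-suc n m x = cong (_· (ℕ→ℚ ((m ℕ.+ n) !) · rising (x + 1ℚ) (n ℕ.+ suc n)))
  (trans (∏-cong n _ _ (λ k _ → bColFactor-suc k)) (trans (∏-· n (bColFactor n m x) _) (cong (∏ n (bColFactor n m x) ·_) (∏≡rising n _))))
  where
  regroup : ∀ f r x n k → f · (r · (x + 1ℚ + (k + n))) ≡ (f · r) · (x + 1ℚ + n + k)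
  regroup = solve-∀ ℚ-ring
  bColFactor-suc : ∀ k → bColFactor (suc n) m x k ≡ bColFactor n m x k · (x + 1ℚ + ℕ→ℚ n + ℕ→ℚ k)
  bColFactor-suc k = begin
    ℕ→ℚ ((m ℕ.+ k) !) · rising (x + 1ℚ) (k ℕ.+ suc n)
      ≡⟨ cong (λ z → ℕ→ℚ ((m ℕ.+ k) !) · rising (x + 1ℚ) z) (ℕP.+-suc k n) ⟩
    ℕ→ℚ ((m ℕ.+ k) !) · rising (x + 1ℚ) (suc (k ℕ.+ n))
      ≡⟨ cong (ℕ→ℚ ((m ℕ.+ k) !) ·_) (rising-suc (k ℕ.+ n) (x + 1ℚ)) ⟩
    ℕ→ℚ ((m ℕ.+ k) !) · (rising (x + 1ℚ) (k ℕ.+ n) · (x + 1ℚ + ℕ→ℚ (k ℕ.+ n)))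
      ≡⟨ cong (λ z → ℕ→ℚ ((m ℕ.+ k) !) · (rising (x + 1ℚ) (k ℕ.+ n) · (x + 1ℚ + z))) (ℕ→ℚ-+ k n) ⟩
    ℕ→ℚ ((m ℕ.+ k) !) · (rising (x + 1ℚ) (k ℕ.+ n) · (x + 1ℚ + (ℕ→ℚ k + ℕ→ℚ n)))
      ≡⟨ regroup (ℕ→ℚ ((m ℕ.+ k) !)) (rising (x + 1ℚ) (k ℕ.+ n)) x (ℕ→ℚ n) (ℕ→ℚ k) ⟩
    bColFactor n m x k · (x + 1ℚ + ℕ→ℚ n + ℕ→ℚ k) ∎
    where open ≡-Reasoning

module RisingIdentity (n m : ℕ) (x : ℚ) where

  open ≡-Reasoning
  N M z row col c : ℚ
  N = ℕ→ℚ n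
  M = ℕ→ℚ m
  z = x + N + 1ℚ - M
  row = kRowFactor m x n
  col = kColFactor m x n
  c = x + 1ℚ + ℕ→ℚ (n ℕ.+ n)
  ℕ→ℚ-2*suc : ℕ→ℚ (2 * suc n) ≡ (N + 1ℚ) + (N + 1ℚ)
  ℕ→ℚ-2*suc = trans (ℕ→ℚ-2* (suc n)) (cong₂ _+_ (ℕ→ℚ-suc n) (ℕ→ℚ-suc n))
  ℕ→ℚ-2*n : ℕ→ℚ (2 * n) ≡ N + N
  ℕ→ℚ-2*n = ℕ→ℚ-2* n
  ℕ→ℚ-2 : ℕ→ℚ 2 ≡ 1ℚ + 1ℚ
  ℕ→ℚ-2 = ℕ→ℚ-suc 1
  ℕ→ℚ-n+n : ℕ→ℚ (n ℕ.+ n) ≡ N + N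
  ℕ→ℚ-n+n = ℕ→ℚ-+ n n
  ℕ→ℚ-n+m : ℕ→ℚ (n ℕ.+ m) ≡ N + M
  ℕ→ℚ-n+m = ℕ→ℚ-+ n m
  top₂-M≡row+1 : x + ℕ→ℚ (2 * suc n) - M ≡ row + 1ℚ
  top₂-M≡row+1 = trans (cong (λ w → x + w - M) ℕ→ℚ-2*suc) (trans (regroup x N M) (cong (λ w → x - M + w + 1ℚ + 1ℚ) (sym ℕ→ℚ-2*n)))
    where
    regroup : ∀ x N M → x + ((N + 1ℚ) + (N + 1ℚ)) - M ≡ x - M + (N + N) + 1ℚ + 1ℚ
    regroup = solve-∀ ℚ-ring
  z+N≡row : z + N ≡ row
  z+N≡row = trans (regroup x N M) (cong (λ w → x - M + w + 1ℚ) (sym ℕ→ℚ-2*n))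
    where
    regroup : ∀ x N M → x + N + 1ℚ - M + N ≡ x - M + (N + N) + 1ℚ
    regroup = solve-∀ ℚ-ring
  z+n+m≡c : z + ℕ→ℚ (n ℕ.+ m) ≡ c
  z+n+m≡c = trans (cong (z +_) ℕ→ℚ-n+m) (trans (regroup x N M) (cong (λ w → x + 1ℚ + w) (sym ℕ→ℚ-n+n)))
    where
    regroup : ∀ x N M → x + N + 1ℚ - M + (N + M) ≡ x + 1ℚ + (N + N)
    regroup = solve-∀ ℚ-ring
  x+suc-n-M≡z : x + ℕ→ℚ (suc n) - M ≡ z
  x+suc-n-M≡z = trans (cong (λ w → x + w - M) (ℕ→ℚ-suc n)) (regroup x N M)
    where
    regroup : ∀ x N M → x + (N + 1ℚ) - M ≡ x + N + 1ℚ - M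
    regroup = solve-∀ ℚ-ring
  x+1+N≡z+M : x + 1ℚ + N ≡ z + M
  x+1+N≡z+M = regroup x N M
    where
    regroup : ∀ x N M → x + 1ℚ + N ≡ x + N + 1ℚ - M + M
    regroup = solve-∀ ℚ-ring
  c≡top₂-2+1 : x + ℕ→ℚ (2 * suc n) - ℕ→ℚ 2 + 1ℚ ≡ c
  c≡top₂-2+1 = trans (cong₂ (λ u v → x + u - v + 1ℚ) ℕ→ℚ-2*suc ℕ→ℚ-2) (trans (regroup x N) (cong (λ w → x + 1ℚ + w) (sym ℕ→ℚ-n+n)))
    where
    regroup : ∀ x N → x + ((N + 1ℚ) + (N + 1ℚ)) - (1ℚ + 1ℚ) + 1ℚ ≡ x + 1ℚ + (N + N)
    regroup = solve-∀ ℚ-ring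
  m+2n≡n+n+m : m ℕ.+ 2 * n ≡ (n ℕ.+ n) ℕ.+ m
  m+2n≡n+n+m = reorder m n
    where
    reorder : ∀ m n → m ℕ.+ 2 * n ≡ (n ℕ.+ n) ℕ.+ m
    reorder = ℕ-Solver.solve-∀
  regroup₁ : ∀ r v a b → r · v · a · b ≡ v · (a · (r · b))
  regroup₁ = solve-∀ ℚ-ring
  lhs-normal : row · col · rising z n · rising (x + ℕ→ℚ (2 * suc n) - M) m
    ≡ rising (x + 1ℚ) ((n ℕ.+ n) ℕ.+ m) · (rising z (m ℕ.+ n) · c)
  lhs-normal = begin
    row · col · rising z n · rising (x + ℕ→ℚ (2 * suc n) - M) m
      ≡⟨ cong (λ w → row · col · rising z n · rising w m) top₂-M≡row+1 ⟩
    row · col · rising z n · rising (row + 1ℚ) m ≡⟨ regroup₁ row col (rising z n) (rising (row + 1ℚ) m) ⟩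
    col · (rising z n · rising row (suc m))
      ≡⟨ cong (λ w → col · (rising z n · rising w (suc m))) (sym z+N≡row) ⟩
    col · (rising z n · rising (z + N) (suc m)) ≡⟨ cong (col ·_) (sym (rising-+ n (suc m) z)) ⟩
    col · rising z (n ℕ.+ suc m) ≡⟨ cong (λ w → col · rising z w) (ℕP.+-suc n m) ⟩
    col · rising z (suc (n ℕ.+ m)) ≡⟨ cong (col ·_) (rising-suc (n ℕ.+ m) z) ⟩
    col · (rising z (n ℕ.+ m) · (z + ℕ→ℚ (n ℕ.+ m)))
      ≡⟨ cong₂ (λ u w → col · (rising z u · w)) (ℕP.+-comm n m) z+n+m≡c ⟩
    col · (rising z (m ℕ.+ n) · c) ≡⟨ cong (λ w → rising (x + 1ℚ) w · (rising z (m ℕ.+ n) · c)) m+2n≡n+n+m ⟩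
    rising (x + 1ℚ) ((n ℕ.+ n) ℕ.+ m) · (rising z (m ℕ.+ n) · c) ∎
  regroup₂ : ∀ a b t p c → a · b · t · (p · c) ≡ (a · t) · (p · b) · c
  regroup₂ = solve-∀ ℚ-ring
  regroup₃ : ∀ a b c → a · b · c ≡ b · (a · c)
  regroup₃ = solve-∀ ℚ-ring
  rhs-normal : rising (x + ℕ→ℚ (suc n) - M) m · rising (x + ℕ→ℚ (2 * suc n) - ℕ→ℚ 2 + 1ℚ) m · rising (x + 1ℚ + N) n · rising (x + 1ℚ) (n ℕ.+ suc n)
      ≡ rising (x + 1ℚ) ((n ℕ.+ n) ℕ.+ m) · (rising z (m ℕ.+ n) · c)
  rhs-normal = begin
    rising (x + ℕ→ℚ (suc n) - M) m · rising (x + ℕ→ℚ (2 * suc n) - ℕ→ℚ 2 + 1ℚ) m · rising (x + 1ℚ + N) n · rising (x + 1ℚ) (n ℕ.+ suc n)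
      ≡⟨ cong₂ (λ u v → rising u m · rising v m · rising (x + 1ℚ + N) n · rising (x + 1ℚ) (n ℕ.+ suc n)) x+suc-n-M≡z c≡top₂-2+1 ⟩
    rising z m · rising c m · rising (x + 1ℚ + N) n · rising (x + 1ℚ) (n ℕ.+ suc n)
      ≡⟨ cong₂ (λ u v → rising z m · rising c m · rising u n · rising (x + 1ℚ) v) x+1+N≡z+M (ℕP.+-suc n n) ⟩
    rising z m · rising c m · rising (z + M) n · rising (x + 1ℚ) (suc (n ℕ.+ n))
      ≡⟨ cong (rising z m · rising c m · rising (z + M) n ·_) (rising-suc (n ℕ.+ n) (x + 1ℚ)) ⟩
    rising z m · rising c m · rising (z + M) n · (rising (x + 1ℚ) (n ℕ.+ n) · c)
      ≡⟨ regroup₂ (rising z m) (rising c m) (rising (z + M) n) (rising (x + 1ℚ) (n ℕ.+ n)) c ⟩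
    (rising z m · rising (z + M) n) · (rising (x + 1ℚ) (n ℕ.+ n) · rising c m) · c
      ≡⟨ cong₂ (λ u v → u · v · c) (sym (rising-+ m n z)) (sym (rising-+ (n ℕ.+ n) m (x + 1ℚ))) ⟩
    rising z (m ℕ.+ n) · rising (x + 1ℚ) ((n ℕ.+ n) ℕ.+ m) · c
      ≡⟨ regroup₃ (rising z (m ℕ.+ n)) (rising (x + 1ℚ) ((n ℕ.+ n) ℕ.+ m)) c ⟩
    rising (x + 1ℚ) ((n ℕ.+ n) ℕ.+ m) · (rising z (m ℕ.+ n) · c) ∎

rising-identity : ∀ n m x
  → kRowFactor m x n · kColFactor m x n · rising (x + ℕ→ℚ n + 1ℚ - ℕ→ℚ m) n · rising (x + ℕ→ℚ (2 * suc n) - ℕ→ℚ m) m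
  ≡ rising (x + ℕ→ℚ (suc n) - ℕ→ℚ m) m · rising (x + ℕ→ℚ (2 * suc n) - ℕ→ℚ 2 + 1ℚ) m · rising (x + 1ℚ + ℕ→ℚ n) n · rising (x + 1ℚ) (n ℕ.+ suc n)
rising-identity n m x = trans lhs-normal (sym rhs-normal)
  where open RisingIdentity n m x

scalars-step : ∀ n m x
  → (∏ (suc n) (kRowFactor m x) · ∏ (suc n) (kColFactor m x)) · ρ m n x · denRow x m (suc n) · ∏ n (bColFactor n m x)
    ≡ (∏ n (kRowFactor m x) · ∏ n (kColFactor m x)) · numRow x m (suc n) · ∏ (suc n) (bColFactor (suc n) m x)
scalars-step n m x = begin
  ((∏r · rₙ) · (∏v · vₙ)) · ρ m n x · denRow x m (suc n) · ∏w
    ≡⟨ cong₂ (λ u v → ((∏r · rₙ) · (∏v · vₙ)) · u · v · ∏w) (ρ≡rising m n x) (denRow≡rising x m n) ⟩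
  ((∏r · rₙ) · (∏v · vₙ)) · (n! · ρ′) · (den₁ · den₂) · ∏w
    ≡⟨ regroup₁ ∏r rₙ ∏v vₙ n! ρ′ den₁ den₂ ∏w ⟩
  (∏r · ∏v · ∏w · n! · den₂) · (rₙ · vₙ · ρ′ · den₁)
    ≡⟨ cong ((∏r · ∏v · ∏w · n! · den₂) ·_) (rising-identity n m x) ⟩
  (∏r · ∏v · ∏w · n! · den₂) · (num₁ · num₂ · w₁ · w₂)
    ≡⟨ regroup₂ ∏r ∏v ∏w n! den₂ num₁ num₂ w₁ w₂ ⟩
  (∏r · ∏v) · (num₁ · num₂) · ((∏w · w₁) · ((n! · den₂) · w₂))
    ≡⟨ cong₂ (λ u v → (∏r · ∏v) · u · ((∏w · w₁) · (v · w₂))) (sym (numRow≡rising x m n)) (sym m+n!) ⟩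
  (∏r · ∏v) · numRow x m (suc n) · ((∏w · w₁) · (ℕ→ℚ ((m ℕ.+ n) !) · w₂))
    ≡⟨ cong ((∏r · ∏v) · numRow x m (suc n) ·_) (sym (∏-bColFactor-suc n m x)) ⟩
  (∏r · ∏v) · numRow x m (suc n) · ∏ (suc n) (bColFactor (suc n) m x) ∎
  where
  open ≡-Reasoning
  ∏r = ∏ n (kRowFactor m x)
  ∏v = ∏ n (kColFactor m x)
  rₙ = kRowFactor m x n
  vₙ = kColFactor m x n
  ∏w = ∏ n (bColFactor n m x)
  n! = ℕ→ℚ (n !)
  ρ′ = rising (x + ℕ→ℚ n + 1ℚ - ℕ→ℚ m) n
  den₁ = rising (x + ℕ→ℚ (2 * suc n) - ℕ→ℚ m) m
  den₂ = rising (ℕ→ℚ n + 1ℚ) m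
  num₁ = rising (x + ℕ→ℚ (suc n) - ℕ→ℚ m) m
  num₂ = rising (x + ℕ→ℚ (2 * suc n) - ℕ→ℚ 2 + 1ℚ) m
  w₁ = rising (x + 1ℚ + ℕ→ℚ n) n
  w₂ = rising (x + 1ℚ) (n ℕ.+ suc n)
  m+n! : ℕ→ℚ ((m ℕ.+ n) !) ≡ n! · den₂
  m+n! = trans (cong (λ w → ℕ→ℚ (w !)) (ℕP.+-comm m n)) (!-+≡!·rising n m)
  regroup₁ : ∀ ∏r rₙ ∏v vₙ n! ρ′ den₁ den₂ ∏w → ((∏r · rₙ) · (∏v · vₙ)) · (n! · ρ′) · (den₁ · den₂) · ∏w
    ≡ (∏r · ∏v · ∏w · n! · den₂) · (rₙ · vₙ · ρ′ · den₁)
  regroup₁ = solve-∀ ℚ-ring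
  regroup₂ : ∀ ∏r ∏v ∏w n! den₂ num₁ num₂ w₁ w₂ → (∏r · ∏v · ∏w · n! · den₂) · (num₁ · num₂ · w₁ · w₂)
    ≡ (∏r · ∏v) · (num₁ · num₂) · ((∏w · w₁) · ((n! · den₂) · w₂))
  regroup₂ = solve-∀ ℚ-ring

∏-bColFactor-pos : ∀ n m x → 0ℚ ℚ.< x → 0ℚ ℚ.< ∏ n (bColFactor n m x)
∏-bColFactor-pos n m x px = ∏-pos n _ (λ k → pos·pos (ℕ→ℚ-!-pos (m ℕ.+ k)) (rising-pos (k ℕ.+ n) (x + 1ℚ) (pos+nonNeg px 0≤1)))

-- For x > 0 the column factors are positive and can be cancelled.
detℕ-Bᵀ-step : ∀ n m x → 0ℚ ℚ.< x → detℕ (suc n) (Bᵀ m x) · denRow x m (suc n) ≡ detℕ n (Bᵀ m x) · numRow x m (suc n)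
detℕ-Bᵀ-step n m x px = ·-cancelʳ _ _ (W1 · W) scaled (pos⇒≢0 (pos·pos (∏-bColFactor-pos (suc n) m x px) (∏-bColFactor-pos n m x px)))
  where
  open ≡-Reasoning
  dC1 = detℕ (suc n) (Bᵀ m x)
  dC = detℕ n (Bᵀ m x)
  W1 = ∏ (suc n) (bColFactor (suc n) m x)
  W = ∏ n (bColFactor n m x)
  V1 = ∏ (suc n) (kRowFactor m x) · ∏ (suc n) (kColFactor m x)
  V = ∏ n (kRowFactor m x) · ∏ n (kColFactor m x)
  dK1 = detℕ (suc n) (Kₓ (suc n) m x)
  dK = detℕ n (Kₓ n m x)
  dn = denRow x m (suc n)
  nm = numRow x m (suc n)
  r = ρ m n x
  regroup₁ : ∀ a d b c → (a · d) · (b · c) ≡ (a · b) · d · c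
  regroup₁ = solve-∀ ℚ-ring
  regroup₂ : ∀ V r k d W → V · (r · k) · d · W ≡ (V · r · d · W) · k
  regroup₂ = solve-∀ ℚ-ring
  regroup₃ : ∀ V k n W → (V · k) · n · W ≡ (V · n · W) · k
  regroup₃ = solve-∀ ℚ-ring
  regroup₄ : ∀ a n b c → (a · n) · (b · c) ≡ (a · c) · n · b
  regroup₄ = solve-∀ ℚ-ring
  scaled : (dC1 · dn) · (W1 · W) ≡ (dC · nm) · (W1 · W)
  scaled = begin
    (dC1 · dn) · (W1 · W) ≡⟨ regroup₁ dC1 dn W1 W ⟩
    (dC1 · W1) · dn · W ≡⟨ cong (λ z → z · dn · W) (detℕ-Bᵀ-scaled (suc n) m x) ⟩
    V1 · dK1 · dn · W ≡⟨ cong (λ z → V1 · z · dn · W) (detKₓ-step m n x) ⟩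
    V1 · (r · dK) · dn · W ≡⟨ regroup₂ V1 r dK dn W ⟩
    (V1 · r · dn · W) · dK ≡⟨ cong (_· dK) (scalars-step n m x) ⟩
    (V · nm · W1) · dK ≡⟨ sym (regroup₃ V dK nm W1) ⟩
    (V · dK) · nm · W1 ≡⟨ cong (λ z → z · nm · W1) (sym (detℕ-Bᵀ-scaled n m x)) ⟩
    (dC · W) · nm · W1 ≡⟨ sym (regroup₄ dC nm W1 W) ⟩
    (dC · nm) · (W1 · W) ∎

detℕ-Bᵀ·den≡num : ∀ n m x → 0ℚ ℚ.< x → detℕ n (Bᵀ m x) · ∏₁ n (denRow x m) ≡ ∏₁ n (numRow x m)
detℕ-Bᵀ·den≡num zero m x px = ℚP.*-identityˡ 1ℚ
detℕ-Bᵀ·den≡num (suc n) m x px = begin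
  dC1 · (∏₁ n (denRow x m) · denRow x m (suc n)) ≡⟨ regroup₁ dC1 (∏₁ n (denRow x m)) (denRow x m (suc n)) ⟩
  (dC1 · denRow x m (suc n)) · ∏₁ n (denRow x m) ≡⟨ cong (_· ∏₁ n (denRow x m)) (detℕ-Bᵀ-step n m x px) ⟩
  (dC · numRow x m (suc n)) · ∏₁ n (denRow x m) ≡⟨ regroup₂ dC (numRow x m (suc n)) (∏₁ n (denRow x m)) ⟩
  (dC · ∏₁ n (denRow x m)) · numRow x m (suc n) ≡⟨ cong (_· numRow x m (suc n)) (detℕ-Bᵀ·den≡num n m x px) ⟩
  ∏₁ n (numRow x m) · numRow x m (suc n) ∎
  where
  open ≡-Reasoning
  dC1 = detℕ (suc n) (Bᵀ m x)
  dC = detℕ n (Bᵀ m x)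
  regroup₁ : ∀ a b c → a · (b · c) ≡ (a · c) · b
  regroup₁ = solve-∀ ℚ-ring
  regroup₂ : ∀ a b c → (a · b) · c ≡ (a · c) · b
  regroup₂ = solve-∀ ℚ-ring

-- All rational x

IsPoly-∑ : ∀ n (f : ℚ → ℕ → ℚ) → (∀ k → IsPoly (λ x → f x k)) → IsPoly (λ x → ∑ n (f x))
IsPoly-∑ zero f h = IsPoly-const 0ℚ
IsPoly-∑ (suc n) f h = IsPoly-+ (λ x → f x 0) (λ x → ∑ n (λ k → f x (suc k))) (h 0) (IsPoly-∑ n (λ x k → f x (suc k)) (λ k → h (suc k)))

IsPoly-∏₁ : ∀ n (f : ℚ → ℕ → ℚ) → (∀ k → IsPoly (λ x → f x k)) → IsPoly (λ x → ∏₁ n (f x))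
IsPoly-∏₁ zero f h = IsPoly-const 1ℚ
IsPoly-∏₁ (suc n) f h = IsPoly-· (λ x → ∏₁ n (f x)) (λ x → f x (suc n)) (IsPoly-∏₁ n f h) (h (suc n))

IsPoly-detℕ : ∀ n (A : ℚ → Matrixℕ) → (∀ i j → IsPoly (λ x → A x i j)) → IsPoly (λ x → detℕ n (A x))
IsPoly-detℕ zero A h = IsPoly-const 1ℚ
IsPoly-detℕ (suc n) A h = IsPoly-∑ (suc n) (λ x j → sign j · A x 0 j · detℕ n (minor (A x) j)) λ j →
  IsPoly-· (λ x → sign j · A x 0 j) (λ x → detℕ n (minor (A x) j)) (IsPoly-scale (sign j) (λ x → A x 0 j) (h 0 j))
    (IsPoly-detℕ n (λ x → minor (A x) j) (λ r c → h (suc r) (punchInℕ j c)))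

Poly-binomℕ : ∀ c k → Poly k (λ x → binomℕ (x + c) k)
Poly-binomℕ c zero = Poly-const 0 1ℚ
Poly-binomℕ c (suc k) = ConstΔ^-Δ⁻ (Poly-cong k (λ x → binomℕ (x + c) k) _ (λ x → sym (Δbinom x)) (Poly-binomℕ c k))
  where
  a+b-a≡b : ∀ a b → (a + b) - a ≡ b
  a+b-a≡b = solve-∀ ℚ-ring
  x+1+c≡x+c+1 : ∀ x c → x + 1ℚ + c ≡ x + c + 1ℚ
  x+1+c≡x+c+1 = solve-∀ ℚ-ring
  Δbinom : ∀ x → Δ (λ y → binomℕ (y + c) (suc k)) x ≡ binomℕ (x + c) k
  Δbinom x = trans (cong (λ w → binomℕ w (suc k) - binomℕ (x + c) (suc k)) (x+1+c≡x+c+1 x c))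
          (trans (cong (_- binomℕ (x + c) (suc k)) (binomℕ-pascal (x + c) k)) (a+b-a≡b (binomℕ (x + c) (suc k)) (binomℕ (x + c) k)))

IsPoly-binom : ∀ c K → IsPoly (λ x → binom (x + c) K)
IsPoly-binom c (ℤ.+ k) = k , Poly-binomℕ c k
IsPoly-binom c -[1+ t ] = IsPoly-const 0ℚ

IsPoly-Tℕ : ∀ m i j → IsPoly (λ x → Tℕ m x i j)
IsPoly-Tℕ m i j = IsPoly-- _ _ (IsPoly-binom (ℕ→ℚ m) ((ℤ.+ j) ℤ.- (ℤ.+ i) ℤ.+ (ℤ.+ m))) (IsPoly-binom (ℕ→ℚ m) ((ℤ.+ m) ℤ.- (ℤ.+ i) ℤ.- (ℤ.+ j) ℤ.- (ℤ.+ 1)))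

IsPoly-x+a-b : ∀ a b → IsPoly (λ x → x + a - b)
IsPoly-x+a-b a b = IsPoly-- (λ x → x + a) (λ _ → b) (IsPoly-x+c a) (IsPoly-const b)

IsPoly-numFactor : ∀ i j → IsPoly (λ x → numFactor x i j)
IsPoly-numFactor i j = IsPoly-· _ _ (IsPoly-x+a-b (ℕ→ℚ i) (ℕ→ℚ j))
  (IsPoly-- (λ x → x + ℕ→ℚ (2 * i) + ℕ→ℚ j) (λ _ → ℕ→ℚ 2) (IsPoly-+ (λ x → x + ℕ→ℚ (2 * i)) (λ _ → ℕ→ℚ j) (IsPoly-x+c _) (IsPoly-const _)) (IsPoly-const _))

IsPoly-denFactor : ∀ i j → IsPoly (λ x → denFactor x i j)
IsPoly-denFactor i j = IsPoly-· _ _ (IsPoly-x+a-b (ℕ→ℚ (2 * i)) (ℕ→ℚ j)) (IsPoly-const _)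

defect : ℕ → ℕ → ℚ → ℚ
defect n m x = detℕ n (Tℕ m x) · ∏₁ n (denRow x m) - ∏₁ n (numRow x m)

IsPoly-defect : ∀ n m → IsPoly (defect n m)
IsPoly-defect n m = IsPoly-- _ _ (IsPoly-· _ _ (IsPoly-detℕ n (Tℕ m) (IsPoly-Tℕ m)) (IsPoly-∏₁ n (λ x i → denRow x m i) (λ i → IsPoly-∏₁ m (λ x j → denFactor x i j) (λ j → IsPoly-denFactor i j))))
  (IsPoly-∏₁ n (λ x i → numRow x m i) (λ i → IsPoly-∏₁ m (λ x j → numFactor x i j) (λ j → IsPoly-numFactor i j)))

archimedean : ∀ x → Σ ℕ (λ K → ∀ k → K ≤ k → 0ℚ ℚ.< x + ℕ→ℚ k)
archimedean (mkℚ (ℤ.+ a) d c) = 1 , λ { (suc k) _ → nonNeg+pos (ℚP.nonNegative⁻¹ (mkℚ (ℤ.+ a) d c)) (ℕ→ℚ-suc-pos k) }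
archimedean (mkℚ -[1+ a ] d c) = suc (suc a) , λ k K≤k → subst (0ℚ ℚ.<_) (sym (x+k-split k K≤k)) (nonNeg+pos 0≤N-q (k-pos k K≤k))
  where
  q = mkℚ (ℤ.+ suc a) d c
  N = ℕ→ℚ (suc a)
  q≤N : q ℚ.≤ N
  q≤N = subst (q ℚ.≤_) (sym (ℕ→ℚ≡mkℚ (suc a))) (ℚ.*≤* (subst₂ ℤ._≤_ (ℤP.pos-* (suc a) 1) (ℤP.pos-* (suc a) (suc d)) (ℤ.+≤+ (ℕP.*-monoʳ-≤ (suc a) (s≤s z≤n)))))
  0≤N-q : 0ℚ ℚ.≤ N - q
  0≤N-q = subst (ℚ._≤ N - q) (ℚP.+-inverseʳ q) (ℚP.+-monoˡ-≤ (- q) q≤N)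
  k-pos : ∀ k → suc (suc a) ≤ k → 0ℚ ℚ.< ℕ→ℚ (k ∸ suc a)
  k-pos k K≤k = subst (λ w → 0ℚ ℚ.< ℕ→ℚ w) (sym (ℕP.+-∸-assoc 1 K≤k)) (ℕ→ℚ-suc-pos (k ∸ suc (suc a)))
  regroup : ∀ q N r → - q + (r + N) ≡ (N - q) + r
  regroup = solve-∀ ℚ-ring
  x+k-split : ∀ k → suc (suc a) ≤ k → mkℚ -[1+ a ] d c + ℕ→ℚ k ≡ (N - q) + ℕ→ℚ (k ∸ suc a)
  x+k-split k K≤k = begin
    - q + ℕ→ℚ k ≡⟨ cong (λ w → - q + ℕ→ℚ w) (sym (ℕP.m∸n+n≡m (ℕP.<⇒≤ K≤k))) ⟩
    - q + ℕ→ℚ (k ∸ suc a ℕ.+ suc a) ≡⟨ cong (- q +_) (ℕ→ℚ-+ (k ∸ suc a) (suc a)) ⟩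
    - q + (ℕ→ℚ (k ∸ suc a) + N) ≡⟨ regroup q N (ℕ→ℚ (k ∸ suc a)) ⟩
    (N - q) + ℕ→ℚ (k ∸ suc a) ∎
    where open ≡-Reasoning

-- Both sides are polynomials in x, and they agree at every x + k > 0.
detℕ-T·den≡num : ∀ n m x → detℕ n (Tℕ m x) · ∏₁ n (denRow x m) ≡ ∏₁ n (numRow x m)
detℕ-T·den≡num n m x = trans (a≡[a-b]+b (detℕ n (Tℕ m x) · ∏₁ n (denRow x m)) (∏₁ n (numRow x m))) (trans (cong (_+ ∏₁ n (numRow x m)) defect≡0) (ℚP.+-identityˡ _))
  where
  a≡[a-b]+b : ∀ a b → a ≡ (a - b) + b
  a≡[a-b]+b = solve-∀ ℚ-ring
  K = proj₁ (archimedean x)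
  defect-pos : ∀ z → 0ℚ ℚ.< z → defect n m z ≡ 0ℚ
  defect-pos z pz = trans (cong (λ w → w · ∏₁ n (denRow z m) - ∏₁ n (numRow z m)) (detℕ-T≡Bᵀ n m z))
              (trans (cong (_- ∏₁ n (numRow z m)) (detℕ-Bᵀ·den≡num n m z pz)) (ℚP.+-inverseʳ (∏₁ n (numRow z m))))
  defect≡0 : defect n m x ≡ 0ℚ
  defect≡0 = Poly-zero-on-tail⇒zero (proj₁ (IsPoly-defect n m)) (defect n m) (proj₂ (IsPoly-defect n m)) x K (λ k K≤k → defect-pos (x + ℕ→ℚ k) (proj₂ (archimedean x) k K≤k))

det-T≡det-B : ∀ n m x → det n (T n m x) ≡ det n (B n m x)
det-T≡det-B n m x = trans (det≡detℕ n (T n m x) (Tℕ m x) (λ i j → refl))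
  (trans (detℕ-T≡Bᵀ n m x) (trans (sym (detℕ-transpose n (Bᵀ m x))) (sym (det≡detℕ n (B n m x) (transpose (Bᵀ m x)) (λ i j → refl)))))

÷′-· : ∀ a b → b ≢ 0ℚ → (a ÷′ b) · b ≡ a
÷′-· a b b≢0 with b ℚP.≟ 0ℚ
... | yes b≡0 = ⊥-elim (b≢0 b≡0)
... | no b≢0' = begin
  (a · ℚ.1/ b) · b ≡⟨ ℚP.*-assoc a (ℚ.1/ b) b ⟩
  a · (ℚ.1/ b · b) ≡⟨ cong (a ·_) (ℚP.*-inverseˡ b) ⟩
  a · 1ℚ ≡⟨ ℚP.*-identityʳ a ⟩
  a ∎
  where
  open ≡-Reasoning
  instance _ = ℚ.≢-nonZero b≢0'

·-≢0 : ∀ a b → a ≢ 0ℚ → b ≢ 0ℚ → a · b ≢ 0ℚ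
·-≢0 a b a≢0 b≢0 e = a≢0 (·-cancelʳ a 0ℚ b (trans e (sym (ℚP.*-zeroˡ b))) b≢0)

∏₁-cong-bounded : ∀ m (f g : ℕ → ℚ) → (∀ j → 1 ≤ j → j ≤ m → f j ≡ g j) → ∏₁ m f ≡ ∏₁ m g
∏₁-cong-bounded zero f g h = refl
∏₁-cong-bounded (suc m) f g h = cong₂ _·_ (∏₁-cong-bounded m f g (λ j a b → h j a (ℕP.m≤n⇒m≤1+n b))) (h (suc m) (s≤s z≤n) ℕP.≤-refl)

∏₁-≢0 : ∀ m (f : ℕ → ℚ) → (∀ j → 1 ≤ j → j ≤ m → f j ≢ 0ℚ) → ∏₁ m f ≢ 0ℚ
∏₁-≢0 zero f h = λ ()
∏₁-≢0 (suc m) f h = ·-≢0 _ _ (∏₁-≢0 m f (λ j a b → h j a (ℕP.m≤n⇒m≤1+n b))) (h (suc m) (s≤s z≤n) ℕP.≤-refl)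

i+j-1≢0 : ∀ i j → 1 ≤ i → 1 ≤ j → ℕ→ℚ i + ℕ→ℚ j - 1ℚ ≢ 0ℚ
i+j-1≢0 (suc i) (suc j) _ _ = pos⇒≢0 (subst (0ℚ ℚ.<_) (sym i+j-1≡) (ℕ→ℚ-suc-pos (i ℕ.+ j)))
  where
  regroup : ∀ a b → (a + 1ℚ) + (b + 1ℚ) - 1ℚ ≡ (a + b) + 1ℚ
  regroup = solve-∀ ℚ-ring
  i+j-1≡ : ℕ→ℚ (suc i) + ℕ→ℚ (suc j) - 1ℚ ≡ ℕ→ℚ (suc (i ℕ.+ j))
  i+j-1≡ = trans (cong₂ (λ u v → u + v - 1ℚ) (ℕ→ℚ-suc i) (ℕ→ℚ-suc j)) (trans (regroup (ℕ→ℚ i) (ℕ→ℚ j))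
        (trans (cong (_+ 1ℚ) (sym (ℕ→ℚ-+ i j))) (sym (ℕ→ℚ-suc (i ℕ.+ j)))))

det-T≡rhs : ∀ n m x → (∀ (i j : ℕ) → 1 ≤ i → i ≤ n → 1 ≤ j → j ≤ m → x + ℕ→ℚ (2 * i) - ℕ→ℚ j ≢ 0ℚ)
  → det n (T n m x) ≡ rhs n m x
det-T≡rhs n m x H = trans (det≡detℕ n (T n m x) (Tℕ m x) (λ i j → refl)) (·-cancelʳ _ _ den (trans (detℕ-T·den≡num n m x) (sym rhs·den≡num)) den≢0)
  where
  den = ∏₁ n (denRow x m)
  denFactor≢0 : ∀ i j → 1 ≤ i → i ≤ n → 1 ≤ j → j ≤ m → denFactor x i j ≢ 0ℚ
  denFactor≢0 i j a b c d = ·-≢0 _ _ (H i j a b c d) (i+j-1≢0 i j a c)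
  den≢0 : den ≢ 0ℚ
  den≢0 = ∏₁-≢0 n (denRow x m) (λ i a b → ∏₁-≢0 m (denFactor x i) (λ j c d → denFactor≢0 i j a b c d))
  rhs·den≡num : rhs n m x · den ≡ ∏₁ n (numRow x m)
  rhs·den≡num = trans (sym (∏₁-· n _ _)) (∏₁-cong-bounded n _ _ (λ i a b →
    trans (sym (∏₁-· m _ _)) (∏₁-cong-bounded m _ _ (λ j c d → ÷′-· (numFactor x i j) (denFactor x i j) (denFactor≢0 i j a b c d)))))

theorem2 : (n m : ℕ) → 1 ≤ n
  → (∀ (x : ℚ) → det n (T n m x) ≡ det n (B n m x))
    × (∀ (x : ℚ)
         → (∀ (i j : ℕ) → 1 ≤ i → i ≤ n → 1 ≤ j → j ≤ m
              → x + ℕ→ℚ (2 * i) - ℕ→ℚ j ≢ 0ℚ)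
         → det n (T n m x) ≡ rhs n m x)
theorem2 n m _ = (λ x → det-T≡det-B n m x) , (λ x H → det-T≡rhs n m x H)
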